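{- Let $d\ge 0$ and $r>d+1$ be integers, and let $z_1,z_2,z_3$ be positive integers with $z_1+z_2+z_3=d+3$. Then $$F=P_r\cap\Big(\bigcap_{i=1}^{z_1-1}H_i\Big)\cap\Big(\bigcap_{j=z_1+z_2}^{r}H_j\Big)\cap\Big(\bigcap_{k=z_1}^{r-z_3}\widehat H_k\Big)$$ is a face of the Kostka polytope $P_r$ of dimension at most $d$ with exactly $z_1z_2z_3$ vertices.
   Context: For a positive integer $r$, a partition with at most $r$ parts is written as a non-increasing $r$-tuple of nonnegative integers; $\mathrm{Par}_r(n)$ is the set of such tuples with entries summing to $n$. For $\lambda,\mu\in\mathrm{Par}_r(n)$, $\lambda$ dominates $\mu$ if $\sum_{i=1}^k\lambda_i\ge\sum_{i=1}^k\mu_i$ for all $k\le r$. The $r$-Kostka cone $\mathcal{K}_r\subseteq\mathbb{R}^{2r}$ is the convex hull of all points $(\lambda_1,\dots,\lambda_r,\mu_1,\dots,\mu_r)$ with $\lambda,\mu\in\mathrm{Par}_r(n)$ for some $n$ and $\lambda$ dominating $\mu$. The Kostka polytope $P_r$ is $\mathcal{K}_r\cap\{x:\sum_{i=1}^r(\lambda_i+\mu_i)=1\}$. In coordinates $(\lambda_1,\dots,\lambda_r,\mu_1,\dots,\mu_r)$ define the hyperplanes $H_i=\{\lambda_i=\lambda_{i+1}\}$ for $1\le i<r$, $H_r=\{\lambda_r=0\}$, and $\widehat H_i=\{\mu_i=\mu_{i+1}\}$ for $1\le i<r$.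
   Formalization: The Kostka cone $\mathcal{K}_r$, the polytope $P_r$ and the face F consist of points of ℚ^(2r) instead of $\mathbb{R}^{2r}$, with rational coefficients in valid inequalities, affine dependences and convex combinations. -}

module Defs where

open import Data.Nat as ℕ using (ℕ; zero; suc; _∸_; _<?_)
open import Data.Fin using (Fin; fromℕ<)
open import Data.Integer using (+_)
open import Data.Rational using (ℚ; 0ℚ; 1ℚ; _+_; _*_; _-_; _/_)
import Data.Rational as Q
open import Data.List using (List; []; _∷_; length)
open import Data.List.Relation.Unary.All using (All)
open import Data.List.Relation.Unary.Any using (Any)
open import Data.List.Relation.Unary.AllPairs using (AllPairs)
open import Data.Product using (Σ; ∃; _×_; _,_)
open import Relation.Binary.PropositionalEquality using (_≡_)
open import Relation.Nullary using (¬_; yes; no)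

sumFin : ∀ {a} {A : Set a} → A → (A → A → A) → ∀ {n} → (Fin n → A) → A
sumFin z _⊕_ {zero}  f = z
sumFin z _⊕_ {suc n} f = f Fin.zero ⊕ sumFin z _⊕_ (λ i → f (Fin.suc i))
  where import Data.Fin as Fin

-- 1-based extension of a Fin r-indexed tuple to ℕ, with a default value
-- (used as 0) at index 0 and at indices > r:  ext f i = f_i for 1 ≤ i ≤ r.
ext : ∀ {a} {A : Set a} {r : ℕ} → A → (Fin r → A) → ℕ → A
ext {r = r} z f zero = z
ext {r = r} z f (suc i) with i <? r
... | yes p = f (fromℕ< p)
... | no _  = z

extℕ : ∀ {r} → (Fin r → ℕ) → ℕ → ℕ
extℕ = ext 0

psum : ∀ {r} → (Fin r → ℕ) → ℕ → ℕ
psum f zero    = 0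
psum f (suc k) = psum f k ℕ.+ extℕ f (suc k)

IsPartition : (r : ℕ) → (Fin r → ℕ) → Set
IsPartition r f = ∀ i → 1 ℕ.≤ i → i ℕ.< r → extℕ f (suc i) ℕ.≤ extℕ f i

InPar : (r n : ℕ) → (Fin r → ℕ) → Set
InPar r n f = IsPartition r f × psum f r ≡ n

Dominates : (r : ℕ) → (Fin r → ℕ) → (Fin r → ℕ) → Set
Dominates r l m = ∀ k → k ℕ.≤ r → psum m k ℕ.≤ psum l k

record Pt (r : ℕ) : Set where
  constructor pt
  field
    lam : Fin r → ℚ
    mu  : Fin r → ℚ
open Pt public

-- 1-based coordinates, 0 outside 1..r (so λ_{r+1} = 0)
lamE : ∀ {r} → Pt r → ℕ → ℚ
lamE x = ext 0ℚ (lam x)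

muE : ∀ {r} → Pt r → ℕ → ℚ
muE x = ext 0ℚ (mu x)

_≈_ : ∀ {r} → Pt r → Pt r → Set
x ≈ y = ∀ i → (lam x i ≡ lam y i) × (mu x i ≡ mu y i)

sumℚ : ∀ {n} → (Fin n → ℚ) → ℚ
sumℚ = sumFin 0ℚ _+_

ℕtoℚ : ℕ → ℚ
ℕtoℚ n = (+ n) / 1

0pt : ∀ {r} → Pt r
0pt = pt (λ _ → 0ℚ) (λ _ → 0ℚ)

_⊕_ : ∀ {r} → Pt r → Pt r → Pt r
x ⊕ y = pt (λ i → lam x i + lam y i) (λ i → mu x i + mu y i)

_·_ : ∀ {r} → ℚ → Pt r → Pt r
t · x = pt (λ i → t * lam x i) (λ i → t * mu x i)

dot : ∀ {r} → Pt r → Pt r → ℚ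
dot c x = sumℚ (λ i → c .lam i * x .lam i) + sumℚ (λ i → c .mu i * x .mu i)

coordSum : ∀ {r} → Pt r → ℚ
coordSum x = sumℚ (lam x) + sumℚ (mu x)

sumCoeffs : ∀ {r} → List (ℚ × Pt r) → ℚ
sumCoeffs [] = 0ℚ
sumCoeffs ((t , _) ∷ l) = t + sumCoeffs l

combo : ∀ {r} → List (ℚ × Pt r) → Pt r
combo [] = 0pt
combo ((t , p) ∷ l) = (t · p) ⊕ combo l

InConvexHull : ∀ {r} → (Pt r → Set) → Pt r → Set
InConvexHull {r} S x =
  Σ (List (ℚ × Pt r)) λ l →
    All (λ tp → (0ℚ Q.≤ Data.Product.proj₁ tp) × S (Data.Product.proj₂ tp)) l
    × sumCoeffs l ≡ 1ℚ × x ≈ combo l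
  where import Data.Product

KostkaGen : (r : ℕ) → Pt r → Set
KostkaGen r x = Σ ℕ λ n → Σ (Fin r → ℕ) λ l → Σ (Fin r → ℕ) λ m →
  InPar r n l × InPar r n m × Dominates r l m
  × x ≈ pt (λ i → ℕtoℚ (l i)) (λ i → ℕtoℚ (m i))

-- r-Kostka cone K_r (its rational points)
KostkaCone : (r : ℕ) → Pt r → Set
KostkaCone r = InConvexHull (KostkaGen r)

KostkaPolytope : (r : ℕ) → Pt r → Set
KostkaPolytope r x = KostkaCone r x × coordSum x ≡ 1ℚ

-- H_i : λ_i = λ_{i+1}  (1 ≤ i < r);  H_r : λ_r = 0 (= λ_{r+1})
H : ∀ {r} → ℕ → Pt r → Set
H i x = lamE x i ≡ lamE x (suc i)

Ĥ : ∀ {r} → ℕ → Pt r → Set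
Ĥ i x = muE x i ≡ muE x (suc i)

IsFace : ∀ {r} → (Pt r → Set) → (Pt r → Set) → Set
IsFace {r} P F = Σ (Pt r) λ c → Σ ℚ λ b →
  (∀ x → P x → dot c x Q.≤ b)
  × (∀ x → F x → P x × dot c x ≡ b)
  × (∀ x → P x → dot c x ≡ b → F x)

-- affine dimension of F is at most d: any d+2 points of F are affinely dependent
DimAtMost : ∀ {r} → ℕ → (Pt r → Set) → Set
DimAtMost {r} d F = (p : Fin (suc (suc d)) → Pt r) → (∀ j → F (p j)) →
  Σ (Fin (suc (suc d)) → ℚ) λ a →
    (¬ (∀ j → a j ≡ 0ℚ))
    × sumℚ a ≡ 0ℚ
    × (∀ i → sumℚ (λ j → a j * lam (p j) i) ≡ 0ℚ
           × sumℚ (λ j → a j * mu (p j) i) ≡ 0ℚ)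

IsVertex : ∀ {r} → (Pt r → Set) → Pt r → Set
IsVertex {r} F x = F x × (∀ y z t → F y → F z → 0ℚ Q.< t → t Q.< 1ℚ →
  x ≈ ((t · y) ⊕ ((1ℚ - t) · z)) → y ≈ x)

HasExactlyVertices : ∀ {r} → (Pt r → Set) → ℕ → Set
HasExactlyVertices {r} F N = Σ (List (Pt r)) λ vs →
  length vs ≡ N
  × AllPairs (λ u v → ¬ (u ≈ v)) vs
  × All (IsVertex F) vs
  × (∀ x → IsVertex F x → Any (x ≈_) vs)

FaceF : (r z₁ z₂ z₃ : ℕ) → Pt r → Set
FaceF r z₁ z₂ z₃ x =
  KostkaPolytope r x
  × (∀ i → 1 ℕ.≤ i → i ℕ.≤ z₁ ∸ 1 → H i x)
  × (∀ j → z₁ ℕ.+ z₂ ℕ.≤ j → j ℕ.≤ r → H j x)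
  × (∀ k → z₁ ℕ.≤ k → k ℕ.≤ r ∸ z₃ → Ĥ k x)

-- Write z₁ = 1 + p′, z₂ = 1 + q′, z₃ = 1 + s′ and let U = [0, z₁), T = [z₁, z₁ + z₂), W = [r − z₃ + 1, r].
-- A point of F is described by its jumps: λ drops only at indices t ∈ T (by α_t), μ only at u ∈ U and w ∈ W
-- (by δ_u, γ_w, with δ₀ = λ₁ − μ₁), all nonnegative on the Kostka cone, subject to two linear relations:
-- equal first entries (Σ α = Σ δ + Σ γ) and equal sizes (Σ t α_t = Σ u δ_u + Σ w γ_w).
-- For each (u, t, w) ∈ U × T × W the dominance pair ((w − u) 1_[1,t], (w − t) 1_[1,u] + (t − u) 1_[1,w]),
-- scaled by 1 / (2 t (w − u)), lies in F and has exactly one nonzero jump in each block; every x ∈ F is the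
-- convex combination of these points with weights 2 t (w − u) α_t δ_u γ_w / Z, Z = Σ δ_u γ_w (w − u) > 0,
-- the two linear relations being what makes the weights reproduce x. Hence these z₁ z₂ z₃ points are
-- exactly the vertices. F is cut out of P_r by the sum of the jump functionals its equations set to zero,
-- and 1 + (z₁ − 1) + (z₂ − 1) + (z₃ − 1) = d + 1 coordinates determine a point of F affinely.

module Submission where

open import Defs
open import Data.Nat as ℕ using (ℕ; zero; suc; z≤n; s≤s)
import Data.Nat.Properties as ℕP
open import Data.Rational as ℚ using (ℚ; 0ℚ; 1ℚ)
import Data.Rational.Properties as ℚP
open import Data.Product using (Σ; _×_; _,_; proj₁; proj₂)
open import Data.Empty using (⊥-elim)
open import Relation.Nullary using (¬_; Dec; yes; no)
open import Relation.Binary.PropositionalEquality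
open import Tactic.RingSolver using (solve-∀)

module Rationals where

  open import Data.Nat using (_≤ᵇ_; _≡ᵇ_)
  open import Data.Bool using (true; false; if_then_else_)
  open import Data.Integer as ℤ using (+_)
  import Data.Integer.Properties as ℤP
  import Data.Nat.Coprimality as Coprimality
  open import Data.Rational using (mkℚ; _+_; _*_; _-_; -_; _≤_; _<_; 1/_)
  open import Data.Maybe using (Maybe; just; nothing)
  open import Relation.Binary.Definitions using (tri<; tri≈; tri>)
  open import Tactic.RingSolver.Core.AlmostCommutativeRing using (AlmostCommutativeRing; fromCommutativeRing)
  import Algebra.Properties.Group as GroupProperties

  ℚ-ring : AlmostCommutativeRing _ _
  ℚ-ring = fromCommutativeRing ℚP.+-*-commutativeRing is-zero
    where
    is-zero : ∀ x → Maybe (0ℚ ≡ x)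
    is-zero x with 0ℚ ℚP.≟ x
    ... | yes p = just p
    ... | no _ = nothing

  0<1 : 0ℚ < 1ℚ
  0<1 = ℚP.positive⁻¹ 1ℚ

  +-nonNeg : ∀ {a b} → 0ℚ ≤ a → 0ℚ ≤ b → 0ℚ ≤ a + b
  +-nonNeg {a} {b} a≥0 b≥0 = subst (_≤ a + b) (ℚP.+-identityʳ 0ℚ) (ℚP.+-mono-≤ a≥0 b≥0)

  *-nonNeg : ∀ {a b} → 0ℚ ≤ a → 0ℚ ≤ b → 0ℚ ≤ a * b
  *-nonNeg {a} {b} a≥0 b≥0 = subst (_≤ a * b) (ℚP.*-zeroʳ a) (ℚP.*-monoˡ-≤-nonNeg a {{ℚ.nonNegative a≥0}} b≥0)

  p≤q⇒0≤q-p : ∀ {p q} → p ≤ q → 0ℚ ≤ q - p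
  p≤q⇒0≤q-p {p} {q} p≤q = subst (_≤ q - p) (ℚP.+-inverseʳ p) (ℚP.+-monoˡ-≤ (- p) p≤q)

  0≤q-p⇒p≤q : ∀ {p q} → 0ℚ ≤ q - p → p ≤ q
  0≤q-p⇒p≤q {p} {q} h = subst₂ _≤_ (ℚP.+-identityʳ p) (p+[q-p]≡q p q) (ℚP.+-monoʳ-≤ p h)
    where
    p+[q-p]≡q : ∀ (p q : ℚ) → p + (q - p) ≡ q
    p+[q-p]≡q = solve-∀ ℚ-ring

  nonNeg+nonNeg≡0 : ∀ {p q} → 0ℚ ≤ p → 0ℚ ≤ q → p + q ≡ 0ℚ → p ≡ 0ℚ × q ≡ 0ℚ
  nonNeg+nonNeg≡0 {p} {q} p≥0 q≥0 p+q≡0 = ℚP.≤-antisym p≤0 p≥0 , ℚP.≤-antisym q≤0 q≥0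
    where
    p≤0 : p ≤ 0ℚ
    p≤0 = subst₂ _≤_ (ℚP.+-identityʳ p) p+q≡0 (ℚP.+-monoʳ-≤ p q≥0)
    q≤0 : q ≤ 0ℚ
    q≤0 = subst₂ _≤_ (ℚP.+-identityˡ q) p+q≡0 (ℚP.+-monoˡ-≤ q p≥0)

  p+q-p≡q : ∀ p q → p + q - p ≡ q
  p+q-p≡q = solve-∀ ℚ-ring

  0<p+p⇒0<p : ∀ {p} → 0ℚ < p + p → 0ℚ < p
  0<p+p⇒0<p {p} 0<2p with ℚP.<-cmp 0ℚ p
  ... | tri< 0<p _ _ = 0<p
  ... | tri≈ _ refl _ = ⊥-elim (ℚP.<-irrefl refl 0<2p)
  ... | tri> _ _ p<0 = ⊥-elim (ℚP.<-asym 0<2p (subst (p + p <_) (ℚP.+-identityʳ 0ℚ) (ℚP.+-mono-< p<0 p<0)))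

  *-cancelˡ-≡0 : ∀ p .{{_ : ℚ.NonZero p}} q → p * q ≡ 0ℚ → q ≡ 0ℚ
  *-cancelˡ-≡0 p q pq≡0 = begin
    q                ≡⟨ ℚP.*-identityˡ q ⟨
    1ℚ * q           ≡⟨ cong (_* q) (ℚP.*-inverseˡ p) ⟨
    (1/ p) * p * q   ≡⟨ ℚP.*-assoc (1/ p) p q ⟩
    (1/ p) * (p * q) ≡⟨ cong (1/ p *_) pq≡0 ⟩
    (1/ p) * 0ℚ      ≡⟨ ℚP.*-zeroʳ (1/ p) ⟩
    0ℚ               ∎
    where open ≡-Reasoning

  pos*p+nonNeg*q≡0 : ∀ {τ σ p q} → 0ℚ < τ → 0ℚ ≤ σ → 0ℚ ≤ p → 0ℚ ≤ q → τ * p + σ * q ≡ 0ℚ → p ≡ 0ℚ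
  pos*p+nonNeg*q≡0 {τ} {σ} {p} τ>0 σ≥0 p≥0 q≥0 sum≡0 =
    *-cancelˡ-≡0 τ {{ℚP.pos⇒nonZero τ {{ℚ.positive τ>0}}}} p
      (proj₁ (nonNeg+nonNeg≡0 (*-nonNeg (ℚP.<⇒≤ τ>0) p≥0) (*-nonNeg σ≥0 q≥0) sum≡0))

  open GroupProperties ℚP.+-0-group public
    using () renaming (x∙y⁻¹≈ε⇒x≈y to p-q≡0⇒p≡q; x≈y⇒x∙y⁻¹≈ε to p≡q⇒p-q≡0)

  ℕtoℚ-mkℚ : ∀ n → ℕtoℚ n ≡ mkℚ (+ n) 0 (Coprimality.sym (Coprimality.1-coprimeTo n))
  ℕtoℚ-mkℚ n = ℚP.normalize-coprime (Coprimality.sym (Coprimality.1-coprimeTo n))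

  ℕtoℚ-homo-+ : ∀ m n → ℕtoℚ (m ℕ.+ n) ≡ ℕtoℚ m + ℕtoℚ n
  ℕtoℚ-homo-+ m n rewrite ℕtoℚ-mkℚ m | ℕtoℚ-mkℚ n =
    cong (ℚ._/ 1) (sym (cong₂ ℤ._+_ (ℤP.*-identityʳ (+ m)) (ℤP.*-identityʳ (+ n))))

  ℕtoℚ-homo-* : ∀ m n → ℕtoℚ (m ℕ.* n) ≡ ℕtoℚ m * ℕtoℚ n
  ℕtoℚ-homo-* m n rewrite ℕtoℚ-mkℚ m | ℕtoℚ-mkℚ n = cong (ℚ._/ 1) (ℤP.pos-* m n)

  ℕtoℚ-homo-∸ : ∀ {m n} → n ℕ.≤ m → ℕtoℚ (m ℕ.∸ n) ≡ ℕtoℚ m - ℕtoℚ n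
  ℕtoℚ-homo-∸ {m} {n} n≤m = begin
    ℕtoℚ (m ℕ.∸ n)                    ≡⟨ p+q-p≡q (ℕtoℚ n) (ℕtoℚ (m ℕ.∸ n)) ⟨
    ℕtoℚ n + ℕtoℚ (m ℕ.∸ n) - ℕtoℚ n  ≡⟨ cong (_- ℕtoℚ n) (ℕtoℚ-homo-+ n (m ℕ.∸ n)) ⟨
    ℕtoℚ (n ℕ.+ (m ℕ.∸ n)) - ℕtoℚ n   ≡⟨ cong (λ k → ℕtoℚ k - ℕtoℚ n) (ℕP.m+[n∸m]≡n n≤m) ⟩
    ℕtoℚ m - ℕtoℚ n                   ∎
    where open ≡-Reasoning

  ℕtoℚ-nonNeg : ∀ n → 0ℚ ≤ ℕtoℚ n
  ℕtoℚ-nonNeg n rewrite ℕtoℚ-mkℚ n = ℚP.nonNegative⁻¹ _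

  ℕtoℚ-pos : ∀ n .{{_ : ℕ.NonZero n}} → ℚ.Positive (ℕtoℚ n)
  ℕtoℚ-pos (suc n) rewrite ℕtoℚ-mkℚ (suc n) = _

  ℕtoℚ-mono-≤ : ∀ {m n} → m ℕ.≤ n → ℕtoℚ m ≤ ℕtoℚ n
  ℕtoℚ-mono-≤ {m} {n} m≤n = 0≤q-p⇒p≤q (subst (0ℚ ≤_) (ℕtoℚ-homo-∸ m≤n) (ℕtoℚ-nonNeg (n ℕ.∸ m)))

  ℕtoℚ-injective : ∀ {m n} → ℕtoℚ m ≡ ℕtoℚ n → m ≡ n
  ℕtoℚ-injective {m} {n} eq = ℤP.+-injective (cong ℚ.numerator (trans (sym (ℕtoℚ-mkℚ m)) (trans eq (ℕtoℚ-mkℚ n))))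

  ℕtoℚ-suc-nonZero : ∀ k → ℚ.NonZero (ℕtoℚ (suc k))
  ℕtoℚ-suc-nonZero k = ℚP.pos⇒nonZero (ℕtoℚ (suc k)) {{ℕtoℚ-pos (suc k)}}

  ℕtoℚ-suc-cancel : ∀ k q → ℕtoℚ (suc k) * q ≡ 0ℚ → q ≡ 0ℚ
  ℕtoℚ-suc-cancel k = *-cancelˡ-≡0 (ℕtoℚ (suc k)) {{ℕtoℚ-suc-nonZero k}}

  1/suc : ℕ → ℚ
  1/suc k = (1/ ℕtoℚ (suc k)) {{ℕtoℚ-suc-nonZero k}}

  1/suc-inverse : ∀ k → ℕtoℚ (suc k) * 1/suc k ≡ 1ℚ
  1/suc-inverse k = ℚP.*-inverseʳ (ℕtoℚ (suc k)) {{ℕtoℚ-suc-nonZero k}}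

  1/suc-pos : ∀ k → 0ℚ < 1/suc k
  1/suc-pos k = ℚP.positive⁻¹ _ {{ℚP.1/pos⇒pos (ℕtoℚ (suc k)) {{ℕtoℚ-pos (suc k)}}}}

  1/suc-≤1 : ∀ k → 1/suc k ≤ 1ℚ
  1/suc-≤1 k = subst₂ _≤_ (ℚP.*-identityˡ (1/suc k)) (1/suc-inverse k)
    (ℚP.*-monoʳ-≤-nonNeg (1/suc k) {{ℚ.nonNegative (ℚP.<⇒≤ (1/suc-pos k))}} (ℕtoℚ-mono-≤ {1} {suc k} (s≤s z≤n)))

  ≤ᵇ-true : ∀ {i t} → i ℕ.≤ t → (i ≤ᵇ t) ≡ true
  ≤ᵇ-true {i} {t} i≤t with i ≤ᵇ t | ℕP.≤⇒≤ᵇ i≤t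
  ... | true | _ = refl

  ≤ᵇ-false : ∀ {i t} → t ℕ.< i → (i ≤ᵇ t) ≡ false
  ≤ᵇ-false {i} {t} t<i with i ≤ᵇ t | ℕP.≤ᵇ⇒≤ i t
  ... | false | _ = refl
  ... | true | ≤ᵇ⇒≤ = ⊥-elim (ℕP.<⇒≱ t<i (≤ᵇ⇒≤ _))

  𝟙ℕ[_≤_] : ℕ → ℕ → ℕ
  𝟙ℕ[ i ≤ t ] = if i ≤ᵇ t then 1 else 0

  𝟙[_≤_] : ℕ → ℕ → ℚ
  𝟙[ i ≤ t ] = if i ≤ᵇ t then 1ℚ else 0ℚ

  𝟙ℕ-≤ : ∀ {i t} → i ℕ.≤ t → 𝟙ℕ[ i ≤ t ] ≡ 1
  𝟙ℕ-≤ i≤t rewrite ≤ᵇ-true i≤t = refl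

  𝟙ℕ-> : ∀ {i t} → t ℕ.< i → 𝟙ℕ[ i ≤ t ] ≡ 0
  𝟙ℕ-> t<i rewrite ≤ᵇ-false t<i = refl

  𝟙-≤ : ∀ {i t} → i ℕ.≤ t → 𝟙[ i ≤ t ] ≡ 1ℚ
  𝟙-≤ i≤t rewrite ≤ᵇ-true i≤t = refl

  𝟙-> : ∀ {i t} → t ℕ.< i → 𝟙[ i ≤ t ] ≡ 0ℚ
  𝟙-> t<i rewrite ≤ᵇ-false t<i = refl

  ℕtoℚ-𝟙 : ∀ i t → ℕtoℚ 𝟙ℕ[ i ≤ t ] ≡ 𝟙[ i ≤ t ]
  ℕtoℚ-𝟙 i t with i ≤ᵇ t
  ... | true = refl
  ... | false = refl

  𝟙ℕ≤1 : ∀ {i t} → 𝟙ℕ[ i ≤ t ] ℕ.≤ 1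
  𝟙ℕ≤1 {i} {t} with i ≤ᵇ t
  ... | true = ℕP.≤-refl
  ... | false = z≤n

  𝟙ℕ-antitone : ∀ {i t} → 𝟙ℕ[ suc i ≤ t ] ℕ.≤ 𝟙ℕ[ i ≤ t ]
  𝟙ℕ-antitone {i} {t} with i ℕ.<? t
  ... | yes i<t = ℕP.≤-reflexive (trans (𝟙ℕ-≤ {suc i} i<t) (sym (𝟙ℕ-≤ (ℕP.<⇒≤ i<t))))
  ... | no i≮t rewrite 𝟙ℕ-> {suc i} {t} (s≤s (ℕP.≮⇒≥ i≮t)) = z≤n

  𝟙-step : ∀ {i t} → i ≢ t → 𝟙[ i ≤ t ] ≡ 𝟙[ suc i ≤ t ]
  𝟙-step {i} {t} i≢t with i ℕ.<? t
  ... | yes i<t = trans (𝟙-≤ (ℕP.<⇒≤ i<t)) (sym (𝟙-≤ {suc i} i<t))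
  ... | no i≮t = trans (𝟙-> t<i) (sym (𝟙-> {suc i} (ℕP.m<n⇒m<1+n t<i)))
    where
    t<i : t ℕ.< i
    t<i = ℕP.≤∧≢⇒< (ℕP.≮⇒≥ i≮t) (≢-sym i≢t)

  𝟙[_≡_] : ℕ → ℕ → ℚ
  𝟙[ k ≡ i ] = if k ≡ᵇ i then 1ℚ else 0ℚ

  𝟙≡-refl : ∀ k → 𝟙[ k ≡ k ] ≡ 1ℚ
  𝟙≡-refl k with k ≡ᵇ k | ℕP.≡⇒≡ᵇ k k refl
  ... | true | _ = refl

  𝟙≡-≢ : ∀ {k i} → k ≢ i → 𝟙[ k ≡ i ] ≡ 0ℚ
  𝟙≡-≢ {k} {i} k≢i with k ≡ᵇ i | ℕP.≡ᵇ⇒≡ k i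
  ... | false | _ = refl
  ... | true | ≡ᵇ⇒≡ = ⊥-elim (k≢i (≡ᵇ⇒≡ _))

module IntervalSums where

  open Rationals
  open import Data.List using (List; []; _∷_; _++_; map; cartesianProduct)
  open import Data.List.Relation.Unary.All as All using (All; []; _∷_)
  open import Data.Rational using (_+_; _*_; _-_; -_; _≤_)

  lsum : ∀ {A : Set} → List A → (A → ℚ) → ℚ
  lsum [] f = 0ℚ
  lsum (x ∷ xs) f = f x + lsum xs f

  range : ℕ → ℕ → List ℕ
  range a zero = []
  range a (suc n) = a ∷ range (suc a) n

  all-range : ∀ {P : ℕ → Set} a n → (∀ i → a ℕ.≤ i → i ℕ.< a ℕ.+ n → P i) → All P (range a n)
  all-range a zero h = []
  all-range a (suc n) h = h a ℕP.≤-refl (ℕP.m<m+n a (s≤s z≤n))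
    ∷ all-range (suc a) n (λ i a<i i<a+1+n → h i (ℕP.<⇒≤ a<i) (subst (i ℕ.<_) (sym (ℕP.+-suc a n)) i<a+1+n))

  all-range⁻ : ∀ {P : ℕ → Set} a n → All P (range a n) → ∀ i → a ℕ.≤ i → i ℕ.< a ℕ.+ n → P i
  all-range⁻ a zero [] i a≤i i<a+0 = ⊥-elim (ℕP.<⇒≱ i<a+0 (subst (ℕ._≤ i) (sym (ℕP.+-identityʳ a)) a≤i))
  all-range⁻ a (suc n) (pa ∷ ps) i a≤i i<a+1+n with a ℕP.≟ i
  ... | yes refl = pa
  ... | no a≢i = all-range⁻ (suc a) n ps i (ℕP.≤∧≢⇒< a≤i a≢i) (subst (i ℕ.<_) (ℕP.+-suc a n) i<a+1+n)

  range-+ : ∀ a m n → range a (m ℕ.+ n) ≡ range a m ++ range (a ℕ.+ m) n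
  range-+ a zero n = cong (λ b → range b n) (sym (ℕP.+-identityʳ a))
  range-+ a (suc m) n = cong (a ∷_) (trans (range-+ (suc a) m n) (cong (λ b → range (suc a) m ++ range b n) (sym (ℕP.+-suc a m))))

  lsum-const-zero : ∀ {A : Set} (xs : List A) → lsum xs (λ _ → 0ℚ) ≡ 0ℚ
  lsum-const-zero [] = refl
  lsum-const-zero (x ∷ xs) = trans (ℚP.+-identityˡ _) (lsum-const-zero xs)

  module _ {A : Set} where

    lsum-cong : ∀ (xs : List A) {f g : A → ℚ} → (∀ x → f x ≡ g x) → lsum xs f ≡ lsum xs g
    lsum-cong [] h = refl
    lsum-cong (x ∷ xs) h = cong₂ _+_ (h x) (lsum-cong xs h)

    lsum-congᴬ : ∀ {xs : List A} {f g : A → ℚ} → All (λ x → f x ≡ g x) xs → lsum xs f ≡ lsum xs g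
    lsum-congᴬ [] = refl
    lsum-congᴬ (e ∷ es) = cong₂ _+_ e (lsum-congᴬ es)

    lsum-zeroᴬ : ∀ {xs : List A} {f : A → ℚ} → All (λ x → f x ≡ 0ℚ) xs → lsum xs f ≡ 0ℚ
    lsum-zeroᴬ [] = refl
    lsum-zeroᴬ (e ∷ es) = trans (cong₂ _+_ e (lsum-zeroᴬ es)) (ℚP.+-identityˡ 0ℚ)

    lsum-nonNegᴬ : ∀ {xs : List A} {f : A → ℚ} → All (λ x → 0ℚ ≤ f x) xs → 0ℚ ≤ lsum xs f
    lsum-nonNegᴬ [] = ℚP.≤-refl
    lsum-nonNegᴬ (h ∷ hs) = +-nonNeg h (lsum-nonNegᴬ hs)

    lsum-nonNeg-≡0 : ∀ {xs : List A} {f : A → ℚ} → All (λ x → 0ℚ ≤ f x) xs → lsum xs f ≡ 0ℚ → All (λ x → f x ≡ 0ℚ) xs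
    lsum-nonNeg-≡0 [] _ = []
    lsum-nonNeg-≡0 (h ∷ hs) e with nonNeg+nonNeg≡0 h (lsum-nonNegᴬ hs) e
    ... | fx≡0 , rest≡0 = fx≡0 ∷ lsum-nonNeg-≡0 hs rest≡0

    lsum-++ : ∀ (xs ys : List A) (f : A → ℚ) → lsum (xs ++ ys) f ≡ lsum xs f + lsum ys f
    lsum-++ [] ys f = sym (ℚP.+-identityˡ _)
    lsum-++ (x ∷ xs) ys f = trans (cong (f x +_) (lsum-++ xs ys f)) (sym (ℚP.+-assoc (f x) _ _))

    lsum-distrib-+ : ∀ (xs : List A) (f g : A → ℚ) → lsum xs (λ x → f x + g x) ≡ lsum xs f + lsum xs g
    lsum-distrib-+ [] f g = sym (ℚP.+-identityˡ 0ℚ)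
    lsum-distrib-+ (x ∷ xs) f g = trans (cong (f x + g x +_) (lsum-distrib-+ xs f g)) (interchange (f x) (g x) _ _)
      where
      interchange : ∀ (a b c d : ℚ) → a + b + (c + d) ≡ a + c + (b + d)
      interchange = solve-∀ ℚ-ring

    lsum-*ˡ : ∀ (xs : List A) c (f : A → ℚ) → lsum xs (λ x → c * f x) ≡ c * lsum xs f
    lsum-*ˡ [] c f = sym (ℚP.*-zeroʳ c)
    lsum-*ˡ (x ∷ xs) c f = trans (cong (c * f x +_) (lsum-*ˡ xs c f)) (sym (ℚP.*-distribˡ-+ c (f x) _))

    lsum-*ʳ : ∀ (xs : List A) c (f : A → ℚ) → lsum xs (λ x → f x * c) ≡ lsum xs f * c
    lsum-*ʳ xs c f = trans (lsum-cong xs (λ x → ℚP.*-comm (f x) c)) (trans (lsum-*ˡ xs c f) (ℚP.*-comm c _))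

    lsum-neg : ∀ (xs : List A) (f : A → ℚ) → lsum xs (λ x → - f x) ≡ - lsum xs f
    lsum-neg [] f = refl
    lsum-neg (x ∷ xs) f = trans (cong (- f x +_) (lsum-neg xs f)) (sym (ℚP.neg-distrib-+ (f x) _))

    lsum-distrib-- : ∀ (xs : List A) (f g : A → ℚ) → lsum xs (λ x → f x - g x) ≡ lsum xs f - lsum xs g
    lsum-distrib-- xs f g = trans (lsum-distrib-+ xs f (λ x → - g x)) (cong (lsum xs f +_) (lsum-neg xs g))

    lsum-map : ∀ {B : Set} (g : A → B) (xs : List A) (f : B → ℚ) → lsum (map g xs) f ≡ lsum xs (λ x → f (g x))
    lsum-map g [] f = refl
    lsum-map g (x ∷ xs) f = cong (f (g x) +_) (lsum-map g xs f)

  lsum-comm : ∀ {A B : Set} (xs : List A) (ys : List B) (f : A → B → ℚ) →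
    lsum xs (λ x → lsum ys (f x)) ≡ lsum ys (λ y → lsum xs (λ x → f x y))
  lsum-comm [] ys f = sym (lsum-const-zero ys)
  lsum-comm (x ∷ xs) ys f = trans (cong (lsum ys (f x) +_) (lsum-comm xs ys f))
    (sym (lsum-distrib-+ ys (f x) (λ y → lsum xs (λ x → f x y))))

  lsum-cartesianProduct : ∀ {A B : Set} (xs : List A) (ys : List B) (f : A × B → ℚ) →
    lsum (cartesianProduct xs ys) f ≡ lsum xs (λ x → lsum ys (λ y → f (x , y)))
  lsum-cartesianProduct [] ys f = refl
  lsum-cartesianProduct (x ∷ xs) ys f = trans (lsum-++ (map (x ,_) ys) _ f)
    (cong₂ _+_ (lsum-map (x ,_) ys f) (lsum-cartesianProduct xs ys f))

  lsum-bilinear : ∀ {A B : Set} (xs : List A) (ys : List B) (f k : A → ℚ) (g h : B → ℚ) →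
    lsum xs (λ x → lsum ys (λ y → f x * g y * (h y - k x))) ≡
    lsum xs f * lsum ys (λ y → h y * g y) - lsum xs (λ x → k x * f x) * lsum ys g
  lsum-bilinear xs ys f k g h = begin
      lsum xs (λ x → lsum ys (λ y → f x * g y * (h y - k x)))
    ≡⟨ lsum-cong xs (λ x → lsum-cong ys (λ y → expand (f x) (g y) (h y) (k x))) ⟩
      lsum xs (λ x → lsum ys (λ y → f x * (h y * g y) - k x * f x * g y))
    ≡⟨ lsum-cong xs (λ x → trans (lsum-distrib-- ys _ _) (cong₂ _-_ (lsum-*ˡ ys (f x) _) (lsum-*ˡ ys (k x * f x) g))) ⟩
      lsum xs (λ x → f x * lsum ys (λ y → h y * g y) - k x * f x * lsum ys g)
    ≡⟨ trans (lsum-distrib-- xs _ _) (cong₂ _-_ (lsum-*ʳ xs _ f) (lsum-*ʳ xs _ (λ x → k x * f x))) ⟩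
      lsum xs f * lsum ys (λ y → h y * g y) - lsum xs (λ x → k x * f x) * lsum ys g
    ∎
    where
    open ≡-Reasoning
    expand : ∀ (a b c d : ℚ) → a * b * (c - d) ≡ a * (c * b) - d * a * b
    expand = solve-∀ ℚ-ring

  lsum-range-cong : ∀ a n {f g : ℕ → ℚ} → (∀ i → a ℕ.≤ i → i ℕ.< a ℕ.+ n → f i ≡ g i) → lsum (range a n) f ≡ lsum (range a n) g
  lsum-range-cong a n h = lsum-congᴬ (all-range a n h)

  lsum-range-zero : ∀ a n {f : ℕ → ℚ} → (∀ i → a ℕ.≤ i → i ℕ.< a ℕ.+ n → f i ≡ 0ℚ) → lsum (range a n) f ≡ 0ℚ
  lsum-range-zero a n h = lsum-zeroᴬ (all-range a n h)

  lsum-range-+ : ∀ a m n (f : ℕ → ℚ) → lsum (range a (m ℕ.+ n)) f ≡ lsum (range a m) f + lsum (range (a ℕ.+ m) n) f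
  lsum-range-+ a m n f = trans (cong (λ xs → lsum xs f) (range-+ a m n)) (lsum-++ (range a m) _ f)

  lsum-range-one : ∀ a n → lsum (range a n) (λ _ → 1ℚ) ≡ ℕtoℚ n
  lsum-range-one a zero = refl
  lsum-range-one a (suc n) = trans (cong (1ℚ +_) (lsum-range-one (suc a) n)) (sym (ℕtoℚ-homo-+ 1 n))

  lsum-range-const : ∀ a n c → lsum (range a n) (λ _ → c) ≡ ℕtoℚ n * c
  lsum-range-const a n c = begin
    lsum (range a n) (λ _ → c)        ≡⟨ lsum-cong (range a n) (λ _ → ℚP.*-identityˡ c) ⟨
    lsum (range a n) (λ _ → 1ℚ * c)   ≡⟨ lsum-*ʳ (range a n) c (λ _ → 1ℚ) ⟩
    lsum (range a n) (λ _ → 1ℚ) * c   ≡⟨ cong (_* c) (lsum-range-one a n) ⟩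
    ℕtoℚ n * c                        ∎
    where open ≡-Reasoning

  lsum-range-suc : ∀ a n (f : ℕ → ℚ) → lsum (range (suc a) n) f ≡ lsum (range a n) (λ i → f (suc i))
  lsum-range-suc a zero f = refl
  lsum-range-suc a (suc n) f = cong (f (suc a) +_) (lsum-range-suc (suc a) n f)

  lsum-range-last : ∀ a n (f : ℕ → ℚ) → lsum (range a (suc n)) f ≡ lsum (range a n) f + f (a ℕ.+ n)
  lsum-range-last a n f = begin
    lsum (range a (suc n)) f                         ≡⟨ cong (λ k → lsum (range a k) f) (ℕP.+-comm 1 n) ⟩
    lsum (range a (n ℕ.+ 1)) f                       ≡⟨ lsum-range-+ a n 1 f ⟩
    lsum (range a n) f + (f (a ℕ.+ n) + 0ℚ)          ≡⟨ cong (lsum (range a n) f +_) (ℚP.+-identityʳ _) ⟩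
    lsum (range a n) f + f (a ℕ.+ n)                 ∎
    where open ≡-Reasoning

  lsum-telescope : ∀ a n (f : ℕ → ℚ) → lsum (range a n) (λ i → f i - f (suc i)) ≡ f a - f (a ℕ.+ n)
  lsum-telescope a zero f = trans (sym (ℚP.+-inverseʳ (f a))) (cong (λ b → f a - f b) (sym (ℕP.+-identityʳ a)))
  lsum-telescope a (suc n) f = begin
    f a - f (suc a) + lsum (range (suc a) n) (λ i → f i - f (suc i)) ≡⟨ cong (f a - f (suc a) +_) (lsum-telescope (suc a) n f) ⟩
    f a - f (suc a) + (f (suc a) - f (suc a ℕ.+ n))                  ≡⟨ x-y+[y-z]≡x-z (f a) (f (suc a)) _ ⟩
    f a - f (suc a ℕ.+ n)                                            ≡⟨ cong (λ b → f a - f b) (ℕP.+-suc a n) ⟨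
    f a - f (a ℕ.+ suc n)                                            ∎
    where
    open ≡-Reasoning
    x-y+[y-z]≡x-z : ∀ (x y z : ℚ) → x - y + (y - z) ≡ x - z
    x-y+[y-z]≡x-z = solve-∀ ℚ-ring

  lsum-range-single : ∀ a n k {f : ℕ → ℚ} → a ℕ.≤ k → k ℕ.< a ℕ.+ n →
    (∀ i → a ℕ.≤ i → i ℕ.< a ℕ.+ n → i ≢ k → f i ≡ 0ℚ) → lsum (range a n) f ≡ f k
  lsum-range-single a zero k a≤k k<a+0 _ = ⊥-elim (ℕP.<⇒≱ k<a+0 (subst (ℕ._≤ k) (sym (ℕP.+-identityʳ a)) a≤k))
  lsum-range-single a (suc n) k {f} a≤k k<a+1+n h with a ℕP.≟ k
  ... | yes refl = trans (cong (f a +_) (lsum-range-zero (suc a) n (λ i a<i i< → h' i a<i i< (ℕP.>⇒≢ a<i)))) (ℚP.+-identityʳ _)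
    where
    h' : ∀ i → suc a ℕ.≤ i → i ℕ.< suc a ℕ.+ n → i ≢ a → f i ≡ 0ℚ
    h' i a<i i< = h i (ℕP.<⇒≤ a<i) (subst (i ℕ.<_) (sym (ℕP.+-suc a n)) i<)
  ... | no a≢k = begin
    f a + lsum (range (suc a) n) f   ≡⟨ cong (_+ lsum (range (suc a) n) f) (h a ℕP.≤-refl (ℕP.m<m+n a (s≤s z≤n)) a≢k) ⟩
    0ℚ + lsum (range (suc a) n) f    ≡⟨ ℚP.+-identityˡ (lsum (range (suc a) n) f) ⟩
    lsum (range (suc a) n) f         ≡⟨ lsum-range-single (suc a) n k (ℕP.≤∧≢⇒< a≤k a≢k) (subst (k ℕ.<_) (ℕP.+-suc a n) k<a+1+n)
                                          (λ i a<i i< → h i (ℕP.<⇒≤ a<i) (subst (i ℕ.<_) (sym (ℕP.+-suc a n)) i<)) ⟩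
    f k                              ∎
    where open ≡-Reasoning

  lsum-range-split : ∀ r i (f : ℕ → ℚ) → i ℕ.≤ r →
    lsum (range 1 r) f ≡ lsum (range 1 i) f + lsum (range (suc i) (r ℕ.∸ i)) f
  lsum-range-split r i f i≤r = trans (cong (λ k → lsum (range 1 k) f) (sym (ℕP.m+[n∸m]≡n i≤r))) (lsum-range-+ 1 i (r ℕ.∸ i) f)

  lsum-𝟙 : ∀ r t → t ℕ.≤ r → lsum (range 1 r) (λ i → 𝟙[ i ≤ t ]) ≡ ℕtoℚ t
  lsum-𝟙 r t t≤r = begin
    lsum (range 1 r) (λ i → 𝟙[ i ≤ t ])                    ≡⟨ lsum-range-split r t _ t≤r ⟩
    lsum (range 1 t) (λ i → 𝟙[ i ≤ t ])
      + lsum (range (suc t) (r ℕ.∸ t)) (λ i → 𝟙[ i ≤ t ])  ≡⟨ cong₂ _+_ (lsum-range-cong 1 t (λ i _ i≤t → 𝟙-≤ (ℕP.≤-pred i≤t)))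
                                                                       (lsum-range-zero (suc t) (r ℕ.∸ t) (λ i t<i _ → 𝟙-> t<i)) ⟩
    lsum (range 1 t) (λ _ → 1ℚ) + 0ℚ                       ≡⟨ ℚP.+-identityʳ _ ⟩
    lsum (range 1 t) (λ _ → 1ℚ)                            ≡⟨ lsum-range-one 1 t ⟩
    ℕtoℚ t                                                 ∎
    where open ≡-Reasoning

  lsum-tail-differences : ∀ r (f : ℕ → ℚ) → f (suc r) ≡ 0ℚ → ∀ i → i ℕ.≤ r →
    f (suc i) ≡ lsum (range 1 r) (λ t → 𝟙[ suc i ≤ t ] * (f t - f (suc t)))
  lsum-tail-differences r f fr≡0 i i≤r = sym (begin
      lsum (range 1 r) g                                             ≡⟨ lsum-range-split r i g i≤r ⟩
      lsum (range 1 i) g + lsum (range (suc i) (r ℕ.∸ i)) g          ≡⟨ cong₂ _+_ (lsum-range-zero 1 i (λ t _ t≤i → below t t≤i))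
                                                                                  (lsum-range-cong (suc i) (r ℕ.∸ i) (λ t i<t _ → above t i<t)) ⟩
      0ℚ + lsum (range (suc i) (r ℕ.∸ i)) (λ t → f t - f (suc t))    ≡⟨ ℚP.+-identityˡ _ ⟩
      lsum (range (suc i) (r ℕ.∸ i)) (λ t → f t - f (suc t))         ≡⟨ lsum-telescope (suc i) (r ℕ.∸ i) f ⟩
      f (suc i) - f (suc i ℕ.+ (r ℕ.∸ i))                            ≡⟨ cong (λ k → f (suc i) - f (suc k)) (ℕP.m+[n∸m]≡n i≤r) ⟩
      f (suc i) - f (suc r)                                          ≡⟨ cong (λ x → f (suc i) - x) fr≡0 ⟩
      f (suc i) - 0ℚ                                                 ≡⟨ ℚP.+-identityʳ _ ⟩
      f (suc i)                                                      ∎)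
    where
    open ≡-Reasoning
    g : ℕ → ℚ
    g t = 𝟙[ suc i ≤ t ] * (f t - f (suc t))
    below : ∀ t → t ℕ.< suc i → g t ≡ 0ℚ
    below t t≤i = trans (cong (_* (f t - f (suc t))) (𝟙-> t≤i)) (ℚP.*-zeroˡ (f t - f (suc t)))
    above : ∀ t → suc i ℕ.≤ t → g t ≡ f t - f (suc t)
    above t i<t = trans (cong (_* (f t - f (suc t))) (𝟙-≤ i<t)) (ℚP.*-identityˡ _)

  module _ (xs : List ℕ) (c : ℕ) {f : ℕ → ℚ} (f≥0 : All (λ i → 0ℚ ≤ f i) xs) where

    lsum-weight-lower : All (c ℕ.≤_) xs → ℕtoℚ c * lsum xs f ≤ lsum xs (λ i → ℕtoℚ i * f i)
    lsum-weight-lower c≤xs = 0≤q-p⇒p≤q (subst (0ℚ ≤_) regroup (lsum-nonNegᴬ (All.zipWith term (c≤xs , f≥0))))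
      where
      term : ∀ {i} → c ℕ.≤ i × 0ℚ ≤ f i → 0ℚ ≤ (ℕtoℚ i - ℕtoℚ c) * f i
      term (c≤i , fi≥0) = *-nonNeg (p≤q⇒0≤q-p (ℕtoℚ-mono-≤ c≤i)) fi≥0
      regroup : lsum xs (λ i → (ℕtoℚ i - ℕtoℚ c) * f i) ≡ lsum xs (λ i → ℕtoℚ i * f i) - ℕtoℚ c * lsum xs f
      regroup = trans (lsum-cong xs (λ i → expand (ℕtoℚ i) (ℕtoℚ c) (f i)))
                      (trans (lsum-distrib-- xs _ _) (cong (λ x → lsum xs (λ i → ℕtoℚ i * f i) - x) (lsum-*ˡ xs (ℕtoℚ c) f)))
        where
        expand : ∀ (a b x : ℚ) → (a - b) * x ≡ a * x - b * x
        expand = solve-∀ ℚ-ring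

    lsum-weight-upper : All (ℕ._≤ c) xs → lsum xs (λ i → ℕtoℚ i * f i) ≤ ℕtoℚ c * lsum xs f
    lsum-weight-upper xs≤c = 0≤q-p⇒p≤q (subst (0ℚ ≤_) regroup (lsum-nonNegᴬ (All.zipWith term (xs≤c , f≥0))))
      where
      term : ∀ {i} → i ℕ.≤ c × 0ℚ ≤ f i → 0ℚ ≤ (ℕtoℚ c - ℕtoℚ i) * f i
      term (i≤c , fi≥0) = *-nonNeg (p≤q⇒0≤q-p (ℕtoℚ-mono-≤ i≤c)) fi≥0
      regroup : lsum xs (λ i → (ℕtoℚ c - ℕtoℚ i) * f i) ≡ ℕtoℚ c * lsum xs f - lsum xs (λ i → ℕtoℚ i * f i)
      regroup = trans (lsum-cong xs (λ i → expand (ℕtoℚ c) (ℕtoℚ i) (f i)))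
                      (trans (lsum-distrib-- xs _ _) (cong (_- lsum xs (λ i → ℕtoℚ i * f i)) (lsum-*ˡ xs (ℕtoℚ c) f)))
        where
        expand : ∀ (a b x : ℚ) → (a - b) * x ≡ a * x - b * x
        expand = solve-∀ ℚ-ring

  lsum-range-𝟙≡ : ∀ a n k (f : ℕ → ℚ) → a ℕ.≤ k → k ℕ.< a ℕ.+ n → lsum (range a n) (λ i → 𝟙[ k ≡ i ] * f i) ≡ f k
  lsum-range-𝟙≡ a n k f a≤k k<a+n = begin
    lsum (range a n) (λ i → 𝟙[ k ≡ i ] * f i) ≡⟨ lsum-range-single a n k a≤k k<a+n (λ i _ _ i≢k → trans (cong (_* f i) (𝟙≡-≢ (≢-sym i≢k))) (ℚP.*-zeroˡ (f i))) ⟩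
    𝟙[ k ≡ k ] * f k                          ≡⟨ cong (_* f k) (𝟙≡-refl k) ⟩
    1ℚ * f k                                  ≡⟨ ℚP.*-identityˡ (f k) ⟩
    f k                                       ∎
    where open ≡-Reasoning

module FinSums where

  open Rationals
  open import Data.Fin using (Fin; zero; suc; punchIn)
  import Data.Fin.Properties as FinP
  open import Data.Vec.Functional using (insertAt)
  open import Data.Vec.Functional.Properties using (insertAt-lookup; insertAt-punchIn)
  open import Data.Rational using (_+_; _*_; _-_; -_; 1/_)
  open import Relation.Nullary using (¬?)
  open import Relation.Nullary.Decidable using (decidable-stable)
  open import Function using (_∘′_)

  sumℚ-cong : ∀ {n} {f g : Fin n → ℚ} → (∀ j → f j ≡ g j) → sumℚ f ≡ sumℚ g
  sumℚ-cong {zero} h = refl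
  sumℚ-cong {suc n} h = cong₂ _+_ (h zero) (sumℚ-cong (λ j → h (suc j)))

  sumℚ-const-zero : ∀ n → sumℚ {n} (λ _ → 0ℚ) ≡ 0ℚ
  sumℚ-const-zero zero = refl
  sumℚ-const-zero (suc n) = trans (ℚP.+-identityˡ _) (sumℚ-const-zero n)

  sumℚ-distrib-+ : ∀ {n} (f g : Fin n → ℚ) → sumℚ (λ j → f j + g j) ≡ sumℚ f + sumℚ g
  sumℚ-distrib-+ {zero} f g = refl
  sumℚ-distrib-+ {suc n} f g =
    trans (cong (f zero + g zero +_) (sumℚ-distrib-+ (λ j → f (suc j)) (λ j → g (suc j)))) (interchange (f zero) (g zero) _ _)
    where
    interchange : ∀ (a b c d : ℚ) → a + b + (c + d) ≡ a + c + (b + d)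
    interchange = solve-∀ ℚ-ring

  sumℚ-*ˡ : ∀ {n} c (f : Fin n → ℚ) → sumℚ (λ j → c * f j) ≡ c * sumℚ f
  sumℚ-*ˡ {zero} c f = sym (ℚP.*-zeroʳ c)
  sumℚ-*ˡ {suc n} c f = trans (cong (c * f zero +_) (sumℚ-*ˡ c (λ j → f (suc j)))) (sym (ℚP.*-distribˡ-+ c (f zero) _))

  sumℚ-neg : ∀ {n} (f : Fin n → ℚ) → sumℚ (λ j → - f j) ≡ - sumℚ f
  sumℚ-neg {zero} f = refl
  sumℚ-neg {suc n} f = trans (cong (- f zero +_) (sumℚ-neg (λ j → f (suc j)))) (sym (ℚP.neg-distrib-+ (f zero) _))

  sumℚ-*ʳ : ∀ {n} c (f : Fin n → ℚ) → sumℚ (λ j → f j * c) ≡ sumℚ f * c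
  sumℚ-*ʳ c f = trans (sumℚ-cong (λ j → ℚP.*-comm (f j) c)) (trans (sumℚ-*ˡ c f) (ℚP.*-comm c _))

  sumℚ-punchIn : ∀ {n} (f : Fin (suc n) → ℚ) (i : Fin (suc n)) → sumℚ f ≡ f i + sumℚ (λ j → f (punchIn i j))
  sumℚ-punchIn f zero = refl
  sumℚ-punchIn {suc n} f (suc i) = trans (cong (f zero +_) (sumℚ-punchIn (λ j → f (suc j)) i)) (swap (f zero) (f (suc i)) _)
    where
    swap : ∀ (a b c : ℚ) → a + (b + c) ≡ b + (a + c)
    swap = solve-∀ ℚ-ring

  Dependence : ∀ {m n} → (Fin m → Fin n → ℚ) → Set
  Dependence {m} {n} v = Σ (Fin m → ℚ) λ a → ¬ (∀ j → a j ≡ 0ℚ) × (∀ k → sumℚ (λ j → a j * v j k) ≡ 0ℚ)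

  module _ {n : ℕ} (v : Fin (suc (suc n)) → Fin (suc n) → ℚ) where

    dependence-zeroColumn : (∀ j → v j zero ≡ 0ℚ) → Dependence (λ j k → v (suc j) (suc k)) → Dependence v
    dependence-zeroColumn col≡0 (b , b≢0 , b-dep) = insertAt b zero 0ℚ , b≢0 ∘′ (λ h j → h (suc j)) , dep
      where
      dep : ∀ k → sumℚ (λ j → insertAt b zero 0ℚ j * v j k) ≡ 0ℚ
      dep zero = trans (cong₂ _+_ (ℚP.*-zeroˡ (v zero zero))
                                  (trans (sumℚ-cong (λ j → trans (cong (b j *_) (col≡0 (suc j))) (ℚP.*-zeroʳ (b j)))) (sumℚ-const-zero (suc n))))
                       (ℚP.+-identityˡ 0ℚ)
      dep (suc k) = trans (cong₂ _+_ (ℚP.*-zeroˡ (v zero (suc k))) (b-dep k)) (ℚP.+-identityˡ 0ℚ)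

    module _ (j₀ : Fin (suc (suc n))) .{{_ : ℚ.NonZero (v j₀ zero)}} where

      multiplier : Fin (suc n) → ℚ
      multiplier j = v (punchIn j₀ j) zero * 1/ v j₀ zero

      dependence-pivot : Dependence (λ j k → v (punchIn j₀ j) (suc k) - multiplier j * v j₀ (suc k)) → Dependence v
      dependence-pivot (b , b≢0 , b-dep) = a , a≢0 , dep
        where
        X : ℚ
        X = sumℚ (λ j → b j * multiplier j)
        a : Fin (suc (suc n)) → ℚ
        a = insertAt b j₀ (- X)
        a≢0 : ¬ (∀ j → a j ≡ 0ℚ)
        a≢0 h = b≢0 (λ j → trans (sym (insertAt-punchIn b j₀ (- X) j)) (h (punchIn j₀ j)))
        eliminate : ∀ k → sumℚ (λ j → a j * v j k) ≡ sumℚ (λ j → b j * (v (punchIn j₀ j) k - multiplier j * v j₀ k))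
        eliminate k = begin
            sumℚ (λ j → a j * v j k)
          ≡⟨ sumℚ-punchIn (λ j → a j * v j k) j₀ ⟩
            a j₀ * v j₀ k + sumℚ (λ j → a (punchIn j₀ j) * v (punchIn j₀ j) k)
          ≡⟨ cong₂ _+_ (cong (_* v j₀ k) (insertAt-lookup b j₀ (- X)))
                       (sumℚ-cong (λ j → cong (_* v (punchIn j₀ j) k) (insertAt-punchIn b j₀ (- X) j))) ⟩
            - X * v j₀ k + sumℚ (λ j → b j * v (punchIn j₀ j) k)
          ≡⟨ cong (_+ sumℚ (λ j → b j * v (punchIn j₀ j) k)) (begin
                - X * v j₀ k                                     ≡⟨ ℚP.neg-distribˡ-* X (v j₀ k) ⟨
                - (X * v j₀ k)                                   ≡⟨ cong -_ (sumℚ-*ʳ (v j₀ k) (λ j → b j * multiplier j)) ⟨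
                - sumℚ (λ j → b j * multiplier j * v j₀ k)       ≡⟨ sumℚ-neg (λ j → b j * multiplier j * v j₀ k) ⟨
                sumℚ (λ j → - (b j * multiplier j * v j₀ k))     ∎) ⟩
            sumℚ (λ j → - (b j * multiplier j * v j₀ k)) + sumℚ (λ j → b j * v (punchIn j₀ j) k)
          ≡⟨ sumℚ-distrib-+ (λ j → - (b j * multiplier j * v j₀ k)) (λ j → b j * v (punchIn j₀ j) k) ⟨
            sumℚ (λ j → - (b j * multiplier j * v j₀ k) + b j * v (punchIn j₀ j) k)
          ≡⟨ sumℚ-cong (λ j → factor (b j) (multiplier j) (v j₀ k) (v (punchIn j₀ j) k)) ⟩
            sumℚ (λ j → b j * (v (punchIn j₀ j) k - multiplier j * v j₀ k))
          ∎
          where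
          open ≡-Reasoning
          factor : ∀ (β γ y z : ℚ) → - (β * γ * y) + β * z ≡ β * (z - γ * y)
          factor = solve-∀ ℚ-ring
        pivot-eliminated : ∀ j → v (punchIn j₀ j) zero - multiplier j * v j₀ zero ≡ 0ℚ
        pivot-eliminated j = p≡q⇒p-q≡0 (sym (begin
          v (punchIn j₀ j) zero * 1/ v j₀ zero * v j₀ zero    ≡⟨ ℚP.*-assoc (v (punchIn j₀ j) zero) (1/ v j₀ zero) (v j₀ zero) ⟩
          v (punchIn j₀ j) zero * (1/ v j₀ zero * v j₀ zero)  ≡⟨ cong (v (punchIn j₀ j) zero *_) (ℚP.*-inverseˡ (v j₀ zero)) ⟩
          v (punchIn j₀ j) zero * 1ℚ                          ≡⟨ ℚP.*-identityʳ _ ⟩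
          v (punchIn j₀ j) zero                               ∎))
          where open ≡-Reasoning
        dep : ∀ k → sumℚ (λ j → a j * v j k) ≡ 0ℚ
        dep zero = trans (eliminate zero) (trans (sumℚ-cong (λ j → trans (cong (b j *_) (pivot-eliminated j)) (ℚP.*-zeroʳ (b j))))
                                                 (sumℚ-const-zero (suc n)))
        dep (suc k) = trans (eliminate (suc k)) (b-dep k)

  linear-dependence : ∀ n (v : Fin (suc n) → Fin n → ℚ) → Dependence v
  linear-dependence zero v = (λ _ → 1ℚ) , (λ h → ℚP.1≢0 (h zero)) , (λ ())
  linear-dependence (suc n) v with FinP.any? (λ j → ¬? (v j zero ℚP.≟ 0ℚ))
  ... | yes (j₀ , pivot≢0) = dependence-pivot v j₀ (linear-dependence n (λ j k → v (punchIn j₀ j) (suc k) - multiplier v j₀ j * v j₀ (suc k)))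
    where
    instance
      pivot-nonZero : ℚ.NonZero (v j₀ zero)
      pivot-nonZero = ℚ.≢-nonZero pivot≢0
  ... | no no-pivot = dependence-zeroColumn v (λ j → decidable-stable (v j zero ℚP.≟ 0ℚ) (λ v≢0 → no-pivot (j , v≢0)))
                                              (linear-dependence n (λ j k → v (suc j) (suc k)))

  module Evaluation {A : Set} {n : ℕ} (a : Fin n → ℚ) (pts : Fin n → A) where

    S : (A → ℚ) → ℚ
    S g = sumℚ (λ j → a j * g (pts j))

    S-+ : ∀ g h → S (λ y → g y + h y) ≡ S g + S h
    S-+ g h = trans (sumℚ-cong (λ j → ℚP.*-distribˡ-+ (a j) (g (pts j)) (h (pts j)))) (sumℚ-distrib-+ (λ j → a j * g (pts j)) (λ j → a j * h (pts j)))

    S-*ˡ : ∀ c g → S (λ y → c * g y) ≡ c * S g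
    S-*ˡ c g = trans (sumℚ-cong (λ j → swap (a j) c (g (pts j)))) (sumℚ-*ˡ c (λ j → a j * g (pts j)))
      where
      swap : ∀ (x c y : ℚ) → x * (c * y) ≡ c * (x * y)
      swap = solve-∀ ℚ-ring

    S-zero : S (λ _ → 0ℚ) ≡ 0ℚ
    S-zero = trans (sumℚ-cong (λ j → ℚP.*-zeroʳ (a j))) (sumℚ-const-zero n)

module Points where

  open Rationals
  open IntervalSums
  open import Data.Nat using (_<?_)
  open import Data.Fin as Fin using (Fin; toℕ; fromℕ<)
  import Data.Fin.Properties as FinP
  open import Data.Rational using (_+_; _*_)

  module _ {a} {A : Set a} {r : ℕ} (z : A) (f : Fin r → A) where

    ext-inside : ∀ i (i<r : i ℕ.< r) → ext z f (suc i) ≡ f (fromℕ< i<r)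
    ext-inside i i<r with i <? r
    ... | yes _ = refl
    ... | no i≮r = ⊥-elim (i≮r i<r)

    ext-outside : ∀ i → r ℕ.≤ i → ext z f (suc i) ≡ z
    ext-outside i r≤i with i <? r
    ... | yes i<r = ⊥-elim (ℕP.<⇒≱ i<r r≤i)
    ... | no _ = refl

    ext-toℕ : ∀ j → ext z f (suc (toℕ j)) ≡ f j
    ext-toℕ j = trans (ext-inside (toℕ j) (FinP.toℕ<n j)) (cong f (FinP.fromℕ<-toℕ j (FinP.toℕ<n j)))

  ext-map : ∀ {a b} {A : Set a} {B : Set b} {r} (g : A → B) {z : A} {z′ : B} (f : Fin r → A) → g z ≡ z′ → ∀ i →
    ext z′ (λ j → g (f j)) i ≡ g (ext z f i)
  ext-map g f gz≡z′ zero = sym gz≡z′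
  ext-map {r = r} g f gz≡z′ (suc i) with i <? r
  ... | yes _ = refl
  ... | no _ = sym gz≡z′

  ext-zipWith : ∀ {a} {A : Set a} {r} (_∙_ : A → A → A) (z : A) (f g : Fin r → A) → z ∙ z ≡ z → ∀ i →
    ext z (λ j → f j ∙ g j) i ≡ ext z f i ∙ ext z g i
  ext-zipWith _∙_ z f g z∙z≡z zero = sym z∙z≡z
  ext-zipWith {r = r} _∙_ z f g z∙z≡z (suc i) with i <? r
  ... | yes _ = refl
  ... | no _ = sym z∙z≡z

  ext-suc : ∀ {a} {A : Set a} {r} (z : A) (f : Fin (suc r) → A) i → ext z f (suc (suc i)) ≡ ext z (λ j → f (Fin.suc j)) (suc i)
  ext-suc {r = r} z f i with i <? r
  ... | yes i<r = ext-inside z f (suc i) (s≤s i<r)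
  ... | no i≮r = ext-outside z f (suc i) (s≤s (ℕP.≮⇒≥ i≮r))

  lamE-outside : ∀ {r} (x : Pt r) i → r ℕ.≤ i → lamE x (suc i) ≡ 0ℚ
  lamE-outside x = ext-outside 0ℚ (lam x)

  muE-outside : ∀ {r} (x : Pt r) i → r ℕ.≤ i → muE x (suc i) ≡ 0ℚ
  muE-outside x = ext-outside 0ℚ (mu x)

  module _ {r : ℕ} where

    lamE-⊕ : ∀ (x y : Pt r) i → lamE (x ⊕ y) i ≡ lamE x i + lamE y i
    lamE-⊕ x y = ext-zipWith _+_ 0ℚ (lam x) (lam y) (ℚP.+-identityʳ 0ℚ)

    muE-⊕ : ∀ (x y : Pt r) i → muE (x ⊕ y) i ≡ muE x i + muE y i
    muE-⊕ x y = ext-zipWith _+_ 0ℚ (mu x) (mu y) (ℚP.+-identityʳ 0ℚ)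

    lamE-· : ∀ c (x : Pt r) i → lamE (c · x) i ≡ c * lamE x i
    lamE-· c x = ext-map (c *_) (lam x) (ℚP.*-zeroʳ c)

    muE-· : ∀ c (x : Pt r) i → muE (c · x) i ≡ c * muE x i
    muE-· c x = ext-map (c *_) (mu x) (ℚP.*-zeroʳ c)

    ext-zero : ∀ i → ext {r = r} 0ℚ (λ _ → 0ℚ) i ≡ 0ℚ
    ext-zero = ext-map (λ _ → 0ℚ) {z = 0ℚ} (λ _ → 0ℚ) refl

    ≈-refl : {x : Pt r} → x ≈ x
    ≈-refl j = refl , refl

    ≈-sym : {x y : Pt r} → x ≈ y → y ≈ x
    ≈-sym x≈y j = sym (proj₁ (x≈y j)) , sym (proj₂ (x≈y j))

    ≈-trans : {x y z : Pt r} → x ≈ y → y ≈ z → x ≈ z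
    ≈-trans x≈y y≈z j = trans (proj₁ (x≈y j)) (proj₁ (y≈z j)) , trans (proj₂ (x≈y j)) (proj₂ (y≈z j))

    ⊕-cong : {x x′ y y′ : Pt r} → x ≈ x′ → y ≈ y′ → (x ⊕ y) ≈ (x′ ⊕ y′)
    ⊕-cong x≈x′ y≈y′ j = cong₂ _+_ (proj₁ (x≈x′ j)) (proj₁ (y≈y′ j)) , cong₂ _+_ (proj₂ (x≈x′ j)) (proj₂ (y≈y′ j))

    ·-cong : ∀ c {x y : Pt r} → x ≈ y → (c · x) ≈ (c · y)
    ·-cong c x≈y j = cong (c *_) (proj₁ (x≈y j)) , cong (c *_) (proj₂ (x≈y j))

    ≈-lamE : {x y : Pt r} → x ≈ y → ∀ i → lamE x i ≡ lamE y i
    ≈-lamE x≈y zero = refl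
    ≈-lamE x≈y (suc i) with i <? r
    ... | yes i<r = proj₁ (x≈y (fromℕ< i<r))
    ... | no _ = refl

    ≈-muE : {x y : Pt r} → x ≈ y → ∀ i → muE x i ≡ muE y i
    ≈-muE x≈y zero = refl
    ≈-muE x≈y (suc i) with i <? r
    ... | yes i<r = proj₂ (x≈y (fromℕ< i<r))
    ... | no _ = refl

    ≈-fromE : {x y : Pt r} → (∀ i → i ℕ.< r → lamE x (suc i) ≡ lamE y (suc i)) →
              (∀ i → i ℕ.< r → muE x (suc i) ≡ muE y (suc i)) → x ≈ y
    ≈-fromE {x} {y} lam≡ mu≡ j =
      trans (sym (ext-toℕ 0ℚ (lam x) j)) (trans (lam≡ (toℕ j) (FinP.toℕ<n j)) (ext-toℕ 0ℚ (lam y) j)) ,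
      trans (sym (ext-toℕ 0ℚ (mu x) j)) (trans (mu≡ (toℕ j) (FinP.toℕ<n j)) (ext-toℕ 0ℚ (mu y) j))

  sumℚ-lsum : ∀ r (f : Fin r → ℚ) → sumℚ f ≡ lsum (range 1 r) (ext 0ℚ f)
  sumℚ-lsum zero f = refl
  sumℚ-lsum (suc r) f = cong₂ _+_ (sym (ext-inside 0ℚ f 0 (s≤s z≤n))) (begin
    sumℚ (λ j → f (Fin.suc j))                                 ≡⟨ sumℚ-lsum r (λ j → f (Fin.suc j)) ⟩
    lsum (range 1 r) (ext 0ℚ (λ j → f (Fin.suc j)))            ≡⟨ lsum-range-cong 1 r (λ { (suc i) _ _ → sym (ext-suc 0ℚ f i) }) ⟩
    lsum (range 1 r) (λ i → ext 0ℚ f (suc i))                  ≡⟨ lsum-range-suc 1 r (ext 0ℚ f) ⟨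
    lsum (range 2 r) (ext 0ℚ f)                                ∎)
    where open ≡-Reasoning

  coordSum-lsum : ∀ {r} (x : Pt r) → coordSum x ≡ lsum (range 1 r) (lamE x) + lsum (range 1 r) (muE x)
  coordSum-lsum {r} x = cong₂ _+_ (sumℚ-lsum r (lam x)) (sumℚ-lsum r (mu x))

  psum-lsum : ∀ {r} (f : Fin r → ℕ) k → ℕtoℚ (psum f k) ≡ lsum (range 1 k) (λ i → ℕtoℚ (extℕ f i))
  psum-lsum f zero = refl
  psum-lsum f (suc k) = begin
    ℕtoℚ (psum f k ℕ.+ extℕ f (suc k))                               ≡⟨ ℕtoℚ-homo-+ (psum f k) _ ⟩
    ℕtoℚ (psum f k) + ℕtoℚ (extℕ f (suc k))                          ≡⟨ cong (_+ ℕtoℚ (extℕ f (suc k))) (psum-lsum f k) ⟩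
    lsum (range 1 k) (λ i → ℕtoℚ (extℕ f i)) + ℕtoℚ (extℕ f (suc k)) ≡⟨ lsum-range-last 1 k (λ i → ℕtoℚ (extℕ f i)) ⟨
    lsum (range 1 (suc k)) (λ i → ℕtoℚ (extℕ f i))                  ∎
    where open ≡-Reasoning

  ext-tabulate : ∀ {a} {A : Set a} {r} (z : A) (g : ℕ → A) → (∀ k → r ℕ.≤ k → g (suc k) ≡ z) → ∀ i →
    ext {r = r} z (λ j → g (suc (toℕ j))) (suc i) ≡ g (suc i)
  ext-tabulate {r = r} z g beyond i with i <? r
  ... | yes i<r = cong (λ k → g (suc k)) (FinP.toℕ-fromℕ< i<r)
  ... | no i≮r = sym (beyond i (ℕP.≮⇒≥ i≮r))

  sumℚ-tabulate : ∀ r (g : ℕ → ℚ) → sumℚ {r} (λ j → g (suc (toℕ j))) ≡ lsum (range 1 r) g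
  sumℚ-tabulate r g = trans (sumℚ-lsum r _) (lsum-range-cong 1 r (λ { (suc i) _ i<r →
    trans (ext-inside 0ℚ _ i (ℕP.≤-pred i<r)) (cong (λ k → g (suc k)) (FinP.toℕ-fromℕ< (ℕP.≤-pred i<r))) }))

module Convexity where

  open Rationals
  open IntervalSums
  open Points
  open import Data.List using (List; []; _∷_; _++_; map)
  open import Data.List.Relation.Unary.All using (All; []; _∷_)
  import Data.List.Relation.Unary.All.Properties as AllP
  open import Data.List.Relation.Unary.Any using (Any; here; there)
  open import Data.Rational using (_+_; _*_; _-_; -_; _≤_; _<_; 1/_)
  open import Data.Product using (map₁)
  open import Relation.Binary.Definitions using (tri<; tri≈; tri>)

  module _ {r : ℕ} where

    WeightedIn : (Pt r → Set) → ℚ × Pt r → Set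
    WeightedIn S (t , y) = (0ℚ ≤ t) × S y

    wsum : List (ℚ × Pt r) → (Pt r → ℚ) → ℚ
    wsum [] φ = 0ℚ
    wsum ((t , y) ∷ l) φ = t * φ y + wsum l φ

    record Linear (φ : Pt r → ℚ) : Set where
      field
        ≈-resp : ∀ {x y} → x ≈ y → φ x ≡ φ y
        combo-wsum : ∀ l → φ (combo l) ≡ wsum l φ
    open Linear public

    lamE-linear : ∀ i → Linear (λ x → lamE x i)
    lamE-linear i .≈-resp x≈y = ≈-lamE x≈y i
    lamE-linear i .combo-wsum [] = ext-zero i
    lamE-linear i .combo-wsum ((t , y) ∷ l) =
      trans (lamE-⊕ (t · y) (combo l) i) (cong₂ _+_ (lamE-· t y i) (lamE-linear i .combo-wsum l))

    muE-linear : ∀ i → Linear (λ x → muE x i)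
    muE-linear i .≈-resp x≈y = ≈-muE x≈y i
    muE-linear i .combo-wsum [] = ext-zero i
    muE-linear i .combo-wsum ((t , y) ∷ l) =
      trans (muE-⊕ (t · y) (combo l) i) (cong₂ _+_ (muE-· t y i) (muE-linear i .combo-wsum l))

    wsum-distrib-+ : ∀ l (φ ψ : Pt r → ℚ) → wsum l (λ x → φ x + ψ x) ≡ wsum l φ + wsum l ψ
    wsum-distrib-+ [] φ ψ = sym (ℚP.+-identityˡ 0ℚ)
    wsum-distrib-+ ((t , y) ∷ l) φ ψ = trans (cong (t * (φ y + ψ y) +_) (wsum-distrib-+ l φ ψ)) (regroup t (φ y) (ψ y) _ _)
      where
      regroup : ∀ (a b c d e : ℚ) → a * (b + c) + (d + e) ≡ a * b + d + (a * c + e)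
      regroup = solve-∀ ℚ-ring

    wsum-neg : ∀ l (φ : Pt r → ℚ) → wsum l (λ x → - φ x) ≡ - wsum l φ
    wsum-neg [] φ = refl
    wsum-neg ((t , y) ∷ l) φ = trans (cong₂ _+_ (sym (ℚP.neg-distribʳ-* t (φ y))) (wsum-neg l φ)) (sym (ℚP.neg-distrib-+ (t * φ y) (wsum l φ)))

    wsum-lsum : ∀ {A : Set} l (xs : List A) (φ : A → Pt r → ℚ) → wsum l (λ x → lsum xs (λ a → φ a x)) ≡ lsum xs (λ a → wsum l (φ a))
    wsum-lsum [] xs φ = sym (lsum-const-zero xs)
    wsum-lsum ((t , y) ∷ l) xs φ = begin
      t * lsum xs (λ a → φ a y) + wsum l (λ x → lsum xs (λ a → φ a x))   ≡⟨ cong₂ _+_ (lsum-*ˡ xs t (λ a → φ a y)) (sym (wsum-lsum l xs φ)) ⟨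
      lsum xs (λ a → t * φ a y) + lsum xs (λ a → wsum l (φ a))            ≡⟨ lsum-distrib-+ xs _ _ ⟨
      lsum xs (λ a → t * φ a y + wsum l (φ a))                            ∎
      where open ≡-Reasoning

    linear-+ : ∀ {φ ψ} → Linear φ → Linear ψ → Linear (λ x → φ x + ψ x)
    linear-+ φ-lin ψ-lin .≈-resp x≈y = cong₂ _+_ (φ-lin .≈-resp x≈y) (ψ-lin .≈-resp x≈y)
    linear-+ {φ} {ψ} φ-lin ψ-lin .combo-wsum l =
      trans (cong₂ _+_ (φ-lin .combo-wsum l) (ψ-lin .combo-wsum l)) (sym (wsum-distrib-+ l φ ψ))

    linear-neg : ∀ {φ} → Linear φ → Linear (λ x → - φ x)
    linear-neg φ-lin .≈-resp x≈y = cong -_ (φ-lin .≈-resp x≈y)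
    linear-neg {φ} φ-lin .combo-wsum l = trans (cong -_ (φ-lin .combo-wsum l)) (sym (wsum-neg l φ))

    linear-- : ∀ {φ ψ} → Linear φ → Linear ψ → Linear (λ x → φ x - ψ x)
    linear-- φ-lin ψ-lin = linear-+ φ-lin (linear-neg ψ-lin)

    linear-lsum : ∀ {A : Set} (xs : List A) {φ : A → Pt r → ℚ} → (∀ a → Linear (φ a)) → Linear (λ x → lsum xs (λ a → φ a x))
    linear-lsum xs φ-lin .≈-resp x≈y = lsum-cong xs (λ a → φ-lin a .≈-resp x≈y)
    linear-lsum xs {φ} φ-lin .combo-wsum l = trans (lsum-cong xs (λ a → φ-lin a .combo-wsum l)) (sym (wsum-lsum l xs φ))

    module _ {S : Pt r → Set} {φ : Pt r → ℚ} where

      wsum-nonNeg : (∀ y → S y → 0ℚ ≤ φ y) → ∀ {l} → All (WeightedIn S) l → 0ℚ ≤ wsum l φ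
      wsum-nonNeg φ≥0 [] = ℚP.≤-refl
      wsum-nonNeg φ≥0 {(t , y) ∷ l} ((t≥0 , Sy) ∷ al) = +-nonNeg (*-nonNeg t≥0 (φ≥0 y Sy)) (wsum-nonNeg φ≥0 al)

      wsum-const : ∀ {c} → (∀ y → S y → φ y ≡ c) → ∀ {l} → All (WeightedIn S) l → wsum l φ ≡ c * sumCoeffs l
      wsum-const {c} φ≡c [] = sym (ℚP.*-zeroʳ c)
      wsum-const {c} φ≡c {(t , y) ∷ l} ((_ , Sy) ∷ al) =
        trans (cong₂ _+_ (trans (cong (t *_) (φ≡c y Sy)) (ℚP.*-comm t c)) (wsum-const φ≡c al)) (sym (ℚP.*-distribˡ-+ c t _))

      linear-const-combo : Linear φ → ∀ {c} → (∀ y → S y → φ y ≡ c) → ∀ {l} → All (WeightedIn S) l → sumCoeffs l ≡ 1ℚ →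
        φ (combo l) ≡ c
      linear-const-combo φ-lin {c} φ≡c {l} al Σ≡1 =
        trans (φ-lin .combo-wsum l) (trans (wsum-const φ≡c al) (trans (cong (c *_) Σ≡1) (ℚP.*-identityʳ c)))

      linear-const-hull : Linear φ → ∀ {c} → (∀ y → S y → φ y ≡ c) → ∀ x → InConvexHull S x → φ x ≡ c
      linear-const-hull φ-lin φ≡c x (l , al , Σ≡1 , x≈l) = trans (φ-lin .≈-resp x≈l) (linear-const-combo φ-lin φ≡c al Σ≡1)

      linear-nonNeg-hull : Linear φ → (∀ y → S y → 0ℚ ≤ φ y) → ∀ x → InConvexHull S x → 0ℚ ≤ φ x
      linear-nonNeg-hull φ-lin φ≥0 x (l , al , _ , x≈l) =
        subst (0ℚ ≤_) (sym (trans (φ-lin .≈-resp x≈l) (φ-lin .combo-wsum l))) (wsum-nonNeg φ≥0 al)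

    rescale : ℚ → List (ℚ × Pt r) → List (ℚ × Pt r)
    rescale c = map (map₁ (c *_))

    sumCoeffs-rescale : ∀ c (l : List (ℚ × Pt r)) → sumCoeffs (rescale c l) ≡ c * sumCoeffs l
    sumCoeffs-rescale c [] = sym (ℚP.*-zeroʳ c)
    sumCoeffs-rescale c ((t , y) ∷ l) = trans (cong (c * t +_) (sumCoeffs-rescale c l)) (sym (ℚP.*-distribˡ-+ c t _))

    sumCoeffs-++ : ∀ (l₁ l₂ : List (ℚ × Pt r)) → sumCoeffs (l₁ ++ l₂) ≡ sumCoeffs l₁ + sumCoeffs l₂
    sumCoeffs-++ [] l₂ = sym (ℚP.+-identityˡ _)
    sumCoeffs-++ ((t , y) ∷ l₁) l₂ = trans (cong (t +_) (sumCoeffs-++ l₁ l₂)) (sym (ℚP.+-assoc t _ _))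

    sumCoeffs-nonNeg : ∀ {S l} → All (WeightedIn S) l → 0ℚ ≤ sumCoeffs l
    sumCoeffs-nonNeg [] = ℚP.≤-refl
    sumCoeffs-nonNeg ((t≥0 , _) ∷ al) = +-nonNeg t≥0 (sumCoeffs-nonNeg al)

    all-rescale : ∀ {S c l} → 0ℚ ≤ c → All (WeightedIn S) l → All (WeightedIn S) (rescale c l)
    all-rescale c≥0 [] = []
    all-rescale c≥0 ((t≥0 , Sy) ∷ al) = (*-nonNeg c≥0 t≥0 , Sy) ∷ all-rescale c≥0 al

    combo-rescale : ∀ c (l : List (ℚ × Pt r)) → combo (rescale c l) ≈ (c · combo l)
    combo-rescale c [] j = sym (ℚP.*-zeroʳ c) , sym (ℚP.*-zeroʳ c)
    combo-rescale c ((t , y) ∷ l) j =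
      trans (cong (c * t * lam y j +_) (proj₁ (combo-rescale c l j))) (factor c t (lam y j) _) ,
      trans (cong (c * t * mu y j +_) (proj₂ (combo-rescale c l j))) (factor c t (mu y j) _)
      where
      factor : ∀ (a b x z : ℚ) → a * b * x + a * z ≡ a * (b * x + z)
      factor = solve-∀ ℚ-ring

    combo-++ : ∀ (l₁ l₂ : List (ℚ × Pt r)) → combo (l₁ ++ l₂) ≈ (combo l₁ ⊕ combo l₂)
    combo-++ [] l₂ j = sym (ℚP.+-identityˡ _) , sym (ℚP.+-identityˡ _)
    combo-++ ((t , y) ∷ l₁) l₂ j =
      trans (cong (t * lam y j +_) (proj₁ (combo-++ l₁ l₂ j))) (sym (ℚP.+-assoc (t * lam y j) _ _)) ,
      trans (cong (t * mu y j +_) (proj₂ (combo-++ l₁ l₂ j))) (sym (ℚP.+-assoc (t * mu y j) _ _))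

    combo-null : ∀ {S l} → All (WeightedIn S) l → sumCoeffs l ≡ 0ℚ → combo l ≈ 0pt
    combo-null [] _ = ≈-refl
    combo-null {l = (t , y) ∷ l} ((t≥0 , _) ∷ al) Σ≡0 j with nonNeg+nonNeg≡0 t≥0 (sumCoeffs-nonNeg al) Σ≡0
    ... | t≡0 , rest≡0 = vanish (lam y j) (proj₁ (combo-null al rest≡0 j)) , vanish (mu y j) (proj₂ (combo-null al rest≡0 j))
      where
      vanish : ∀ a {b} → b ≡ 0ℚ → t * a + b ≡ 0ℚ
      vanish a b≡0 = trans (cong₂ _+_ (trans (cong (_* a) t≡0) (ℚP.*-zeroˡ a)) b≡0) (ℚP.+-identityˡ 0ℚ)

    module _ {S : Pt r → Set} where

      flatten : ∀ {l} → All (WeightedIn (InConvexHull S)) l →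
        Σ (List (ℚ × Pt r)) λ l′ → All (WeightedIn S) l′ × sumCoeffs l′ ≡ sumCoeffs l × combo l′ ≈ combo l
      flatten [] = [] , [] , refl , ≈-refl
      flatten {(t , y) ∷ l} ((t≥0 , (ly , aly , Σly≡1 , y≈ly)) ∷ al) with flatten al
      ... | l′ , al′ , Σl′ , l′≈l =
        rescale t ly ++ l′ ,
        AllP.++⁺ (all-rescale t≥0 aly) al′ ,
        trans (sumCoeffs-++ (rescale t ly) l′) (cong₂ _+_ (trans (sumCoeffs-rescale t ly) (trans (cong (t *_) Σly≡1) (ℚP.*-identityʳ t))) Σl′) ,
        ≈-trans (combo-++ (rescale t ly) l′) (⊕-cong (≈-trans (combo-rescale t ly) (·-cong t (≈-sym y≈ly))) l′≈l)

      hull-combo : ∀ {l} → All (WeightedIn (InConvexHull S)) l → sumCoeffs l ≡ 1ℚ → InConvexHull S (combo l)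
      hull-combo al Σ≡1 with flatten al
      ... | l′ , al′ , Σl′ , l′≈l = l′ , al′ , trans Σl′ Σ≡1 , ≈-sym l′≈l

      ConvexlyClosed : Set
      ConvexlyClosed = ∀ {l} → All (WeightedIn S) l → sumCoeffs l ≡ 1ℚ → S (combo l)

    combo-head-one : ∀ {S θ y l} → θ ≡ 1ℚ → All (WeightedIn S) l → θ + sumCoeffs l ≡ 1ℚ → combo ((θ , y) ∷ l) ≈ y
    combo-head-one {θ = θ} {y} {l} θ≡1 al Σ≡1 j =
      keep (lam y j) (proj₁ (combo-null al rest≡0 j)) , keep (mu y j) (proj₂ (combo-null al rest≡0 j))
      where
      rest≡0 : sumCoeffs l ≡ 0ℚ
      rest≡0 = trans (sym (p+q-p≡q θ (sumCoeffs l))) (trans (cong₂ _-_ Σ≡1 θ≡1) (ℚP.+-inverseʳ 1ℚ))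
      keep : ∀ a {b} → b ≡ 0ℚ → θ * a + b ≡ a
      keep a b≡0 = trans (cong₂ _+_ (cong (_* a) θ≡1) b≡0) (trans (ℚP.+-identityʳ (1ℚ * a)) (ℚP.*-identityˡ a))

    combo-head-zero : ∀ {θ} {y : Pt r} l → θ ≡ 0ℚ → combo ((θ , y) ∷ l) ≈ combo l
    combo-head-zero {θ} {y} l θ≡0 j = drop (lam y j) , drop (mu y j)
      where
      drop : ∀ a {b} → θ * a + b ≡ b
      drop a {b} = trans (cong (λ c → c * a + b) θ≡0) (trans (cong (_+ b) (ℚP.*-zeroˡ a)) (ℚP.+-identityˡ b))

    module _ {θ : ℚ} (y : Pt r) (l : List (ℚ × Pt r)) (θ<1 : θ < 1ℚ) where

      private
        1-θ>0 : 0ℚ < 1ℚ - θ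
        1-θ>0 = subst (_< 1ℚ - θ) (ℚP.+-inverseʳ θ) (ℚP.+-monoˡ-< (- θ) θ<1)
        instance
          1-θ≢0 : ℚ.NonZero (1ℚ - θ)
          1-θ≢0 = ℚP.pos⇒nonZero (1ℚ - θ) {{ℚ.positive 1-θ>0}}

      rest : List (ℚ × Pt r)
      rest = rescale (1/ (1ℚ - θ)) l

      rest-weights : ∀ {S} → All (WeightedIn S) l → All (WeightedIn S) rest
      rest-weights = all-rescale (ℚP.<⇒≤ (ℚP.positive⁻¹ (1/ (1ℚ - θ)) {{ℚP.1/pos⇒pos (1ℚ - θ) {{ℚ.positive 1-θ>0}}}}))

      sumCoeffs-rest : θ + sumCoeffs l ≡ 1ℚ → sumCoeffs rest ≡ 1ℚ
      sumCoeffs-rest Σ≡1 = trans (sumCoeffs-rescale (1/ (1ℚ - θ)) l)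
        (trans (cong (1/ (1ℚ - θ) *_) (trans (sym (p+q-p≡q θ (sumCoeffs l))) (cong (_- θ) Σ≡1))) (ℚP.*-inverseˡ (1ℚ - θ)))

      combo-head-split : combo ((θ , y) ∷ l) ≈ ((θ · y) ⊕ ((1ℚ - θ) · combo rest))
      combo-head-split = ⊕-cong {x = θ · y} ≈-refl (≈-sym (≈-trans (·-cong (1ℚ - θ) (combo-rescale (1/ (1ℚ - θ)) l)) unscale))
        where
        cancel : ∀ a → (1ℚ - θ) * (1/ (1ℚ - θ) * a) ≡ a
        cancel a = trans (sym (ℚP.*-assoc (1ℚ - θ) _ a)) (trans (cong (_* a) (ℚP.*-inverseʳ (1ℚ - θ))) (ℚP.*-identityˡ a))
        unscale : ((1ℚ - θ) · ((1/ (1ℚ - θ)) · combo l)) ≈ combo l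
        unscale j = cancel (lam (combo l) j) , cancel (mu (combo l) j)

    module _ {S : Pt r → Set} (closed : ConvexlyClosed {S}) {x : Pt r} (x-vertex : IsVertex S x) where

      vertex-∈-combo : ∀ {l} → All (WeightedIn S) l → sumCoeffs l ≡ 1ℚ → x ≈ combo l → Any (x ≈_) (map proj₂ l)
      vertex-∈-combo [] 0≡1 _ = ⊥-elim (ℚP.1≢0 (sym 0≡1))
      vertex-∈-combo {(θ , y) ∷ l} ((θ≥0 , Sy) ∷ al) Σ≡1 x≈ with ℚP.<-cmp θ 1ℚ
      ... | tri≈ _ θ≡1 _ = here (≈-trans x≈ (combo-head-one θ≡1 al Σ≡1))
      ... | tri> _ _ θ>1 = ⊥-elim (ℚP.<-irrefl (sym Σ≡1) 1<Σ)
        where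
        1<Σ : 1ℚ < θ + sumCoeffs l
        1<Σ = subst (_< θ + sumCoeffs l) (ℚP.+-identityʳ 1ℚ) (ℚP.+-mono-<-≤ θ>1 (sumCoeffs-nonNeg al))
      ... | tri< θ<1 _ _ with ℚP.<-cmp 0ℚ θ
      ...   | tri< 0<θ _ _ = here (≈-sym (proj₂ x-vertex y (combo (rest y l θ<1)) θ Sy
                                     (closed (rest-weights y l θ<1 al) (sumCoeffs-rest y l θ<1 Σ≡1)) 0<θ θ<1
                                     (≈-trans x≈ (combo-head-split y l θ<1))))
      ...   | tri≈ _ 0≡θ _ = there (vertex-∈-combo al (trans (sym (ℚP.+-identityˡ _)) (trans (cong (_+ sumCoeffs l) 0≡θ) Σ≡1))
                                     (≈-trans x≈ (combo-head-zero {y = y} l (sym 0≡θ))))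
      ...   | tri> _ _ θ<0 = ⊥-elim (ℚP.<-irrefl refl (ℚP.<-≤-trans θ<0 θ≥0))

    linear-pair : ∀ {φ} → Linear φ → ∀ τ σ (y z : Pt r) → φ ((τ · y) ⊕ (σ · z)) ≡ τ * φ y + σ * φ z
    linear-pair {φ} φ-lin τ σ y z =
      trans (φ-lin .≈-resp pair≈) (trans (φ-lin .combo-wsum ((τ , y) ∷ (σ , z) ∷ [])) (cong (τ * φ y +_) (ℚP.+-identityʳ _)))
      where
      pair≈ : ((τ · y) ⊕ (σ · z)) ≈ combo ((τ , y) ∷ (σ , z) ∷ [])
      pair≈ j = cong (τ * lam y j +_) (sym (ℚP.+-identityʳ _)) , cong (τ * mu y j +_) (sym (ℚP.+-identityʳ _))

module KostkaCone where

  open Rationals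
  open IntervalSums
  open Points
  open Convexity
  open import Data.Nat using (_<?_)
  open import Data.Fin using (Fin)
  open import Data.List using ([]; _∷_)
  open import Data.List.Relation.Unary.All using ([]; _∷_)
  open import Data.Rational using (_+_; _*_; _-_; -_; _≤_)

  module _ {r : ℕ} where

    Δλ : ℕ → Pt r → ℚ
    Δλ i x = lamE x i - lamE x (suc i)

    Δμ : ℕ → Pt r → ℚ
    Δμ i x = muE x i - muE x (suc i)

    dominance-gap : Pt r → ℚ
    dominance-gap x = lamE x 1 - muE x 1

    size-gap : Pt r → ℚ
    size-gap x = lsum (range 1 r) (lamE x) - lsum (range 1 r) (muE x)

    Δλ-linear : ∀ i → Linear (Δλ i)
    Δλ-linear i = linear-- (lamE-linear i) (lamE-linear (suc i))

    Δμ-linear : ∀ i → Linear (Δμ i)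
    Δμ-linear i = linear-- (muE-linear i) (muE-linear (suc i))

    dominance-gap-linear : Linear dominance-gap
    dominance-gap-linear = linear-- (lamE-linear 1) (muE-linear 1)

    size-gap-linear : Linear size-gap
    size-gap-linear = linear-- (linear-lsum (range 1 r) lamE-linear) (linear-lsum (range 1 r) muE-linear)

    private
      ℕ-gap-nonNeg : ∀ {a b c d} → a ≡ ℕtoℚ c → b ≡ ℕtoℚ d → d ℕ.≤ c → 0ℚ ≤ a - b
      ℕ-gap-nonNeg refl refl d≤c = p≤q⇒0≤q-p (ℕtoℚ-mono-≤ d≤c)

    partition-antitone : ∀ {f : Fin r → ℕ} → IsPartition r f → ∀ i → 1 ℕ.≤ i → extℕ f (suc i) ℕ.≤ extℕ f i
    partition-antitone {f} f-part i 1≤i = by-cases (i <? r)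
      where
      by-cases : Dec (i ℕ.< r) → extℕ f (suc i) ℕ.≤ extℕ f i
      by-cases (yes i<r) = f-part i 1≤i i<r
      by-cases (no i≮r) = subst (ℕ._≤ extℕ f i) (sym (ext-outside 0 f i (ℕP.≮⇒≥ i≮r))) z≤n

    generator-lamE : ∀ {x} (g : KostkaGen r x) → ∀ i → lamE x i ≡ ℕtoℚ (extℕ (proj₁ (proj₂ g)) i)
    generator-lamE (_ , l , _ , _ , _ , _ , x≈) i = trans (≈-lamE x≈ i) (ext-map ℕtoℚ l refl i)

    generator-muE : ∀ {x} (g : KostkaGen r x) → ∀ i → muE x i ≡ ℕtoℚ (extℕ (proj₁ (proj₂ (proj₂ g))) i)
    generator-muE (_ , _ , m , _ , _ , _ , x≈) i = trans (≈-muE x≈ i) (ext-map ℕtoℚ m refl i)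

    generator-Δλ-nonNeg : ∀ i → 1 ℕ.≤ i → ∀ x → KostkaGen r x → 0ℚ ≤ Δλ i x
    generator-Δλ-nonNeg i 1≤i x g@(_ , _ , _ , (l-part , _) , _) =
      ℕ-gap-nonNeg (generator-lamE g i) (generator-lamE g (suc i)) (partition-antitone l-part i 1≤i)

    generator-Δμ-nonNeg : ∀ i → 1 ℕ.≤ i → ∀ x → KostkaGen r x → 0ℚ ≤ Δμ i x
    generator-Δμ-nonNeg i 1≤i x g@(_ , _ , _ , _ , (m-part , _) , _) =
      ℕ-gap-nonNeg (generator-muE g i) (generator-muE g (suc i)) (partition-antitone m-part i 1≤i)

    generator-dominance-gap-nonNeg : 1 ℕ.≤ r → ∀ x → KostkaGen r x → 0ℚ ≤ dominance-gap x
    generator-dominance-gap-nonNeg 1≤r x g@(_ , _ , _ , _ , _ , l⊵m , _) =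
      ℕ-gap-nonNeg (generator-lamE g 1) (generator-muE g 1) (l⊵m 1 1≤r)

    generator-lsum-lamE : ∀ {x} (g : KostkaGen r x) → lsum (range 1 r) (lamE x) ≡ ℕtoℚ (proj₁ g)
    generator-lsum-lamE g@(_ , l , _ , (_ , l-size) , _) =
      trans (lsum-cong (range 1 r) (generator-lamE g)) (trans (sym (psum-lsum l r)) (cong ℕtoℚ l-size))

    generator-lsum-muE : ∀ {x} (g : KostkaGen r x) → lsum (range 1 r) (muE x) ≡ ℕtoℚ (proj₁ g)
    generator-lsum-muE g@(_ , _ , m , _ , (_ , m-size) , _) =
      trans (lsum-cong (range 1 r) (generator-muE g)) (trans (sym (psum-lsum m r)) (cong ℕtoℚ m-size))

    generator-size-gap : ∀ x → KostkaGen r x → size-gap x ≡ 0ℚ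
    generator-size-gap x g =
      trans (cong₂ _-_ (generator-lsum-lamE g) (generator-lsum-muE g)) (ℚP.+-inverseʳ (ℕtoℚ (proj₁ g)))

    cone-Δλ-nonNeg : ∀ i → 1 ℕ.≤ i → ∀ x → KostkaCone r x → 0ℚ ≤ Δλ i x
    cone-Δλ-nonNeg i 1≤i = linear-nonNeg-hull (Δλ-linear i) (generator-Δλ-nonNeg i 1≤i)

    cone-Δμ-nonNeg : ∀ i → 1 ℕ.≤ i → ∀ x → KostkaCone r x → 0ℚ ≤ Δμ i x
    cone-Δμ-nonNeg i 1≤i = linear-nonNeg-hull (Δμ-linear i) (generator-Δμ-nonNeg i 1≤i)

    cone-dominance-gap-nonNeg : 1 ℕ.≤ r → ∀ x → KostkaCone r x → 0ℚ ≤ dominance-gap x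
    cone-dominance-gap-nonNeg 1≤r = linear-nonNeg-hull dominance-gap-linear (generator-dominance-gap-nonNeg 1≤r)

    cone-size-gap : ∀ x → KostkaCone r x → size-gap x ≡ 0ℚ
    cone-size-gap = linear-const-hull size-gap-linear generator-size-gap

    psum-pointwise-≤ : ∀ (f g : Fin r → ℕ) k → (∀ i → 1 ℕ.≤ i → i ℕ.≤ k → extℕ f i ℕ.≤ extℕ g i) → psum f k ℕ.≤ psum g k
    psum-pointwise-≤ f g zero _ = z≤n
    psum-pointwise-≤ f g (suc k) f≤g = ℕP.+-mono-≤ (psum-pointwise-≤ f g k (λ i 1≤i i≤k → f≤g i 1≤i (ℕP.m≤n⇒m≤1+n i≤k)))
                                                    (f≤g (suc k) (s≤s z≤n) ℕP.≤-refl)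

    psum-monotone : ∀ (f : Fin r → ℕ) {k k′} → k ℕ.≤ k′ → psum f k ℕ.≤ psum f k′
    psum-monotone f {k′ = zero} z≤n = z≤n
    psum-monotone f {k} {suc k′} k≤1+k′ with k ℕP.≟ suc k′
    ... | yes refl = ℕP.≤-refl
    ... | no k≢1+k′ = ℕP.≤-trans (psum-monotone f (ℕP.≤-pred (ℕP.≤∧≢⇒< k≤1+k′ k≢1+k′))) (ℕP.m≤m+n _ _)

    psum-flat : ∀ (f : Fin r → ℕ) {k k′} → k ℕ.≤ k′ → (∀ i → k ℕ.< i → i ℕ.≤ k′ → extℕ f i ≡ 0) → psum f k′ ≡ psum f k
    psum-flat f {k′ = zero} z≤n _ = refl
    psum-flat f {k} {suc k′} k≤1+k′ zeros with k ℕP.≟ suc k′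
    ... | yes refl = refl
    ... | no k≢1+k′ = trans (cong (psum f k′ ℕ.+_) (zeros (suc k′) k<1+k′ ℕP.≤-refl))
                            (trans (ℕP.+-identityʳ _) (psum-flat f (ℕP.≤-pred k<1+k′) (λ i k<i i≤k′ → zeros i k<i (ℕP.m≤n⇒m≤1+n i≤k′))))
      where
      k<1+k′ : k ℕ.< suc k′
      k<1+k′ = ℕP.≤∧≢⇒< k≤1+k′ k≢1+k′

    zero-generator : KostkaGen r 0pt
    zero-generator = 0 , null , null , (zero-partition , psum-zero r) , (zero-partition , psum-zero r) , (λ _ _ → ℕP.≤-refl) , ≈-refl
      where
      null : Fin r → ℕ
      null _ = 0
      extℕ-zero : ∀ i → extℕ null i ≡ 0
      extℕ-zero = ext-map (λ _ → 0) {z = 0} null refl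
      zero-partition : IsPartition r null
      zero-partition i _ _ = ℕP.≤-reflexive (trans (extℕ-zero (suc i)) (sym (extℕ-zero i)))
      psum-zero : ∀ k → psum null k ≡ 0
      psum-zero zero = refl
      psum-zero (suc k) = cong₂ ℕ._+_ (psum-zero k) (extℕ-zero (suc k))

    shrunk-generator-∈-cone : ∀ {g c} → KostkaGen r g → 0ℚ ≤ c → c ≤ 1ℚ → KostkaCone r (c · g)
    shrunk-generator-∈-cone {g} {c} g-gen c≥0 c≤1 =
      (c , g) ∷ (1ℚ - c , 0pt) ∷ [] , (c≥0 , g-gen) ∷ (p≤q⇒0≤q-p c≤1 , zero-generator) ∷ [] , c+[1-c]≡1 c , c·g≈
      where
      c+[1-c]≡1 : ∀ (c : ℚ) → c + ((1ℚ - c) + 0ℚ) ≡ 1ℚ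
      c+[1-c]≡1 = solve-∀ ℚ-ring
      c·g≈ : (c · g) ≈ combo ((c , g) ∷ (1ℚ - c , 0pt) ∷ [])
      c·g≈ j = absorb c (lam g j) , absorb c (mu g j)
        where
        absorb : ∀ (c a : ℚ) → c * a ≡ c * a + ((1ℚ - c) * 0ℚ + 0ℚ)
        absorb = solve-∀ ℚ-ring

module Face (r p′ q′ s′ : ℕ) (hr : p′ ℕ.+ suc q′ ℕ.+ suc s′ ℕ.≤ r) where

  open Rationals
  open IntervalSums
  open FinSums
  open Points
  open Convexity
  open KostkaCone
  open import Data.Fin as Fin using (Fin; toℕ)
  import Data.Fin.Properties as FinP
  open import Data.List using (List; []; _∷_; _++_; map; cartesianProduct; length; lookup)
  import Data.List.Properties as ListP
  open import Data.List.Relation.Unary.All as All using (All; []; _∷_)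
  import Data.List.Relation.Unary.All.Properties as AllP
  open import Data.List.Relation.Unary.Any using (Any)
  open import Data.List.Relation.Unary.AllPairs using (AllPairs; []; _∷_)
  import Data.List.Relation.Unary.AllPairs.Properties as AllPairsP
  import Data.List.Relation.Unary.Unique.Propositional.Properties as UniqueP
  open import Data.Rational using (_+_; _*_; _-_; -_; _≤_; _<_; 1/_)
  open import Data.Sum using (_⊎_; inj₁; inj₂)
  open import Relation.Binary.Definitions using (tri<; tri≈; tri>)
  open import Relation.Nullary.Decidable using (decidable-stable)

  -- Jump coordinates on F

  p q s K m : ℕ
  p = suc p′
  q = suc q′
  s = suc s′
  K = r ℕ.∸ s
  m = suc K

  U T W : List ℕ
  U = range 0 p
  T = range p q
  W = range m s

  F : Pt r → Set
  F = FaceF r p q s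

  s≤r : s ℕ.≤ r
  s≤r = ℕP.≤-trans (ℕP.m≤n+m s (p′ ℕ.+ q)) hr

  K+s≡r : K ℕ.+ s ≡ r
  K+s≡r = ℕP.m∸n+n≡m s≤r

  m+s≡1+r : m ℕ.+ s ≡ suc r
  m+s≡1+r = cong suc K+s≡r

  p′+q≤K : p′ ℕ.+ q ℕ.≤ K
  p′+q≤K = subst (ℕ._≤ K) (ℕP.m+n∸n≡m (p′ ℕ.+ q) s) (ℕP.∸-monoˡ-≤ s hr)

  p′+q≤r : p′ ℕ.+ q ℕ.≤ r
  p′+q≤r = ℕP.≤-trans (ℕP.m≤m+n (p′ ℕ.+ q) s) hr

  p+q≤r : p ℕ.+ q ℕ.≤ r
  p+q≤r = ℕP.≤-trans (ℕP.m<m+n (p′ ℕ.+ q) (s≤s z≤n)) hr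

  p≤r : p ℕ.≤ r
  p≤r = ℕP.≤-trans (ℕP.m≤m+n p q) p+q≤r

  m≤r : m ℕ.≤ r
  m≤r = subst (m ℕ.≤_) K+s≡r (ℕP.m<m+n K (s≤s z≤n))

  p′≤K : p′ ℕ.≤ K
  p′≤K = ℕP.≤-trans (ℕP.m≤m+n p′ q) p′+q≤K

  p+q≤m : p ℕ.+ q ℕ.≤ m
  p+q≤m = s≤s p′+q≤K

  0<r : 0 ℕ.< r
  0<r = ℕP.≤-trans (s≤s z≤n) s≤r

  λ-tail μ-middle : ℕ
  λ-tail = r ℕ.∸ (p′ ℕ.+ q)
  μ-middle = K ℕ.∸ p′

  p+μ-middle≡m : p ℕ.+ μ-middle ≡ m
  p+μ-middle≡m = cong suc (ℕP.m+[n∸m]≡n p′≤K)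

  p+q+λ-tail≡1+r : p ℕ.+ q ℕ.+ λ-tail ≡ suc r
  p+q+λ-tail≡1+r = cong suc (ℕP.m+[n∸m]≡n p′+q≤r)

  λ-blocks : ∀ f → lsum (range 1 r) f ≡ lsum (range 1 p′) f + (lsum T f + lsum (range (p ℕ.+ q) λ-tail) f)
  λ-blocks f = begin
    lsum (range 1 r) f                                           ≡⟨ cong (λ n → lsum (range 1 n) f) (sym (ℕP.m+[n∸m]≡n p′+q≤r)) ⟩
    lsum (range 1 (p′ ℕ.+ q ℕ.+ λ-tail)) f                       ≡⟨ cong (λ n → lsum (range 1 n) f) (ℕP.+-assoc p′ q λ-tail) ⟩
    lsum (range 1 (p′ ℕ.+ (q ℕ.+ λ-tail))) f                     ≡⟨ lsum-range-+ 1 p′ (q ℕ.+ λ-tail) f ⟩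
    lsum (range 1 p′) f + lsum (range p (q ℕ.+ λ-tail)) f        ≡⟨ cong (lsum (range 1 p′) f +_) (lsum-range-+ p q λ-tail f) ⟩
    lsum (range 1 p′) f + (lsum T f + lsum (range (p ℕ.+ q) λ-tail) f) ∎
    where open ≡-Reasoning

  μ-blocks : ∀ f → lsum (range 1 r) f ≡ lsum (range 1 p′) f + (lsum (range p μ-middle) f + lsum W f)
  μ-blocks f = begin
    lsum (range 1 r) f                                            ≡⟨ cong (λ n → lsum (range 1 n) f) (sym K+s≡r) ⟩
    lsum (range 1 (K ℕ.+ s)) f                                    ≡⟨ cong (λ n → lsum (range 1 (n ℕ.+ s)) f) (sym (ℕP.m+[n∸m]≡n p′≤K)) ⟩
    lsum (range 1 (p′ ℕ.+ μ-middle ℕ.+ s)) f                      ≡⟨ cong (λ n → lsum (range 1 n) f) (ℕP.+-assoc p′ μ-middle s) ⟩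
    lsum (range 1 (p′ ℕ.+ (μ-middle ℕ.+ s))) f                    ≡⟨ lsum-range-+ 1 p′ (μ-middle ℕ.+ s) f ⟩
    lsum (range 1 p′) f + lsum (range p (μ-middle ℕ.+ s)) f       ≡⟨ cong (lsum (range 1 p′) f +_) (lsum-range-+ p μ-middle s f) ⟩
    lsum (range 1 p′) f + (lsum (range p μ-middle) f + lsum (range (p ℕ.+ μ-middle) s) f)
                                                                  ≡⟨ cong (λ n → lsum (range 1 p′) f + (lsum (range p μ-middle) f + lsum (range n s) f)) p+μ-middle≡m ⟩
    lsum (range 1 p′) f + (lsum (range p μ-middle) f + lsum W f)  ∎
    where open ≡-Reasoning

  -- δ₀ = λ₁ − μ₁ serves as a jump of μ at index 0, turning λ₁ = μ₁ + δ₀ into Σ α = Σ δ + Σ γ (A≡D+G).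
  α γ δ : Pt r → ℕ → ℚ
  α x t = Δλ t x
  γ x w = Δμ w x
  δ x zero = dominance-gap x
  δ x (suc u) = Δμ (suc u) x

  α-linear : ∀ t → Linear (λ x → α x t)
  α-linear t = Δλ-linear t

  γ-linear : ∀ w → Linear (λ x → γ x w)
  γ-linear w = Δμ-linear w

  δ-linear : ∀ u → Linear (λ x → δ x u)
  δ-linear zero = dominance-gap-linear
  δ-linear (suc u) = Δμ-linear (suc u)

  module _ {x : Pt r} (x∈cone : KostkaCone r x) where

    α-nonNeg : ∀ t → 1 ℕ.≤ t → 0ℚ ≤ α x t
    α-nonNeg t 1≤t = cone-Δλ-nonNeg t 1≤t x x∈cone

    γ-nonNeg : ∀ w → 1 ℕ.≤ w → 0ℚ ≤ γ x w
    γ-nonNeg w 1≤w = cone-Δμ-nonNeg w 1≤w x x∈cone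

    δ-nonNeg : ∀ u → 0ℚ ≤ δ x u
    δ-nonNeg zero = cone-dominance-gap-nonNeg 0<r x x∈cone
    δ-nonNeg (suc u) = cone-Δμ-nonNeg (suc u) (s≤s z≤n) x x∈cone

  module OnFace {x : Pt r} (x∈F : F x) where

    x∈cone : KostkaCone r x
    x∈cone = proj₁ (proj₁ x∈F)

    coordSum≡1 : coordSum x ≡ 1ℚ
    coordSum≡1 = proj₂ (proj₁ x∈F)

    λ-head-flat : ∀ i → 1 ℕ.≤ i → i ℕ.≤ p′ → α x i ≡ 0ℚ
    λ-head-flat i 1≤i i≤p′ = p≡q⇒p-q≡0 (proj₁ (proj₂ x∈F) i 1≤i i≤p′)

    λ-tail-flat : ∀ i → p ℕ.+ q ℕ.≤ i → i ℕ.≤ r → α x i ≡ 0ℚ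
    λ-tail-flat i p+q≤i i≤r = p≡q⇒p-q≡0 (proj₁ (proj₂ (proj₂ x∈F)) i p+q≤i i≤r)

    μ-middle-flat : ∀ i → p ℕ.≤ i → i ℕ.≤ K → γ x i ≡ 0ℚ
    μ-middle-flat i p≤i i≤K = p≡q⇒p-q≡0 (proj₂ (proj₂ (proj₂ x∈F)) i p≤i i≤K)

    lamE-from-α : ∀ i → i ℕ.< r → lamE x (suc i) ≡ lsum T (λ t → 𝟙[ suc i ≤ t ] * α x t)
    lamE-from-α i i<r = begin
      lamE x (suc i)                                                ≡⟨ lsum-tail-differences r (lamE x) (lamE-outside x r ℕP.≤-refl) i (ℕP.<⇒≤ i<r) ⟩
      lsum (range 1 r) g                                            ≡⟨ λ-blocks g ⟩
      lsum (range 1 p′) g + (lsum T g + lsum (range (p ℕ.+ q) λ-tail) g)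
                                                                    ≡⟨ cong₂ (λ a b → a + (lsum T g + b))
                                                                         (lsum-range-zero 1 p′ (λ t 1≤t t<p → vanish t (λ-head-flat t 1≤t (ℕP.≤-pred t<p))))
                                                                         (lsum-range-zero (p ℕ.+ q) λ-tail (λ t p+q≤t t< → vanish t
                                                                            (λ-tail-flat t p+q≤t (ℕP.≤-pred (subst (t ℕ.<_) p+q+λ-tail≡1+r t<))))) ⟩
      0ℚ + (lsum T g + 0ℚ)                                          ≡⟨ trans (ℚP.+-identityˡ _) (ℚP.+-identityʳ _) ⟩
      lsum T g                                                      ∎
      where
      open ≡-Reasoning
      g : ℕ → ℚ
      g t = 𝟙[ suc i ≤ t ] * α x t
      vanish : ∀ t → α x t ≡ 0ℚ → g t ≡ 0ℚ
      vanish t αt≡0 = trans (cong (𝟙[ suc i ≤ t ] *_) αt≡0) (ℚP.*-zeroʳ 𝟙[ suc i ≤ t ])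

    muE-from-δγ : ∀ i → i ℕ.< r → muE x (suc i) ≡ lsum U (λ u → 𝟙[ suc i ≤ u ] * δ x u) + lsum W (λ w → 𝟙[ suc i ≤ w ] * γ x w)
    muE-from-δγ i i<r = begin
      muE x (suc i)                                                 ≡⟨ lsum-tail-differences r (muE x) (muE-outside x r ℕP.≤-refl) i (ℕP.<⇒≤ i<r) ⟩
      lsum (range 1 r) g                                            ≡⟨ μ-blocks g ⟩
      lsum (range 1 p′) g + (lsum (range p μ-middle) g + lsum W g)  ≡⟨ cong (λ a → lsum (range 1 p′) g + (a + lsum W g))
                                                                         (lsum-range-zero p μ-middle (λ t p≤t t< → vanish t
                                                                            (μ-middle-flat t p≤t (ℕP.≤-pred (subst (t ℕ.<_) p+μ-middle≡m t<))))) ⟩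
      lsum (range 1 p′) g + (0ℚ + lsum W g)                         ≡⟨ cong₂ _+_ (trans (sym (ℚP.+-identityˡ (lsum (range 1 p′) g))) (cong₂ _+_ (sym (ℚP.*-zeroˡ (δ x 0)))
                                                                                    (lsum-range-cong 1 p′ {g} {λ u → 𝟙[ suc i ≤ u ] * δ x u} (λ { (suc u) _ _ → refl }))))
                                                                                 (ℚP.+-identityˡ (lsum W g)) ⟩
      lsum U (λ u → 𝟙[ suc i ≤ u ] * δ x u) + lsum W g              ∎
      where
      open ≡-Reasoning
      g : ℕ → ℚ
      g t = 𝟙[ suc i ≤ t ] * (muE x t - muE x (suc t))
      vanish : ∀ t → γ x t ≡ 0ℚ → g t ≡ 0ℚ
      vanish t γt≡0 = trans (cong (𝟙[ suc i ≤ t ] *_) γt≡0) (ℚP.*-zeroʳ 𝟙[ suc i ≤ t ])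

    A D G A₁ D₁ G₁ : ℚ
    A = lsum T (α x)
    D = lsum U (δ x)
    G = lsum W (γ x)
    A₁ = lsum T (λ t → ℕtoℚ t * α x t)
    D₁ = lsum U (λ u → ℕtoℚ u * δ x u)
    G₁ = lsum W (λ w → ℕtoℚ w * γ x w)

    private
      𝟙-below : ∀ {i k} (f : ℕ → ℚ) → i ℕ.≤ k → 𝟙[ i ≤ k ] * f k ≡ f k
      𝟙-below f i≤k = trans (cong (_* f _) (𝟙-≤ i≤k)) (ℚP.*-identityˡ (f _))

    lamE-1≡A : lamE x 1 ≡ A
    lamE-1≡A = trans (lamE-from-α 0 0<r) (lsum-range-cong p q (λ t p≤t _ → 𝟙-below (α x) (ℕP.≤-trans (s≤s z≤n) p≤t)))

    muE-1≡ : muE x 1 ≡ lsum (range 1 p′) (δ x) + G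
    muE-1≡ = trans (muE-from-δγ 0 0<r) (cong₂ _+_
      (trans (cong (_+ lsum (range 1 p′) (λ u → 𝟙[ 1 ≤ u ] * δ x u)) (ℚP.*-zeroˡ (δ x 0)))
             (trans (ℚP.+-identityˡ _) (lsum-range-cong 1 p′ (λ u 1≤u _ → 𝟙-below (δ x) 1≤u))))
      (lsum-range-cong m s (λ w m≤w _ → 𝟙-below (γ x) (ℕP.≤-trans (s≤s z≤n) m≤w))))

    A≡D+G : A ≡ D + G
    A≡D+G = begin
      A                                               ≡⟨ a≡a-b+b A (muE x 1) ⟩
      (A - muE x 1) + muE x 1                         ≡⟨ cong₂ (λ a b → (a - muE x 1) + b) (sym lamE-1≡A) muE-1≡ ⟩
      δ x 0 + (lsum (range 1 p′) (δ x) + G)           ≡⟨ ℚP.+-assoc (δ x 0) _ G ⟨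
      D + G                                           ∎
      where
      open ≡-Reasoning
      a≡a-b+b : ∀ (a b : ℚ) → a ≡ (a - b) + b
      a≡a-b+b = solve-∀ ℚ-ring

    lsum-lamE≡A₁ : lsum (range 1 r) (lamE x) ≡ A₁
    lsum-lamE≡A₁ = begin
      lsum (range 1 r) (lamE x)                                         ≡⟨ lsum-range-cong 1 r (λ { (suc i) _ i<r → lamE-from-α i (ℕP.≤-pred i<r) }) ⟩
      lsum (range 1 r) (λ i → lsum T (λ t → 𝟙[ i ≤ t ] * α x t))        ≡⟨ lsum-comm (range 1 r) T (λ i t → 𝟙[ i ≤ t ] * α x t) ⟩
      lsum T (λ t → lsum (range 1 r) (λ i → 𝟙[ i ≤ t ] * α x t))        ≡⟨ lsum-range-cong p q (λ t _ t<p+q → trans (lsum-*ʳ (range 1 r) (α x t) (λ i → 𝟙[ i ≤ t ]))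
                                                                             (cong (_* α x t) (lsum-𝟙 r t (ℕP.≤-pred (ℕP.≤-trans t<p+q (s≤s p′+q≤r)))))) ⟩
      A₁                                                                ∎
      where open ≡-Reasoning

    lsum-muE≡D₁+G₁ : lsum (range 1 r) (muE x) ≡ D₁ + G₁
    lsum-muE≡D₁+G₁ = begin
      lsum (range 1 r) (muE x)
        ≡⟨ lsum-range-cong 1 r (λ { (suc i) _ i<r → muE-from-δγ i (ℕP.≤-pred i<r) }) ⟩
      lsum (range 1 r) (λ i → lsum U (λ u → 𝟙[ i ≤ u ] * δ x u) + lsum W (λ w → 𝟙[ i ≤ w ] * γ x w))
        ≡⟨ lsum-distrib-+ (range 1 r) _ _ ⟩
      lsum (range 1 r) (λ i → lsum U (λ u → 𝟙[ i ≤ u ] * δ x u)) + lsum (range 1 r) (λ i → lsum W (λ w → 𝟙[ i ≤ w ] * γ x w))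
        ≡⟨ cong₂ _+_ (trans (lsum-comm (range 1 r) U _) (lsum-range-cong 0 p (λ u _ u<p → weigh (δ x) (u<p⇒u≤r u<p))))
                     (trans (lsum-comm (range 1 r) W _) (lsum-range-cong m s (λ w _ w<m+s → weigh (γ x) (w<m+s⇒w≤r w<m+s)))) ⟩
      D₁ + G₁ ∎
      where
      open ≡-Reasoning
      weigh : ∀ (f : ℕ → ℚ) {k} → k ℕ.≤ r → lsum (range 1 r) (λ i → 𝟙[ i ≤ k ] * f k) ≡ ℕtoℚ k * f k
      weigh f {k} k≤r = trans (lsum-*ʳ (range 1 r) (f k) (λ i → 𝟙[ i ≤ k ])) (cong (_* f k) (lsum-𝟙 r k k≤r))
      u<p⇒u≤r : ∀ {u} → u ℕ.< p → u ℕ.≤ r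
      u<p⇒u≤r u<p = ℕP.≤-trans (ℕP.≤-pred u<p) (ℕP.≤-trans (ℕP.m≤m+n p′ q) p′+q≤r)
      w<m+s⇒w≤r : ∀ {w} → w ℕ.< m ℕ.+ s → w ℕ.≤ r
      w<m+s⇒w≤r {w} w<m+s = ℕP.≤-pred (subst (w ℕ.<_) m+s≡1+r w<m+s)

    lsum-lamE≡lsum-muE : lsum (range 1 r) (lamE x) ≡ lsum (range 1 r) (muE x)
    lsum-lamE≡lsum-muE = p-q≡0⇒p≡q _ _ (cone-size-gap x x∈cone)

    A₁+A₁≡1 : A₁ + A₁ ≡ 1ℚ
    A₁+A₁≡1 = begin
      A₁ + A₁                                              ≡⟨ cong₂ _+_ (sym lsum-lamE≡A₁) (trans (sym lsum-lamE≡A₁) lsum-lamE≡lsum-muE) ⟩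
      lsum (range 1 r) (lamE x) + lsum (range 1 r) (muE x) ≡⟨ coordSum-lsum x ⟨
      coordSum x                                           ≡⟨ coordSum≡1 ⟩
      1ℚ                                                   ∎
      where open ≡-Reasoning

    A₁≡D₁+G₁ : A₁ ≡ D₁ + G₁
    A₁≡D₁+G₁ = trans (sym lsum-lamE≡A₁) (trans lsum-lamE≡lsum-muE lsum-muE≡D₁+G₁)

    Z Z′ Z″ : ℚ
    Z = lsum U (λ u → lsum W (λ w → δ x u * γ x w * ℕtoℚ (w ℕ.∸ u)))
    Z′ = lsum T (λ t → lsum W (λ w → α x t * γ x w * ℕtoℚ (w ℕ.∸ t)))
    Z″ = lsum U (λ u → lsum T (λ t → δ x u * α x t * ℕtoℚ (t ℕ.∸ u)))

    private
      pairing : ∀ {xs ys : List ℕ} (f g : ℕ → ℚ) → All (λ a → All (a ℕ.≤_) ys) xs →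
        lsum xs (λ a → lsum ys (λ b → f a * g b * ℕtoℚ (b ℕ.∸ a)))
          ≡ lsum xs f * lsum ys (λ b → ℕtoℚ b * g b) - lsum xs (λ a → ℕtoℚ a * f a) * lsum ys g
      pairing {xs} {ys} f g xs≤ys = trans
        (lsum-congᴬ (All.map (λ {a} a≤ys → lsum-congᴬ (All.map (λ {b} a≤b → cong (f a * g b *_) (ℕtoℚ-homo-∸ a≤b)) a≤ys)) xs≤ys))
        (lsum-bilinear xs ys f ℕtoℚ g ℕtoℚ)

      U≤W : All (λ u → All (u ℕ.≤_) W) U
      U≤W = all-range 0 p (λ u _ u<p → all-range m s (λ w m≤w _ → ℕP.≤-trans (ℕP.≤-pred u<p) (ℕP.≤-trans p′≤K (ℕP.≤-trans (ℕP.n≤1+n K) m≤w))))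

      T≤W : All (λ t → All (t ℕ.≤_) W) T
      T≤W = all-range p q (λ t _ t<p+q → all-range m s (λ w m≤w _ → ℕP.≤-trans (ℕP.<⇒≤ t<p+q) (ℕP.≤-trans p+q≤m m≤w)))

      U≤T : All (λ u → All (u ℕ.≤_) T) U
      U≤T = all-range 0 p (λ u _ u<p → all-range p q (λ t p≤t _ → ℕP.≤-trans (ℕP.<⇒≤ u<p) p≤t))

    Z≡ : Z ≡ D * G₁ - D₁ * G
    Z≡ = pairing (δ x) (γ x) U≤W

    Z′≡Z : Z′ ≡ Z
    Z′≡Z = begin
      Z′                        ≡⟨ pairing (α x) (γ x) T≤W ⟩
      A * G₁ - A₁ * G           ≡⟨ cong₂ (λ a b → a * G₁ - b * G) A≡D+G A₁≡D₁+G₁ ⟩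
      (D + G) * G₁ - (D₁ + G₁) * G ≡⟨ cancel D G D₁ G₁ ⟩
      D * G₁ - D₁ * G           ≡⟨ Z≡ ⟨
      Z                         ∎
      where
      open ≡-Reasoning
      cancel : ∀ (d g d₁ g₁ : ℚ) → (d + g) * g₁ - (d₁ + g₁) * g ≡ d * g₁ - d₁ * g
      cancel = solve-∀ ℚ-ring

    Z″≡Z : Z″ ≡ Z
    Z″≡Z = begin
      Z″                        ≡⟨ pairing (δ x) (α x) U≤T ⟩
      D * A₁ - D₁ * A           ≡⟨ cong₂ (λ a b → D * b - D₁ * a) A≡D+G A₁≡D₁+G₁ ⟩
      D * (D₁ + G₁) - D₁ * (D + G) ≡⟨ cancel D G D₁ G₁ ⟩
      D * G₁ - D₁ * G           ≡⟨ Z≡ ⟨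
      Z                         ∎
      where
      open ≡-Reasoning
      cancel : ∀ (d g d₁ g₁ : ℚ) → d * (d₁ + g₁) - d₁ * (d + g) ≡ d * g₁ - d₁ * g
      cancel = solve-∀ ℚ-ring

    private
      α-nonNegᵀ : All (λ t → 0ℚ ≤ α x t) T
      α-nonNegᵀ = all-range p q (λ t p≤t _ → α-nonNeg x∈cone t (ℕP.≤-trans (s≤s z≤n) p≤t))

      γ-nonNegᵂ : All (λ w → 0ℚ ≤ γ x w) W
      γ-nonNegᵂ = all-range m s (λ w m≤w _ → γ-nonNeg x∈cone w (ℕP.≤-trans (s≤s z≤n) m≤w))

      δ-nonNegᵁ : All (λ u → 0ℚ ≤ δ x u) U
      δ-nonNegᵁ = all-range 0 p (λ u _ _ → δ-nonNeg x∈cone u)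

      A-nonNeg : 0ℚ ≤ A
      A-nonNeg = lsum-nonNegᴬ α-nonNegᵀ

      D-nonNeg : 0ℚ ≤ D
      D-nonNeg = lsum-nonNegᴬ δ-nonNegᵁ

      G-nonNeg : 0ℚ ≤ G
      G-nonNeg = lsum-nonNegᴬ γ-nonNegᵂ

      PQ e : ℕ
      PQ = p′ ℕ.+ q
      e = K ℕ.∸ PQ

      m≡1+PQ+e : ℕtoℚ m ≡ 1ℚ + ℕtoℚ PQ + ℕtoℚ e
      m≡1+PQ+e = begin
        ℕtoℚ (suc K)                          ≡⟨ cong (λ k → ℕtoℚ (suc k)) (ℕP.m+[n∸m]≡n p′+q≤K) ⟨
        ℕtoℚ (1 ℕ.+ (PQ ℕ.+ e))               ≡⟨ ℕtoℚ-homo-+ 1 (PQ ℕ.+ e) ⟩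
        1ℚ + ℕtoℚ (PQ ℕ.+ e)                  ≡⟨ cong (1ℚ +_) (ℕtoℚ-homo-+ PQ e) ⟩
        1ℚ + (ℕtoℚ PQ + ℕtoℚ e)               ≡⟨ ℚP.+-assoc 1ℚ (ℕtoℚ PQ) (ℕtoℚ e) ⟨
        1ℚ + ℕtoℚ PQ + ℕtoℚ e                 ∎
        where open ≡-Reasoning

      G-moment : 0ℚ ≤ G₁ - ℕtoℚ m * G
      G-moment = p≤q⇒0≤q-p (lsum-weight-lower W m γ-nonNegᵂ (all-range m s (λ w m≤w _ → m≤w)))

      A-moment-upper : 0ℚ ≤ ℕtoℚ PQ * A - A₁
      A-moment-upper = p≤q⇒0≤q-p (lsum-weight-upper T PQ α-nonNegᵀ (all-range p q (λ t _ t<p+q → ℕP.≤-pred t<p+q)))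

      A-moment-lower : 0ℚ ≤ A₁ - ℕtoℚ p * A
      A-moment-lower = p≤q⇒0≤q-p (lsum-weight-lower T p α-nonNegᵀ (all-range p q (λ t p≤t _ → p≤t)))

      D-moment-upper : 0ℚ ≤ ℕtoℚ p′ * D - D₁
      D-moment-upper = p≤q⇒0≤q-p (lsum-weight-upper U p′ δ-nonNegᵁ (all-range 0 p (λ u _ u<p → ℕP.≤-pred u<p)))

      Z-AG-nonNeg : 0ℚ ≤ Z - A * G
      Z-AG-nonNeg = subst (0ℚ ≤_) (sym Z-AG≡)
        (+-nonNeg (+-nonNeg (*-nonNeg A-nonNeg G-moment) (*-nonNeg G-nonNeg A-moment-upper)) (*-nonNeg (ℕtoℚ-nonNeg e) (*-nonNeg A-nonNeg G-nonNeg)))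
        where
        expand : ∀ (d g d₁ g₁ pq e : ℚ) → d * g₁ - d₁ * g - (d + g) * g ≡
                 (d + g) * (g₁ - (1ℚ + pq + e) * g) + g * (pq * (d + g) - (d₁ + g₁)) + e * ((d + g) * g)
        expand = solve-∀ ℚ-ring
        shape : ℚ → ℚ → ℚ → ℚ
        shape a a₁ c = a * (G₁ - c * G) + G * (ℕtoℚ PQ * a - a₁) + ℕtoℚ e * (a * G)
        Z-AG≡ : Z - A * G ≡ shape A A₁ (ℕtoℚ m)
        Z-AG≡ = begin
          Z - A * G                                    ≡⟨ cong₂ (λ z a → z - a * G) Z≡ A≡D+G ⟩
          D * G₁ - D₁ * G - (D + G) * G                ≡⟨ expand D G D₁ G₁ (ℕtoℚ PQ) (ℕtoℚ e) ⟩
          shape (D + G) (D₁ + G₁) (1ℚ + ℕtoℚ PQ + ℕtoℚ e) ≡⟨ cong₂ (λ a a₁ → shape a a₁ (1ℚ + ℕtoℚ PQ + ℕtoℚ e)) A≡D+G A₁≡D₁+G₁ ⟨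
          shape A A₁ (1ℚ + ℕtoℚ PQ + ℕtoℚ e)           ≡⟨ cong (shape A A₁) m≡1+PQ+e ⟨
          shape A A₁ (ℕtoℚ m)                          ∎
          where open ≡-Reasoning

      Z-AD-nonNeg : 0ℚ ≤ Z - A * D
      Z-AD-nonNeg = subst (0ℚ ≤_) (sym Z-AD≡) (+-nonNeg (*-nonNeg D-nonNeg A-moment-lower) (*-nonNeg A-nonNeg D-moment-upper))
        where
        expand : ∀ (d a d₁ a₁ p′ : ℚ) → d * a₁ - d₁ * a - a * d ≡ d * (a₁ - (1ℚ + p′) * a) + a * (p′ * d - d₁)
        expand = solve-∀ ℚ-ring
        Z-AD≡ : Z - A * D ≡ D * (A₁ - ℕtoℚ p * A) + A * (ℕtoℚ p′ * D - D₁)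
        Z-AD≡ = begin
          Z - A * D                                          ≡⟨ cong (_- A * D) (trans (sym Z″≡Z) (pairing (δ x) (α x) U≤T)) ⟩
          D * A₁ - D₁ * A - A * D                            ≡⟨ expand D A D₁ A₁ (ℕtoℚ p′) ⟩
          D * (A₁ - (1ℚ + ℕtoℚ p′) * A) + A * (ℕtoℚ p′ * D - D₁) ≡⟨ cong (λ c → D * (A₁ - c * A) + A * (ℕtoℚ p′ * D - D₁)) (ℕtoℚ-homo-+ 1 p′) ⟨
          D * (A₁ - ℕtoℚ p * A) + A * (ℕtoℚ p′ * D - D₁)     ∎
          where open ≡-Reasoning

    A-pos : 0ℚ < A
    A-pos with ℚP.<-cmp 0ℚ A
    ... | tri< 0<A _ _ = 0<A
    ... | tri> _ _ A<0 = ⊥-elim (ℚP.<-irrefl refl (ℚP.<-≤-trans A<0 A-nonNeg))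
    ... | tri≈ _ 0≡A _ = ⊥-elim (ℚP.<-irrefl refl (ℚP.<-≤-trans 0<1 (subst (_≤ 0ℚ) A₁+A₁≡1 (ℚP.+-mono-≤ A₁≤0 A₁≤0))))
      where
      A₁≤0 : A₁ ≤ 0ℚ
      A₁≤0 = subst (A₁ ≤_) (trans (cong (ℕtoℚ PQ *_) (sym 0≡A)) (ℚP.*-zeroʳ (ℕtoℚ PQ))) (0≤q-p⇒p≤q A-moment-upper)

    Z-pos : 0ℚ < Z
    Z-pos = 0<p+p⇒0<p (ℚP.<-≤-trans A²-pos (0≤q-p⇒p≤q (subst (0ℚ ≤_) regroup (+-nonNeg Z-AG-nonNeg Z-AD-nonNeg))))
      where
      A²-pos : 0ℚ < A * A
      A²-pos = ℚP.positive⁻¹ (A * A) {{ℚP.pos*pos⇒pos A {{ℚ.positive A-pos}} A {{ℚ.positive A-pos}}}}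
      collect : ∀ (z a d g : ℚ) → z - a * g + (z - a * d) ≡ z + z - a * (d + g)
      collect = solve-∀ ℚ-ring
      regroup : Z - A * G + (Z - A * D) ≡ Z + Z - A * A
      regroup = trans (collect Z A D G) (cong (λ a → Z + Z - A * a) (sym A≡D+G))

  -- The candidate vertices

  Valid : ℕ → ℕ → ℕ → Set
  Valid u t w = (u ℕ.< p) × (p ℕ.≤ t) × (t ℕ.< p ℕ.+ q) × (m ℕ.≤ w) × (w ℕ.< m ℕ.+ s)

  module Vertex (u t w : ℕ) where

    N : ℕ
    N = 2 ℕ.* t ℕ.* (w ℕ.∸ u)

    -- Agrees with 1 / N because N ≥ 1 for valid triples (N*1/N≡1 below).
    1/N : ℚ
    1/N = 1/suc (N ℕ.∸ 1)

    gλ gμ : ℕ → ℕ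
    gλ i = (w ℕ.∸ u) ℕ.* 𝟙ℕ[ i ≤ t ]
    gμ i = (w ℕ.∸ t) ℕ.* 𝟙ℕ[ i ≤ u ] ℕ.+ (t ℕ.∸ u) ℕ.* 𝟙ℕ[ i ≤ w ]

    gλ′ gμ′ : Fin r → ℕ
    gλ′ j = gλ (suc (toℕ j))
    gμ′ j = gμ (suc (toℕ j))

    generator : Pt r
    generator = pt (λ j → ℕtoℚ (gλ′ j)) (λ j → ℕtoℚ (gμ′ j))

    vertex : Pt r
    vertex = 1/N · generator

    vλ vμ : ℕ → ℚ
    vλ i = 1/N * (ℕtoℚ (w ℕ.∸ u) * 𝟙[ i ≤ t ])
    vμ i = 1/N * (ℕtoℚ (w ℕ.∸ t) * 𝟙[ i ≤ u ] + ℕtoℚ (t ℕ.∸ u) * 𝟙[ i ≤ w ])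

    gλ-ℚ : ∀ i → ℕtoℚ (gλ i) ≡ ℕtoℚ (w ℕ.∸ u) * 𝟙[ i ≤ t ]
    gλ-ℚ i = trans (ℕtoℚ-homo-* (w ℕ.∸ u) 𝟙ℕ[ i ≤ t ]) (cong (ℕtoℚ (w ℕ.∸ u) *_) (ℕtoℚ-𝟙 i t))

    gμ-ℚ : ∀ i → ℕtoℚ (gμ i) ≡ ℕtoℚ (w ℕ.∸ t) * 𝟙[ i ≤ u ] + ℕtoℚ (t ℕ.∸ u) * 𝟙[ i ≤ w ]
    gμ-ℚ i = trans (ℕtoℚ-homo-+ ((w ℕ.∸ t) ℕ.* 𝟙ℕ[ i ≤ u ]) ((t ℕ.∸ u) ℕ.* 𝟙ℕ[ i ≤ w ]))
      (cong₂ _+_ (trans (ℕtoℚ-homo-* (w ℕ.∸ t) 𝟙ℕ[ i ≤ u ]) (cong (ℕtoℚ (w ℕ.∸ t) *_) (ℕtoℚ-𝟙 i u)))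
                 (trans (ℕtoℚ-homo-* (t ℕ.∸ u) 𝟙ℕ[ i ≤ w ]) (cong (ℕtoℚ (t ℕ.∸ u) *_) (ℕtoℚ-𝟙 i w))))

    gλ-beyond : t ℕ.≤ r → ∀ k → r ℕ.≤ k → gλ (suc k) ≡ 0
    gλ-beyond t≤r k r≤k = trans (cong ((w ℕ.∸ u) ℕ.*_) (𝟙ℕ-> (s≤s (ℕP.≤-trans t≤r r≤k)))) (ℕP.*-zeroʳ (w ℕ.∸ u))

    gμ-beyond : u ℕ.≤ r → w ℕ.≤ r → ∀ k → r ℕ.≤ k → gμ (suc k) ≡ 0
    gμ-beyond u≤r w≤r k r≤k = cong₂ ℕ._+_
      (trans (cong ((w ℕ.∸ t) ℕ.*_) (𝟙ℕ-> (s≤s (ℕP.≤-trans u≤r r≤k)))) (ℕP.*-zeroʳ (w ℕ.∸ t)))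
      (trans (cong ((t ℕ.∸ u) ℕ.*_) (𝟙ℕ-> (s≤s (ℕP.≤-trans w≤r r≤k)))) (ℕP.*-zeroʳ (t ℕ.∸ u)))

    vertex-lamE : t ℕ.≤ r → ∀ i → lamE vertex (suc i) ≡ vλ (suc i)
    vertex-lamE t≤r i = begin
      lamE vertex (suc i)                  ≡⟨ lamE-· 1/N generator (suc i) ⟩
      1/N * lamE generator (suc i)       ≡⟨ cong (1/N *_) (ext-map ℕtoℚ gλ′ refl (suc i)) ⟩
      1/N * ℕtoℚ (extℕ gλ′ (suc i))      ≡⟨ cong (λ n → 1/N * ℕtoℚ n) (ext-tabulate 0 gλ (gλ-beyond t≤r) i) ⟩
      1/N * ℕtoℚ (gλ (suc i))            ≡⟨ cong (1/N *_) (gλ-ℚ (suc i)) ⟩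
      vλ (suc i)                           ∎
      where open ≡-Reasoning

    vertex-muE : u ℕ.≤ r → w ℕ.≤ r → ∀ i → muE vertex (suc i) ≡ vμ (suc i)
    vertex-muE u≤r w≤r i = begin
      muE vertex (suc i)                   ≡⟨ muE-· 1/N generator (suc i) ⟩
      1/N * muE generator (suc i)        ≡⟨ cong (1/N *_) (ext-map ℕtoℚ gμ′ refl (suc i)) ⟩
      1/N * ℕtoℚ (extℕ gμ′ (suc i))      ≡⟨ cong (λ n → 1/N * ℕtoℚ n) (ext-tabulate 0 gμ (gμ-beyond u≤r w≤r) i) ⟩
      1/N * ℕtoℚ (gμ (suc i))            ≡⟨ cong (1/N *_) (gμ-ℚ (suc i)) ⟩
      vμ (suc i)                           ∎
      where open ≡-Reasoning

  module ValidVertex {u t w : ℕ} (v : Valid u t w) where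
    open Vertex u t w public

    private
      u<p : u ℕ.< p
      u<p = proj₁ v
      p≤t : p ℕ.≤ t
      p≤t = proj₁ (proj₂ v)
      t<p+q : t ℕ.< p ℕ.+ q
      t<p+q = proj₁ (proj₂ (proj₂ v))
      m≤w : m ℕ.≤ w
      m≤w = proj₁ (proj₂ (proj₂ (proj₂ v)))
      w<m+s : w ℕ.< m ℕ.+ s
      w<m+s = proj₂ (proj₂ (proj₂ (proj₂ v)))

    u≤t : u ℕ.≤ t
    u≤t = ℕP.≤-trans (ℕP.<⇒≤ u<p) p≤t

    u<t : u ℕ.< t
    u<t = ℕP.<-≤-trans u<p p≤t

    t<w : t ℕ.< w
    t<w = ℕP.<-≤-trans t<p+q (ℕP.≤-trans p+q≤m m≤w)

    t≤w : t ℕ.≤ w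
    t≤w = ℕP.<⇒≤ t<w

    u≤w : u ℕ.≤ w
    u≤w = ℕP.≤-trans u≤t t≤w

    w≤r : w ℕ.≤ r
    w≤r = ℕP.≤-pred (subst (w ℕ.<_) m+s≡1+r w<m+s)

    t≤r : t ℕ.≤ r
    t≤r = ℕP.≤-trans t≤w w≤r

    u≤r : u ℕ.≤ r
    u≤r = ℕP.≤-trans u≤t t≤r

    1≤t : 1 ℕ.≤ t
    1≤t = ℕP.≤-trans (s≤s z≤n) p≤t

    1≤N : 1 ℕ.≤ N
    1≤N = ℕP.*-mono-≤ {1} {2 ℕ.* t} {1} {w ℕ.∸ u} (ℕP.*-mono-≤ {1} {2} {1} {t} (s≤s z≤n) 1≤t) (ℕP.m<n⇒0<n∸m (ℕP.<-trans u<t t<w))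

    N*1/N≡1 : ℕtoℚ N * 1/N ≡ 1ℚ
    N*1/N≡1 = trans (cong (λ n → ℕtoℚ n * 1/N) (sym (ℕP.suc-pred N {{ℕ.>-nonZero 1≤N}}))) (1/suc-inverse (N ℕ.∸ 1))

    w∸u≡w∸t+t∸u : w ℕ.∸ u ≡ (w ℕ.∸ t) ℕ.+ (t ℕ.∸ u)
    w∸u≡w∸t+t∸u = begin
      w ℕ.∸ u                                  ≡⟨ cong (ℕ._∸ u) (ℕP.m∸n+n≡m t≤w) ⟨
      (w ℕ.∸ t) ℕ.+ t ℕ.∸ u                    ≡⟨ ℕP.+-∸-assoc (w ℕ.∸ t) u≤t ⟩
      (w ℕ.∸ t) ℕ.+ (t ℕ.∸ u)                  ∎
      where open ≡-Reasoning

    private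
      Wu Wt Tu : ℚ
      Wu = ℕtoℚ (w ℕ.∸ u)
      Wt = ℕtoℚ (w ℕ.∸ t)
      Tu = ℕtoℚ (t ℕ.∸ u)

      Wu≡Wt+Tu : Wu ≡ Wt + Tu
      Wu≡Wt+Tu = trans (cong ℕtoℚ w∸u≡w∸t+t∸u) (ℕtoℚ-homo-+ (w ℕ.∸ t) (t ℕ.∸ u))

    lsum-gλ : lsum (range 1 r) (λ i → ℕtoℚ (gλ i)) ≡ ℕtoℚ (t ℕ.* (w ℕ.∸ u))
    lsum-gλ = begin
      lsum (range 1 r) (λ i → ℕtoℚ (gλ i))          ≡⟨ lsum-cong (range 1 r) gλ-ℚ ⟩
      lsum (range 1 r) (λ i → Wu * 𝟙[ i ≤ t ])      ≡⟨ lsum-*ˡ (range 1 r) Wu (λ i → 𝟙[ i ≤ t ]) ⟩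
      Wu * lsum (range 1 r) (λ i → 𝟙[ i ≤ t ])      ≡⟨ cong (Wu *_) (lsum-𝟙 r t t≤r) ⟩
      Wu * ℕtoℚ t                                   ≡⟨ ℚP.*-comm Wu (ℕtoℚ t) ⟩
      ℕtoℚ t * Wu                                   ≡⟨ ℕtoℚ-homo-* t (w ℕ.∸ u) ⟨
      ℕtoℚ (t ℕ.* (w ℕ.∸ u))                        ∎
      where open ≡-Reasoning

    lsum-gμ : lsum (range 1 r) (λ i → ℕtoℚ (gμ i)) ≡ ℕtoℚ (t ℕ.* (w ℕ.∸ u))
    lsum-gμ = begin
      lsum (range 1 r) (λ i → ℕtoℚ (gμ i))
        ≡⟨ lsum-cong (range 1 r) gμ-ℚ ⟩
      lsum (range 1 r) (λ i → Wt * 𝟙[ i ≤ u ] + Tu * 𝟙[ i ≤ w ])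
        ≡⟨ lsum-distrib-+ (range 1 r) _ _ ⟩
      lsum (range 1 r) (λ i → Wt * 𝟙[ i ≤ u ]) + lsum (range 1 r) (λ i → Tu * 𝟙[ i ≤ w ])
        ≡⟨ cong₂ _+_ (trans (lsum-*ˡ (range 1 r) Wt _) (cong (Wt *_) (lsum-𝟙 r u u≤r)))
                     (trans (lsum-*ˡ (range 1 r) Tu _) (cong (Tu *_) (lsum-𝟙 r w w≤r))) ⟩
      Wt * ℕtoℚ u + Tu * ℕtoℚ w
        ≡⟨ cong₂ (λ a b → a * ℕtoℚ u + b * ℕtoℚ w) (ℕtoℚ-homo-∸ t≤w) (ℕtoℚ-homo-∸ u≤t) ⟩
      (ℕtoℚ w - ℕtoℚ t) * ℕtoℚ u + (ℕtoℚ t - ℕtoℚ u) * ℕtoℚ w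
        ≡⟨ collect (ℕtoℚ w) (ℕtoℚ t) (ℕtoℚ u) ⟩
      ℕtoℚ t * (ℕtoℚ w - ℕtoℚ u)
        ≡⟨ cong (ℕtoℚ t *_) (ℕtoℚ-homo-∸ u≤w) ⟨
      ℕtoℚ t * Wu
        ≡⟨ ℕtoℚ-homo-* t (w ℕ.∸ u) ⟨
      ℕtoℚ (t ℕ.* (w ℕ.∸ u))
        ∎
      where
      open ≡-Reasoning
      collect : ∀ (w t u : ℚ) → (w - t) * u + (t - u) * w ≡ t * (w - u)
      collect = solve-∀ ℚ-ring

    extℕ-gλ′ : ∀ i → extℕ gλ′ (suc i) ≡ gλ (suc i)
    extℕ-gλ′ = ext-tabulate 0 gλ (gλ-beyond t≤r)

    extℕ-gμ′ : ∀ i → extℕ gμ′ (suc i) ≡ gμ (suc i)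
    extℕ-gμ′ = ext-tabulate 0 gμ (gμ-beyond u≤r w≤r)

    size : ℕ
    size = t ℕ.* (w ℕ.∸ u)

    psum-gλ′ : psum gλ′ r ≡ size
    psum-gλ′ = ℕtoℚ-injective (trans (psum-lsum gλ′ r)
      (trans (lsum-range-cong 1 r (λ { (suc i) _ _ → cong ℕtoℚ (extℕ-gλ′ i) })) lsum-gλ))

    psum-gμ′ : psum gμ′ r ≡ size
    psum-gμ′ = ℕtoℚ-injective (trans (psum-lsum gμ′ r)
      (trans (lsum-range-cong 1 r (λ { (suc i) _ _ → cong ℕtoℚ (extℕ-gμ′ i) })) lsum-gμ))

    gλ′-partition : IsPartition r gλ′
    gλ′-partition (suc i) _ _ = subst₂ ℕ._≤_ (sym (extℕ-gλ′ (suc i))) (sym (extℕ-gλ′ i))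
      (ℕP.*-monoʳ-≤ (w ℕ.∸ u) (𝟙ℕ-antitone {suc i} {t}))

    gμ′-partition : IsPartition r gμ′
    gμ′-partition (suc i) _ _ = subst₂ ℕ._≤_ (sym (extℕ-gμ′ (suc i))) (sym (extℕ-gμ′ i))
      (ℕP.+-mono-≤ (ℕP.*-monoʳ-≤ (w ℕ.∸ t) (𝟙ℕ-antitone {suc i} {u})) (ℕP.*-monoʳ-≤ (t ℕ.∸ u) (𝟙ℕ-antitone {suc i} {w})))

    gμ≤gλ : ∀ i → i ℕ.≤ t → gμ i ℕ.≤ gλ i
    gμ≤gλ i i≤t = begin
      (w ℕ.∸ t) ℕ.* 𝟙ℕ[ i ≤ u ] ℕ.+ (t ℕ.∸ u) ℕ.* 𝟙ℕ[ i ≤ w ] ≤⟨ ℕP.+-mono-≤ (ℕP.*-monoʳ-≤ (w ℕ.∸ t) (𝟙ℕ≤1 {i} {u})) ℕP.≤-refl ⟩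
      (w ℕ.∸ t) ℕ.* 1 ℕ.+ (t ℕ.∸ u) ℕ.* 𝟙ℕ[ i ≤ w ]           ≡⟨ cong₂ ℕ._+_ (ℕP.*-identityʳ (w ℕ.∸ t)) (cong ((t ℕ.∸ u) ℕ.*_) (𝟙ℕ-≤ (ℕP.≤-trans i≤t t≤w))) ⟩
      (w ℕ.∸ t) ℕ.+ (t ℕ.∸ u) ℕ.* 1                          ≡⟨ cong ((w ℕ.∸ t) ℕ.+_) (ℕP.*-identityʳ (t ℕ.∸ u)) ⟩
      (w ℕ.∸ t) ℕ.+ (t ℕ.∸ u)                                ≡⟨ w∸u≡w∸t+t∸u ⟨
      w ℕ.∸ u                                                ≡⟨ ℕP.*-identityʳ (w ℕ.∸ u) ⟨
      (w ℕ.∸ u) ℕ.* 1                                        ≡⟨ cong ((w ℕ.∸ u) ℕ.*_) (𝟙ℕ-≤ i≤t) ⟨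
      gλ i                                                   ∎
      where open ℕP.≤-Reasoning

    gλ′-dominates-gμ′ : Dominates r gλ′ gμ′
    gλ′-dominates-gμ′ k k≤r with k ℕ.≤? t
    ... | yes k≤t = psum-pointwise-≤ gμ′ gλ′ k (λ { (suc i) _ i<k →
            subst₂ ℕ._≤_ (sym (extℕ-gμ′ i)) (sym (extℕ-gλ′ i)) (gμ≤gλ (suc i) (ℕP.≤-trans i<k k≤t)) })
    ... | no k≰t = ℕP.≤-trans (psum-monotone gμ′ k≤r) (ℕP.≤-reflexive (trans psum-gμ′ (trans (sym psum-gλ′)
            (psum-flat gλ′ k≤r (λ { (suc i) k<1+i _ → trans (extℕ-gλ′ i)
               (trans (cong ((w ℕ.∸ u) ℕ.*_) (𝟙ℕ-> (ℕP.<-trans (ℕP.≰⇒> k≰t) k<1+i))) (ℕP.*-zeroʳ (w ℕ.∸ u))) })))))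

    generator-gen : KostkaGen r generator
    generator-gen = size , gλ′ , gμ′ , (gλ′-partition , psum-gλ′) , (gμ′-partition , psum-gμ′) , gλ′-dominates-gμ′ , ≈-refl

    1/N-nonNeg : 0ℚ ≤ 1/N
    1/N-nonNeg = ℚP.<⇒≤ (1/suc-pos (N ℕ.∸ 1))

    vertex-∈-cone : KostkaCone r vertex
    vertex-∈-cone = shrunk-generator-∈-cone generator-gen 1/N-nonNeg (1/suc-≤1 (N ℕ.∸ 1))

    vertex-coordSum : coordSum vertex ≡ 1ℚ
    vertex-coordSum = begin
      coordSum vertex
        ≡⟨ coordSum-lsum vertex ⟩
      lsum (range 1 r) (lamE vertex) + lsum (range 1 r) (muE vertex)
        ≡⟨ cong₂ _+_ (trans (lsum-cong (range 1 r) (lamE-· 1/N generator)) (lsum-*ˡ (range 1 r) 1/N (lamE generator)))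
                     (trans (lsum-cong (range 1 r) (muE-· 1/N generator)) (lsum-*ˡ (range 1 r) 1/N (muE generator))) ⟩
      1/N * lsum (range 1 r) (lamE generator) + 1/N * lsum (range 1 r) (muE generator)
        ≡⟨ cong₂ (λ a b → 1/N * a + 1/N * b) (generator-lsum-lamE generator-gen) (generator-lsum-muE generator-gen) ⟩
      1/N * ℕtoℚ size + 1/N * ℕtoℚ size
        ≡⟨ double 1/N (ℕtoℚ size) ⟩
      (ℕtoℚ size + ℕtoℚ size) * 1/N
        ≡⟨ cong (_* 1/N) (trans (cong ℕtoℚ N≡size+size) (ℕtoℚ-homo-+ size size)) ⟨
      ℕtoℚ N * 1/N
        ≡⟨ N*1/N≡1 ⟩
      1ℚ ∎
      where
      open ≡-Reasoning
      double : ∀ (c a : ℚ) → c * a + c * a ≡ (a + a) * c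
      double = solve-∀ ℚ-ring
      N≡size+size : N ≡ size ℕ.+ size
      N≡size+size = trans (ℕP.*-assoc 2 t (w ℕ.∸ u)) (cong (size ℕ.+_) (ℕP.+-identityʳ size))

    vertex-lamE′ : ∀ {i} → 1 ℕ.≤ i → lamE vertex i ≡ vλ i
    vertex-lamE′ {suc i} _ = vertex-lamE t≤r i

    vertex-muE′ : ∀ {i} → 1 ℕ.≤ i → muE vertex i ≡ vμ i
    vertex-muE′ {suc i} _ = vertex-muE u≤r w≤r i

    vλ-step : ∀ {i} → 1 ℕ.≤ i → 𝟙[ i ≤ t ] ≡ 𝟙[ suc i ≤ t ] → H i vertex
    vλ-step {i} 1≤i 𝟙≡ = trans (vertex-lamE′ 1≤i) (trans (cong (λ b → 1/N * (ℕtoℚ (w ℕ.∸ u) * b)) 𝟙≡) (sym (vertex-lamE′ (s≤s z≤n))))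

    vertex-∈-F : F vertex
    vertex-∈-F = (vertex-∈-cone , vertex-coordSum) , head , tail , middle
      where
      head : ∀ i → 1 ℕ.≤ i → i ℕ.≤ p′ → H i vertex
      head i 1≤i i≤p′ = vλ-step 1≤i (trans (𝟙-≤ (ℕP.≤-trans (ℕP.m≤n⇒m≤1+n i≤p′) p≤t)) (sym (𝟙-≤ (ℕP.≤-trans (s≤s i≤p′) p≤t))))
      tail : ∀ i → p ℕ.+ q ℕ.≤ i → i ℕ.≤ r → H i vertex
      tail i p+q≤i _ = vλ-step (ℕP.≤-trans (s≤s z≤n) p+q≤i)
        (trans (𝟙-> (ℕP.<-≤-trans t<p+q p+q≤i)) (sym (𝟙-> (ℕP.<-≤-trans t<p+q (ℕP.m≤n⇒m≤1+n p+q≤i)))))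
      middle : ∀ k → p ℕ.≤ k → k ℕ.≤ K → Ĥ k vertex
      middle k p≤k k≤K = trans (vertex-muE′ 1≤k) (trans (cong₂ (λ a b → 1/N * (ℕtoℚ (w ℕ.∸ t) * a + ℕtoℚ (t ℕ.∸ u) * b))
          (trans (𝟙-> (ℕP.<-≤-trans u<p p≤k)) (sym (𝟙-> (ℕP.<-≤-trans u<p (ℕP.m≤n⇒m≤1+n p≤k)))))
          (trans (𝟙-≤ (ℕP.≤-trans (ℕP.m≤n⇒m≤1+n k≤K) m≤w)) (sym (𝟙-≤ (ℕP.≤-trans (s≤s k≤K) m≤w)))))
        (sym (vertex-muE′ (s≤s z≤n))))
        where
        1≤k : 1 ℕ.≤ k
        1≤k = ℕP.≤-trans (s≤s z≤n) p≤k

    vμ-flat : ∀ {a} → a ≢ u → a ≢ w → vμ a ≡ vμ (suc a)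
    vμ-flat a≢u a≢w = cong₂ (λ y z → 1/N * (Wt * y + Tu * z)) (𝟙-step a≢u) (𝟙-step a≢w)

    below-p≢w : ∀ {a} → a ℕ.< p → a ≢ w
    below-p≢w a<p refl = ℕP.<-irrefl refl (ℕP.<-≤-trans a<p (ℕP.≤-trans (ℕP.≤-trans (ℕP.m≤m+n p q) p+q≤m) m≤w))

    α-vertex-off : ∀ a → 1 ℕ.≤ a → a ≢ t → α vertex a ≡ 0ℚ
    α-vertex-off a 1≤a a≢t = p≡q⇒p-q≡0 (trans (vertex-lamE′ 1≤a)
      (trans (cong (λ b → 1/N * (Wu * b)) (𝟙-step a≢t)) (sym (vertex-lamE′ (s≤s z≤n)))))

    α-vertex-on : α vertex t ≡ 1/N * Wu
    α-vertex-on = begin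
      lamE vertex t - lamE vertex (suc t)        ≡⟨ cong₂ _-_ (vertex-lamE′ 1≤t) (vertex-lamE′ (s≤s z≤n)) ⟩
      vλ t - vλ (suc t)                          ≡⟨ cong₂ (λ a b → 1/N * (Wu * a) - 1/N * (Wu * b)) (𝟙-≤ (ℕP.≤-refl {t})) (𝟙-> (ℕP.n<1+n t)) ⟩
      1/N * (Wu * 1ℚ) - 1/N * (Wu * 0ℚ)          ≡⟨ simplify 1/N Wu ⟩
      1/N * Wu                                   ∎
      where
      open ≡-Reasoning
      simplify : ∀ (c x : ℚ) → c * (x * 1ℚ) - c * (x * 0ℚ) ≡ c * x
      simplify = solve-∀ ℚ-ring

    δ-vertex-off : ∀ a → a ℕ.< p → a ≢ u → δ vertex a ≡ 0ℚ
    δ-vertex-off zero _ 0≢u = begin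
      lamE vertex 1 - muE vertex 1                        ≡⟨ cong₂ _-_ (vertex-lamE′ (s≤s z≤n)) (vertex-muE′ (s≤s z≤n)) ⟩
      vλ 1 - vμ 1                                         ≡⟨ cong₂ (λ a b → 1/N * (Wu * a) - 1/N * (Wt * b + Tu * 𝟙[ 1 ≤ w ])) (𝟙-≤ 1≤t) (𝟙-≤ 1≤u) ⟩
      1/N * (Wu * 1ℚ) - 1/N * (Wt * 1ℚ + Tu * 𝟙[ 1 ≤ w ]) ≡⟨ cong₂ (λ a b → 1/N * (a * 1ℚ) - 1/N * (Wt * 1ℚ + Tu * b)) Wu≡Wt+Tu (𝟙-≤ (ℕP.≤-trans 1≤t t≤w)) ⟩
      1/N * ((Wt + Tu) * 1ℚ) - 1/N * (Wt * 1ℚ + Tu * 1ℚ)  ≡⟨ cancel 1/N Wt Tu ⟩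
      0ℚ                                                  ∎
      where
      open ≡-Reasoning
      1≤u : 1 ℕ.≤ u
      1≤u = ℕP.n≢0⇒n>0 (≢-sym 0≢u)
      cancel : ∀ (c x y : ℚ) → c * ((x + y) * 1ℚ) - c * (x * 1ℚ + y * 1ℚ) ≡ 0ℚ
      cancel = solve-∀ ℚ-ring
    δ-vertex-off (suc a) a<p a≢u =
      p≡q⇒p-q≡0 (trans (vertex-muE′ (s≤s z≤n)) (trans (vμ-flat a≢u (below-p≢w a<p)) (sym (vertex-muE′ (s≤s z≤n)))))

    δ-vertex-on : δ vertex u ≡ 1/N * Wt
    δ-vertex-on = by-cases (u ℕP.≟ 0)
      where
      open ≡-Reasoning
      by-cases : Dec (u ≡ 0) → δ vertex u ≡ 1/N * Wt
      by-cases (yes refl) = begin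
        lamE vertex 1 - muE vertex 1                        ≡⟨ cong₂ _-_ (vertex-lamE′ (s≤s z≤n)) (vertex-muE′ (s≤s z≤n)) ⟩
        vλ 1 - vμ 1                                         ≡⟨ cong₂ (λ a b → 1/N * (Wu * a) - 1/N * (Wt * 0ℚ + Tu * b)) (𝟙-≤ 1≤t) (𝟙-≤ (ℕP.≤-trans 1≤t t≤w)) ⟩
        1/N * (Wu * 1ℚ) - 1/N * (Wt * 0ℚ + Tu * 1ℚ)         ≡⟨ cong (λ a → 1/N * (a * 1ℚ) - 1/N * (Wt * 0ℚ + Tu * 1ℚ)) Wu≡Wt+Tu ⟩
        1/N * ((Wt + Tu) * 1ℚ) - 1/N * (Wt * 0ℚ + Tu * 1ℚ)  ≡⟨ simplify 1/N Wt Tu ⟩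
        1/N * Wt                                            ∎
        where
        simplify : ∀ (c x y : ℚ) → c * ((x + y) * 1ℚ) - c * (x * 0ℚ + y * 1ℚ) ≡ c * x
        simplify = solve-∀ ℚ-ring
      by-cases (no u≢0) = begin
        δ vertex u                                                             ≡⟨ δ≡Δμ (ℕP.n≢0⇒n>0 u≢0) ⟩
        muE vertex u - muE vertex (suc u)                                      ≡⟨ cong₂ _-_ (vertex-muE′ (ℕP.n≢0⇒n>0 u≢0)) (vertex-muE′ (s≤s z≤n)) ⟩
        vμ u - vμ (suc u)                                                      ≡⟨ cong₂ (λ a b → 1/N * (Wt * a + Tu * 𝟙[ u ≤ w ]) - 1/N * (Wt * b + Tu * 𝟙[ suc u ≤ w ]))
                                                                                    (𝟙-≤ (ℕP.≤-refl {u})) (𝟙-> (ℕP.n<1+n u)) ⟩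
        1/N * (Wt * 1ℚ + Tu * 𝟙[ u ≤ w ]) - 1/N * (Wt * 0ℚ + Tu * 𝟙[ suc u ≤ w ]) ≡⟨ cong (λ b → 1/N * (Wt * 1ℚ + Tu * b) - 1/N * (Wt * 0ℚ + Tu * 𝟙[ suc u ≤ w ]))
                                                                                    (𝟙-step (below-p≢w u<p)) ⟩
        1/N * (Wt * 1ℚ + Tu * 𝟙[ suc u ≤ w ]) - 1/N * (Wt * 0ℚ + Tu * 𝟙[ suc u ≤ w ]) ≡⟨ simplify 1/N Wt Tu 𝟙[ suc u ≤ w ] ⟩
        1/N * Wt                                                               ∎
        where
        δ≡Δμ : ∀ {a} → 1 ℕ.≤ a → δ vertex a ≡ Δμ a vertex
        δ≡Δμ {suc a} _ = refl
        simplify : ∀ (c x y z : ℚ) → c * (x * 1ℚ + y * z) - c * (x * 0ℚ + y * z) ≡ c * x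
        simplify = solve-∀ ℚ-ring

    γ-vertex-off : ∀ a → m ℕ.≤ a → a ≢ w → γ vertex a ≡ 0ℚ
    γ-vertex-off a m≤a a≢w = p≡q⇒p-q≡0 (trans (vertex-muE′ 1≤a) (trans (vμ-flat a≢u a≢w) (sym (vertex-muE′ (s≤s z≤n)))))
      where
      1≤a : 1 ℕ.≤ a
      1≤a = ℕP.≤-trans (s≤s z≤n) m≤a
      a≢u : a ≢ u
      a≢u refl = ℕP.<-irrefl refl (ℕP.<-≤-trans u<p (ℕP.≤-trans (ℕP.≤-trans (ℕP.m≤m+n p q) p+q≤m) m≤a))

    γ-vertex-on : γ vertex w ≡ 1/N * Tu
    γ-vertex-on = begin
      muE vertex w - muE vertex (suc w)                                      ≡⟨ cong₂ _-_ (vertex-muE′ (ℕP.≤-trans 1≤t t≤w)) (vertex-muE′ (s≤s z≤n)) ⟩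
      vμ w - vμ (suc w)                                                      ≡⟨ cong₂ (λ a b → 1/N * (Wt * 𝟙[ w ≤ u ] + Tu * a) - 1/N * (Wt * 𝟙[ suc w ≤ u ] + Tu * b))
                                                                                  (𝟙-≤ (ℕP.≤-refl {w})) (𝟙-> (ℕP.n<1+n w)) ⟩
      1/N * (Wt * 𝟙[ w ≤ u ] + Tu * 1ℚ) - 1/N * (Wt * 𝟙[ suc w ≤ u ] + Tu * 0ℚ) ≡⟨ cong (λ a → 1/N * (Wt * a + Tu * 1ℚ) - 1/N * (Wt * 𝟙[ suc w ≤ u ] + Tu * 0ℚ))
                                                                                  (𝟙-step (≢-sym (ℕP.<⇒≢ (ℕP.<-≤-trans u<t t≤w)))) ⟩
      1/N * (Wt * 𝟙[ suc w ≤ u ] + Tu * 1ℚ) - 1/N * (Wt * 𝟙[ suc w ≤ u ] + Tu * 0ℚ) ≡⟨ simplify 1/N Wt Tu 𝟙[ suc w ≤ u ] ⟩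
      1/N * Tu                                                               ∎
      where
      open ≡-Reasoning
      simplify : ∀ (c x y z : ℚ) → c * (x * z + y * 1ℚ) - c * (x * z + y * 0ℚ) ≡ c * y
      simplify = solve-∀ ℚ-ring

    1/N*-pos : ∀ {a b} → a ℕ.< b → 0ℚ < 1/N * ℕtoℚ (b ℕ.∸ a)
    1/N*-pos {a} {b} a<b = ℚP.positive⁻¹ _ {{ℚP.pos*pos⇒pos 1/N {{ℚ.positive (1/suc-pos (N ℕ.∸ 1))}}
      (ℕtoℚ (b ℕ.∸ a)) {{ℕtoℚ-pos (b ℕ.∸ a) {{ℕ.>-nonZero (ℕP.m<n⇒0<n∸m a<b)}}}}}}

  -- Barycentric coordinates on F

  tsum : (ℕ → ℕ → ℕ → ℚ) → ℚ
  tsum f = lsum U (λ u → lsum T (λ t → lsum W (λ w → f u t w)))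

  tsum-cong : ∀ {f g : ℕ → ℕ → ℕ → ℚ} → (∀ u t w → Valid u t w → f u t w ≡ g u t w) → tsum f ≡ tsum g
  tsum-cong f≡g = lsum-range-cong 0 p (λ u _ u<p → lsum-range-cong p q (λ t p≤t t<p+q →
    lsum-range-cong m s (λ w m≤w w<m+s → f≡g u t w (u<p , p≤t , t<p+q , m≤w , w<m+s))))

  tsum-distrib-+ : ∀ (f g : ℕ → ℕ → ℕ → ℚ) → tsum (λ u t w → f u t w + g u t w) ≡ tsum f + tsum g
  tsum-distrib-+ f g = trans
    (lsum-cong U (λ u → trans (lsum-cong T (λ t → lsum-distrib-+ W (f u t) (g u t)))
                              (lsum-distrib-+ T (λ t → lsum W (f u t)) (λ t → lsum W (g u t)))))
    (lsum-distrib-+ U (λ u → lsum T (λ t → lsum W (f u t))) (λ u → lsum T (λ t → lsum W (g u t))))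

  tsum-factorᵘ : ∀ (a : ℕ → ℚ) (b : ℕ → ℕ → ℚ) → tsum (λ u t w → a u * b t w) ≡ lsum U (λ u → a u * lsum T (λ t → lsum W (b t)))
  tsum-factorᵘ a b = lsum-cong U (λ u → trans (lsum-cong T (λ t → lsum-*ˡ W (a u) (b t))) (lsum-*ˡ T (a u) (λ t → lsum W (b t))))

  tsum-factorᵗ : ∀ (a : ℕ → ℚ) (b : ℕ → ℕ → ℚ) → tsum (λ u t w → a t * b u w) ≡ lsum T (λ t → a t * lsum U (λ u → lsum W (b u)))
  tsum-factorᵗ a b = begin
    lsum U (λ u → lsum T (λ t → lsum W (λ w → a t * b u w)))   ≡⟨ lsum-cong U (λ u → lsum-cong T (λ t → lsum-*ˡ W (a t) (b u))) ⟩
    lsum U (λ u → lsum T (λ t → a t * lsum W (b u)))           ≡⟨ lsum-comm U T (λ u t → a t * lsum W (b u)) ⟩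
    lsum T (λ t → lsum U (λ u → a t * lsum W (b u)))           ≡⟨ lsum-cong T (λ t → lsum-*ˡ U (a t) (λ u → lsum W (b u))) ⟩
    lsum T (λ t → a t * lsum U (λ u → lsum W (b u)))           ∎
    where open ≡-Reasoning

  tsum-factorʷ : ∀ (a : ℕ → ℚ) (b : ℕ → ℕ → ℚ) → tsum (λ u t w → a w * b u t) ≡ lsum W (λ w → a w * lsum U (λ u → lsum T (b u)))
  tsum-factorʷ a b = begin
    lsum U (λ u → lsum T (λ t → lsum W (λ w → a w * b u t)))   ≡⟨ lsum-cong U (λ u → lsum-comm T W (λ t w → a w * b u t)) ⟩
    lsum U (λ u → lsum W (λ w → lsum T (λ t → a w * b u t)))   ≡⟨ lsum-comm U W (λ u w → lsum T (λ t → a w * b u t)) ⟩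
    lsum W (λ w → lsum U (λ u → lsum T (λ t → a w * b u t)))   ≡⟨ lsum-cong W (λ w → trans (lsum-cong U (λ u → lsum-*ˡ T (a w) (b u)))
                                                                                               (lsum-*ˡ U (a w) (λ u → lsum T (b u)))) ⟩
    lsum W (λ w → a w * lsum U (λ u → lsum T (b u)))           ∎
    where open ≡-Reasoning

  tsum-single : ∀ (f : ℕ → ℕ → ℕ → ℚ) {u t w} → Valid u t w →
    (∀ u′ t′ w′ → Valid u′ t′ w′ → u′ ≢ u ⊎ t′ ≢ t ⊎ w′ ≢ w → f u′ t′ w′ ≡ 0ℚ) → tsum f ≡ f u t w
  tsum-single f {u} {t} {w} (u<p , p≤t , t<p+q , m≤w , w<m+s) off =
    trans (lsum-range-single 0 p u z≤n u<p (λ u′ _ u′<p u′≢u →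
             lsum-range-zero p q (λ t′ p≤t′ t′<p+q → lsum-range-zero m s (λ w′ m≤w′ w′<m+s →
               off u′ t′ w′ (u′<p , p≤t′ , t′<p+q , m≤w′ , w′<m+s) (inj₁ u′≢u)))))
    (trans (lsum-range-single p q t p≤t t<p+q (λ t′ p≤t′ t′<p+q t′≢t →
             lsum-range-zero m s (λ w′ m≤w′ w′<m+s → off u t′ w′ (u<p , p≤t′ , t′<p+q , m≤w′ , w′<m+s) (inj₂ (inj₁ t′≢t)))))
           (lsum-range-single m s w m≤w w<m+s (λ w′ m≤w′ w′<m+s w′≢w → off u t w′ (u<p , p≤t , t<p+q , m≤w′ , w′<m+s) (inj₂ (inj₂ w′≢w)))))

  Triple : Set
  Triple = ℕ × ℕ × ℕ

  ValidTriple : Triple → Set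
  ValidTriple (u , t , w) = Valid u t w

  triples : List Triple
  triples = cartesianProduct U (cartesianProduct T W)

  lsum-triples : ∀ (f : Triple → ℚ) → lsum triples f ≡ tsum (λ u t w → f (u , t , w))
  lsum-triples f = trans (lsum-cartesianProduct U (cartesianProduct T W) f)
                         (lsum-cong U (λ u → lsum-cartesianProduct T W (λ tw → f (u , tw))))

  all-triples : ∀ {P : Triple → Set} → (∀ u t w → Valid u t w → P (u , t , w)) → All P triples
  all-triples {P} h = all-cartesianProduct U _ (all-range 0 p (λ u _ u<p → all-cartesianProduct T W
    (all-range p q (λ t p≤t t<p+q → all-range m s (λ w m≤w w<m+s → h u t w (u<p , p≤t , t<p+q , m≤w , w<m+s))))))
    where
    all-cartesianProduct : ∀ {A B : Set} {P : A × B → Set} (xs : List A) (ys : List B) →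
      All (λ a → All (λ b → P (a , b)) ys) xs → All P (cartesianProduct xs ys)
    all-cartesianProduct [] ys [] = []
    all-cartesianProduct (x ∷ xs) ys (h ∷ hs) = AllP.++⁺ (AllP.map⁺ h) (all-cartesianProduct xs ys hs)

  vertexᵗ : Triple → Pt r
  vertexᵗ (u , t , w) = Vertex.vertex u t w

  -- Summing the weights θ against the vertex coordinates produces Z for λ but Z′ and Z″ for μ, hence Z′ ≡ Z and Z″ ≡ Z.
  module Decomposition {x : Pt r} (x∈F : F x) where
    open OnFace x∈F

    private
      instance
        Z-nonZero : ℚ.NonZero Z
        Z-nonZero = ℚP.pos⇒nonZero Z {{ℚ.positive Z-pos}}

      Z⁻¹*Z≡1 : 1/ Z * Z ≡ 1ℚ
      Z⁻¹*Z≡1 = ℚP.*-inverseˡ Z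

      cancel-Z : ∀ a → a * 1/ Z * Z ≡ a
      cancel-Z a = trans (ℚP.*-assoc a (1/ Z) Z) (trans (cong (a *_) Z⁻¹*Z≡1) (ℚP.*-identityʳ a))

      cancel-N : ∀ {u t w} → Valid u t w → ∀ a → ℕtoℚ (Vertex.N u t w) * (Vertex.1/N u t w * a) ≡ a
      cancel-N {u} {t} {w} v a = trans (sym (ℚP.*-assoc (ℕtoℚ (Vertex.N u t w)) (Vertex.1/N u t w) a)) (trans (cong (_* a) (ValidVertex.N*1/N≡1 v)) (ℚP.*-identityˡ a))

    θ : ℕ → ℕ → ℕ → ℚ
    θ u t w = ℕtoℚ (Vertex.N u t w) * (α x t * δ x u * γ x w) * 1/ Z

    θ-vanishes : ∀ {u t w} → α x t * δ x u * γ x w ≡ 0ℚ → θ u t w ≡ 0ℚ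
    θ-vanishes {u} {t} {w} αδγ≡0 = trans (cong (λ a → ℕtoℚ (Vertex.N u t w) * a * 1/ Z) αδγ≡0)
      (trans (cong (_* 1/ Z) (ℚP.*-zeroʳ (ℕtoℚ (Vertex.N u t w)))) (ℚP.*-zeroˡ (1/ Z)))

    θ-nonNeg : ∀ {u t w} → Valid u t w → 0ℚ ≤ θ u t w
    θ-nonNeg {u} {t} {w} (_ , p≤t , _ , m≤w , _) =
      *-nonNeg (*-nonNeg (ℕtoℚ-nonNeg (Vertex.N u t w)) (*-nonNeg (*-nonNeg (α-nonNeg x∈cone t (ℕP.≤-trans (s≤s z≤n) p≤t)) (δ-nonNeg x∈cone u))
                                                   (γ-nonNeg x∈cone w (ℕP.≤-trans (s≤s z≤n) m≤w))))
               (ℚP.<⇒≤ (ℚP.positive⁻¹ (1/ Z) {{ℚP.1/pos⇒pos Z {{ℚ.positive Z-pos}}}}))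

    θ-sum : tsum θ ≡ 1ℚ
    θ-sum = begin
      tsum θ                                                                         ≡⟨ lsum-cong U (λ u → lsum-cong T (λ t → lsum-cong W (λ w → regroup u t w))) ⟩
      tsum (λ u t w → ((1ℚ + 1ℚ) * 1/ Z * (ℕtoℚ t * α x t)) * (δ x u * γ x w * ℕtoℚ (w ℕ.∸ u)))
                                                                                     ≡⟨ tsum-factorᵗ (λ t → (1ℚ + 1ℚ) * 1/ Z * (ℕtoℚ t * α x t)) (λ u w → δ x u * γ x w * ℕtoℚ (w ℕ.∸ u)) ⟩
      lsum T (λ t → (1ℚ + 1ℚ) * 1/ Z * (ℕtoℚ t * α x t) * Z)                         ≡⟨ lsum-cong T (λ t → cancel-Z′ (ℕtoℚ t * α x t)) ⟩
      lsum T (λ t → (1ℚ + 1ℚ) * (ℕtoℚ t * α x t))                                    ≡⟨ lsum-*ˡ T (1ℚ + 1ℚ) (λ t → ℕtoℚ t * α x t) ⟩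
      (1ℚ + 1ℚ) * A₁                                                                 ≡⟨ two A₁ ⟩
      A₁ + A₁                                                                        ≡⟨ A₁+A₁≡1 ⟩
      1ℚ                                                                             ∎
      where
      open ≡-Reasoning
      two : ∀ (a : ℚ) → (1ℚ + 1ℚ) * a ≡ a + a
      two = solve-∀ ℚ-ring
      cancel-Z′ : ∀ a → (1ℚ + 1ℚ) * 1/ Z * a * Z ≡ (1ℚ + 1ℚ) * a
      cancel-Z′ a = trans (shuffle (1ℚ + 1ℚ) (1/ Z) a Z) (trans (cong ((1ℚ + 1ℚ) * a *_) Z⁻¹*Z≡1) (ℚP.*-identityʳ _))
        where
        shuffle : ∀ (c i a z : ℚ) → c * i * a * z ≡ c * a * (i * z)
        shuffle = solve-∀ ℚ-ring
      N≡ : ∀ u t w → ℕtoℚ (Vertex.N u t w) ≡ (1ℚ + 1ℚ) * ℕtoℚ t * ℕtoℚ (w ℕ.∸ u)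
      N≡ u t w = trans (ℕtoℚ-homo-* (2 ℕ.* t) (w ℕ.∸ u)) (cong (_* ℕtoℚ (w ℕ.∸ u)) (trans (ℕtoℚ-homo-* 2 t) (cong (_* ℕtoℚ t) (ℕtoℚ-homo-+ 1 1))))
      regroup : ∀ u t w → θ u t w ≡ ((1ℚ + 1ℚ) * 1/ Z * (ℕtoℚ t * α x t)) * (δ x u * γ x w * ℕtoℚ (w ℕ.∸ u))
      regroup u t w = trans (cong (λ n → n * (α x t * δ x u * γ x w) * 1/ Z) (N≡ u t w))
                            (shuffle (ℕtoℚ t) (ℕtoℚ (w ℕ.∸ u)) (α x t) (δ x u) (γ x w) (1/ Z))
        where
        shuffle : ∀ (t w-u a d g i : ℚ) → (1ℚ + 1ℚ) * t * w-u * (a * d * g) * i ≡ ((1ℚ + 1ℚ) * i * (t * a)) * (d * g * w-u)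
        shuffle = solve-∀ ℚ-ring

    θ-lamE : ∀ i → i ℕ.< r → lamE x (suc i) ≡ tsum (λ u t w → θ u t w * Vertex.vλ u t w (suc i))
    θ-lamE i i<r = sym (begin
      tsum (λ u t w → θ u t w * Vertex.vλ u t w (suc i))                          ≡⟨ tsum-cong pointwise ⟩
      tsum (λ u t w → (𝟙[ suc i ≤ t ] * α x t * 1/ Z) * (δ x u * γ x w * ℕtoℚ (w ℕ.∸ u)))
                                                                                   ≡⟨ tsum-factorᵗ (λ t → 𝟙[ suc i ≤ t ] * α x t * 1/ Z) _ ⟩
      lsum T (λ t → 𝟙[ suc i ≤ t ] * α x t * 1/ Z * Z)                             ≡⟨ lsum-cong T (λ t → cancel-Z (𝟙[ suc i ≤ t ] * α x t)) ⟩
      lsum T (λ t → 𝟙[ suc i ≤ t ] * α x t)                                        ≡⟨ lamE-from-α i i<r ⟨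
      lamE x (suc i)                                                               ∎)
      where
      open ≡-Reasoning
      shuffle : ∀ (n c a d g i w-u 𝟙 : ℚ) → n * (a * d * g) * i * (c * (w-u * 𝟙)) ≡ n * (c * ((𝟙 * a * i) * (d * g * w-u)))
      shuffle = solve-∀ ℚ-ring
      pointwise : ∀ u t w → Valid u t w →
        θ u t w * Vertex.vλ u t w (suc i) ≡ (𝟙[ suc i ≤ t ] * α x t * 1/ Z) * (δ x u * γ x w * ℕtoℚ (w ℕ.∸ u))
      pointwise u t w v = trans (shuffle (ℕtoℚ (Vertex.N u t w)) (Vertex.1/N u t w) (α x t) (δ x u) (γ x w) (1/ Z) (ℕtoℚ (w ℕ.∸ u)) 𝟙[ suc i ≤ t ])
                                (cancel-N v _)

    θ-muE : ∀ i → i ℕ.< r → muE x (suc i) ≡ tsum (λ u t w → θ u t w * Vertex.vμ u t w (suc i))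
    θ-muE i i<r = sym (begin
      tsum (λ u t w → θ u t w * Vertex.vμ u t w (suc i))
        ≡⟨ tsum-cong pointwise ⟩
      tsum (λ u t w → (δ x u * 𝟙[ suc i ≤ u ] * 1/ Z) * (α x t * γ x w * ℕtoℚ (w ℕ.∸ t)) + (γ x w * 𝟙[ suc i ≤ w ] * 1/ Z) * (δ x u * α x t * ℕtoℚ (t ℕ.∸ u)))
        ≡⟨ tsum-distrib-+ (λ u t w → (δ x u * 𝟙[ suc i ≤ u ] * 1/ Z) * (α x t * γ x w * ℕtoℚ (w ℕ.∸ t)))
                          (λ u t w → (γ x w * 𝟙[ suc i ≤ w ] * 1/ Z) * (δ x u * α x t * ℕtoℚ (t ℕ.∸ u))) ⟩
      tsum (λ u t w → (δ x u * 𝟙[ suc i ≤ u ] * 1/ Z) * (α x t * γ x w * ℕtoℚ (w ℕ.∸ t)))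
        + tsum (λ u t w → (γ x w * 𝟙[ suc i ≤ w ] * 1/ Z) * (δ x u * α x t * ℕtoℚ (t ℕ.∸ u)))
        ≡⟨ cong₂ _+_ (tsum-factorᵘ (λ u → δ x u * 𝟙[ suc i ≤ u ] * 1/ Z) (λ t w → α x t * γ x w * ℕtoℚ (w ℕ.∸ t)))
                     (tsum-factorʷ (λ w → γ x w * 𝟙[ suc i ≤ w ] * 1/ Z) (λ u t → δ x u * α x t * ℕtoℚ (t ℕ.∸ u))) ⟩
      lsum U (λ u → δ x u * 𝟙[ suc i ≤ u ] * 1/ Z * Z′) + lsum W (λ w → γ x w * 𝟙[ suc i ≤ w ] * 1/ Z * Z″)
        ≡⟨ cong₂ _+_ (lsum-cong U (λ u → trans (cong (δ x u * 𝟙[ suc i ≤ u ] * 1/ Z *_) Z′≡Z) (cancel-Z′ (δ x u) 𝟙[ suc i ≤ u ])))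
                     (lsum-cong W (λ w → trans (cong (γ x w * 𝟙[ suc i ≤ w ] * 1/ Z *_) Z″≡Z) (cancel-Z′ (γ x w) 𝟙[ suc i ≤ w ]))) ⟩
      lsum U (λ u → 𝟙[ suc i ≤ u ] * δ x u) + lsum W (λ w → 𝟙[ suc i ≤ w ] * γ x w)
        ≡⟨ muE-from-δγ i i<r ⟨
      muE x (suc i) ∎)
      where
      open ≡-Reasoning
      cancel-Z′ : ∀ a b → a * b * 1/ Z * Z ≡ b * a
      cancel-Z′ a b = trans (cancel-Z (a * b)) (ℚP.*-comm a b)
      shuffle : ∀ (n c a d g i w-t t-u 𝟙u 𝟙w : ℚ) →
        n * (a * d * g) * i * (c * (w-t * 𝟙u + t-u * 𝟙w)) ≡ n * (c * ((d * 𝟙u * i) * (a * g * w-t) + (g * 𝟙w * i) * (d * a * t-u)))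
      shuffle = solve-∀ ℚ-ring
      pointwise : ∀ u t w → Valid u t w → θ u t w * Vertex.vμ u t w (suc i) ≡
        (δ x u * 𝟙[ suc i ≤ u ] * 1/ Z) * (α x t * γ x w * ℕtoℚ (w ℕ.∸ t)) + (γ x w * 𝟙[ suc i ≤ w ] * 1/ Z) * (δ x u * α x t * ℕtoℚ (t ℕ.∸ u))
      pointwise u t w v = trans (shuffle (ℕtoℚ (Vertex.N u t w)) (Vertex.1/N u t w) (α x t) (δ x u) (γ x w) (1/ Z)
                                         (ℕtoℚ (w ℕ.∸ t)) (ℕtoℚ (t ℕ.∸ u)) 𝟙[ suc i ≤ u ] 𝟙[ suc i ≤ w ])
                                (cancel-N v _)

    θᵗ : Triple → ℚ
    θᵗ (u , t , w) = θ u t w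

    weights : List (ℚ × Pt r)
    weights = map (λ k → θᵗ k , vertexᵗ k) triples

    private
      sumCoeffs-map : ∀ ks → sumCoeffs (map (λ k → θᵗ k , vertexᵗ k) ks) ≡ lsum ks θᵗ
      sumCoeffs-map [] = refl
      sumCoeffs-map (k ∷ ks) = cong (θᵗ k +_) (sumCoeffs-map ks)

      wsum-map : ∀ ks (φ : Pt r → ℚ) → wsum (map (λ k → θᵗ k , vertexᵗ k) ks) φ ≡ lsum ks (λ k → θᵗ k * φ (vertexᵗ k))
      wsum-map [] φ = refl
      wsum-map (k ∷ ks) φ = cong (θᵗ k * φ (vertexᵗ k) +_) (wsum-map ks φ)

    weights-valid : All (WeightedIn F) weights
    weights-valid = AllP.map⁺ (all-triples (λ u t w v → θ-nonNeg v , ValidVertex.vertex-∈-F v))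

    weights-sum : sumCoeffs weights ≡ 1ℚ
    weights-sum = trans (sumCoeffs-map triples) (trans (lsum-triples θᵗ) θ-sum)

    x≈combo-weights : x ≈ combo weights
    x≈combo-weights = ≈-fromE
      (λ i i<r → sym (begin
        lamE (combo weights) (suc i)                                      ≡⟨ lamE-linear (suc i) .combo-wsum weights ⟩
        wsum weights (λ y → lamE y (suc i))                               ≡⟨ wsum-map triples (λ y → lamE y (suc i)) ⟩
        lsum triples (λ k → θᵗ k * lamE (vertexᵗ k) (suc i))              ≡⟨ lsum-triples (λ k → θᵗ k * lamE (vertexᵗ k) (suc i)) ⟩
        tsum (λ u t w → θ u t w * lamE (Vertex.vertex u t w) (suc i))     ≡⟨ tsum-cong (λ u t w v → cong (θ u t w *_) (ValidVertex.vertex-lamE v (ValidVertex.t≤r v) i)) ⟩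
        tsum (λ u t w → θ u t w * Vertex.vλ u t w (suc i))                ≡⟨ θ-lamE i i<r ⟨
        lamE x (suc i)                                                    ∎))
      (λ i i<r → sym (begin
        muE (combo weights) (suc i)                                       ≡⟨ muE-linear (suc i) .combo-wsum weights ⟩
        wsum weights (λ y → muE y (suc i))                                ≡⟨ wsum-map triples (λ y → muE y (suc i)) ⟩
        lsum triples (λ k → θᵗ k * muE (vertexᵗ k) (suc i))               ≡⟨ lsum-triples (λ k → θᵗ k * muE (vertexᵗ k) (suc i)) ⟩
        tsum (λ u t w → θ u t w * muE (Vertex.vertex u t w) (suc i))      ≡⟨ tsum-cong (λ u t w v → cong (θ u t w *_)
                                                                               (ValidVertex.vertex-muE v (ValidVertex.u≤r v) (ValidVertex.w≤r v) i)) ⟩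
        tsum (λ u t w → θ u t w * Vertex.vμ u t w (suc i))                ≡⟨ θ-muE i i<r ⟨
        muE x (suc i)                                                     ∎))
      where open ≡-Reasoning

  -- The vertex set

  F-convex : ConvexlyClosed {S = F}
  F-convex {l} al Σ≡1 = (combo-∈-cone , combo-coordSum) , head , tail , middle
    where
    flat : ∀ {φ} → Linear φ → (∀ y → F y → φ y ≡ 0ℚ) → φ (combo l) ≡ 0ℚ
    flat φ-lin φ≡0 = linear-const-combo φ-lin φ≡0 al Σ≡1
    combo-∈-cone : KostkaCone r (combo l)
    combo-∈-cone = hull-combo (All.map (λ (t≥0 , y∈F) → t≥0 , OnFace.x∈cone y∈F) al) Σ≡1
    combo-coordSum : coordSum (combo l) ≡ 1ℚ
    combo-coordSum = trans (coordSum-lsum (combo l))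
      (linear-const-combo (linear-+ (linear-lsum (range 1 r) lamE-linear) (linear-lsum (range 1 r) muE-linear))
                          (λ y y∈F → trans (sym (coordSum-lsum y)) (OnFace.coordSum≡1 y∈F)) al Σ≡1)
    head : ∀ i → 1 ℕ.≤ i → i ℕ.≤ p′ → H i (combo l)
    head i 1≤i i≤p′ = p-q≡0⇒p≡q _ _ (flat (α-linear i) (λ y y∈F → OnFace.λ-head-flat y∈F i 1≤i i≤p′))
    tail : ∀ i → p ℕ.+ q ℕ.≤ i → i ℕ.≤ r → H i (combo l)
    tail i p+q≤i i≤r = p-q≡0⇒p≡q _ _ (flat (α-linear i) (λ y y∈F → OnFace.λ-tail-flat y∈F i p+q≤i i≤r))
    middle : ∀ k → p ℕ.≤ k → k ℕ.≤ K → Ĥ k (combo l)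
    middle k p≤k k≤K = p-q≡0⇒p≡q _ _ (flat (γ-linear k) (λ y y∈F → OnFace.μ-middle-flat y∈F k p≤k k≤K))

  -- If the vertex splits as τ y + (1 − τ) z inside F, every coordinate vanishing at the vertex vanishes at y,
  -- so the weights of y are concentrated on the vertex's own triple.
  module Extremality {u t w : ℕ} (v : Valid u t w) {y z : Pt r} {τ : ℚ} (y∈F : F y) (z∈F : F z)
                     (0<τ : 0ℚ < τ) (τ<1 : τ < 1ℚ) (v≈ : Vertex.vertex u t w ≈ ((τ · y) ⊕ ((1ℚ - τ) · z))) where
    open ValidVertex v
    open Decomposition y∈F

    zero-inherited : ∀ {φ} → Linear φ → 0ℚ ≤ φ y → 0ℚ ≤ φ z → φ vertex ≡ 0ℚ → φ y ≡ 0ℚ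
    zero-inherited {φ} φ-lin φy≥0 φz≥0 φv≡0 = pos*p+nonNeg*q≡0 0<τ (p≤q⇒0≤q-p (ℚP.<⇒≤ τ<1)) φy≥0 φz≥0
      (trans (sym (linear-pair φ-lin τ (1ℚ - τ) y z)) (trans (sym (φ-lin .≈-resp v≈)) φv≡0))

    private
      inherited : ∀ {φ : Pt r → ℚ} → Linear φ → (∀ {x} → KostkaCone r x → 0ℚ ≤ φ x) → φ vertex ≡ 0ℚ → φ y ≡ 0ℚ
      inherited φ-lin φ≥0 = zero-inherited φ-lin (φ≥0 (OnFace.x∈cone y∈F)) (φ≥0 (OnFace.x∈cone z∈F))
      product-zero : ∀ (a b c : ℚ) → a ≡ 0ℚ ⊎ b ≡ 0ℚ ⊎ c ≡ 0ℚ → a * b * c ≡ 0ℚ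
      product-zero a b c (inj₁ refl) = trans (cong (_* c) (ℚP.*-zeroˡ b)) (ℚP.*-zeroˡ c)
      product-zero a b c (inj₂ (inj₁ refl)) = trans (cong (_* c) (ℚP.*-zeroʳ a)) (ℚP.*-zeroˡ c)
      product-zero a b c (inj₂ (inj₂ refl)) = ℚP.*-zeroʳ (a * b)

    θ-off : ∀ u′ t′ w′ → Valid u′ t′ w′ → u′ ≢ u ⊎ t′ ≢ t ⊎ w′ ≢ w → θ u′ t′ w′ ≡ 0ℚ
    θ-off u′ t′ w′ (u′<p , p≤t′ , _ , m≤w′ , _) differs = θ-vanishes {u′} {t′} {w′} (product-zero (α y t′) (δ y u′) (γ y w′) (factor-zero differs))
      where
      1≤t′ : 1 ℕ.≤ t′
      1≤t′ = ℕP.≤-trans (s≤s z≤n) p≤t′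
      1≤w′ : 1 ℕ.≤ w′
      1≤w′ = ℕP.≤-trans (s≤s z≤n) m≤w′
      factor-zero : u′ ≢ u ⊎ t′ ≢ t ⊎ w′ ≢ w → α y t′ ≡ 0ℚ ⊎ δ y u′ ≡ 0ℚ ⊎ γ y w′ ≡ 0ℚ
      factor-zero (inj₁ u′≢u) = inj₂ (inj₁ (inherited (δ-linear u′) (λ x∈cone → δ-nonNeg x∈cone u′) (δ-vertex-off u′ u′<p u′≢u)))
      factor-zero (inj₂ (inj₁ t′≢t)) = inj₁ (inherited (α-linear t′) (λ x∈cone → α-nonNeg x∈cone t′ 1≤t′) (α-vertex-off t′ 1≤t′ t′≢t))
      factor-zero (inj₂ (inj₂ w′≢w)) = inj₂ (inj₂ (inherited (γ-linear w′) (λ x∈cone → γ-nonNeg x∈cone w′ 1≤w′) (γ-vertex-off w′ m≤w′ w′≢w)))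

    θ-on : θ u t w ≡ 1ℚ
    θ-on = trans (sym (tsum-single θ v θ-off)) θ-sum

    concentrated : ∀ (f : ℕ → ℕ → ℕ → ℚ) → tsum (λ u′ t′ w′ → θ u′ t′ w′ * f u′ t′ w′) ≡ f u t w
    concentrated f = begin
      tsum (λ u′ t′ w′ → θ u′ t′ w′ * f u′ t′ w′)  ≡⟨ tsum-single _ v (λ u′ t′ w′ v′ differs → trans (cong (_* f u′ t′ w′) (θ-off u′ t′ w′ v′ differs))
                                                                                                 (ℚP.*-zeroˡ (f u′ t′ w′))) ⟩
      θ u t w * f u t w                           ≡⟨ cong (_* f u t w) θ-on ⟩
      1ℚ * f u t w                                ≡⟨ ℚP.*-identityˡ (f u t w) ⟩
      f u t w                                     ∎
      where open ≡-Reasoning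

    vertex≈y : vertex ≈ y
    vertex≈y = ≈-fromE
      (λ i i<r → trans (vertex-lamE t≤r i) (sym (trans (θ-lamE i i<r) (concentrated (λ u′ t′ w′ → Vertex.vλ u′ t′ w′ (suc i))))))
      (λ i i<r → trans (vertex-muE u≤r w≤r i) (sym (trans (θ-muE i i<r) (concentrated (λ u′ t′ w′ → Vertex.vμ u′ t′ w′ (suc i))))))

  vertex-isVertex : ∀ {u t w} → Valid u t w → IsVertex F (Vertex.vertex u t w)
  vertex-isVertex v = ValidVertex.vertex-∈-F v , λ y z τ y∈F z∈F 0<τ τ<1 v≈ → ≈-sym (Extremality.vertex≈y v y∈F z∈F 0<τ τ<1 v≈)

  module _ {u t w u′ t′ w′ : ℕ} (v : Valid u t w) (v′ : Valid u′ t′ w′)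
           (v≈v′ : Vertex.vertex u t w ≈ Vertex.vertex u′ t′ w′) where
    private
      module V = ValidVertex v
      module V′ = ValidVertex v′
      pos≢0 : ∀ {a} → 0ℚ < a → a ≢ 0ℚ
      pos≢0 0<a a≡0 = ℚP.<-irrefl (sym a≡0) 0<a

    vertex-t-injective : t ≡ t′
    vertex-t-injective = decidable-stable (t ℕP.≟ t′) λ t≢t′ →
      pos≢0 (V.1/N*-pos (ℕP.<-trans V.u<t V.t<w))
            (trans (sym V.α-vertex-on) (trans (α-linear t .≈-resp v≈v′) (V′.α-vertex-off t V.1≤t t≢t′)))

    vertex-u-injective : u ≡ u′
    vertex-u-injective = decidable-stable (u ℕP.≟ u′) λ u≢u′ →
      pos≢0 (V.1/N*-pos V.t<w) (trans (sym V.δ-vertex-on) (trans (δ-linear u .≈-resp v≈v′) (V′.δ-vertex-off u (proj₁ v) u≢u′)))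

    vertex-w-injective : w ≡ w′
    vertex-w-injective = decidable-stable (w ℕP.≟ w′) λ w≢w′ →
      pos≢0 (V.1/N*-pos V.u<t) (trans (sym V.γ-vertex-on) (trans (γ-linear w .≈-resp v≈v′) (V′.γ-vertex-off w (proj₁ (proj₂ (proj₂ (proj₂ v)))) w≢w′)))

  vertexᵗ-injective : ∀ {k k′} → ValidTriple k → ValidTriple k′ → vertexᵗ k ≈ vertexᵗ k′ → k ≡ k′
  vertexᵗ-injective v v′ v≈v′ =
    cong₂ _,_ (vertex-u-injective v v′ v≈v′) (cong₂ _,_ (vertex-t-injective v v′ v≈v′) (vertex-w-injective v v′ v≈v′))

  vertices : List (Pt r)
  vertices = map vertexᵗ triples

  private
    length-range : ∀ a n → length (range a n) ≡ n
    length-range a zero = refl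
    length-range a (suc n) = cong suc (length-range (suc a) n)

    length-cartesianProduct : ∀ {A B : Set} (xs : List A) (ys : List B) → length (cartesianProduct xs ys) ≡ length xs ℕ.* length ys
    length-cartesianProduct [] ys = refl
    length-cartesianProduct (x ∷ xs) ys =
      trans (ListP.length-++ (map (x ,_) ys)) (cong₂ ℕ._+_ (ListP.length-map (x ,_) ys) (length-cartesianProduct xs ys))

    range-unique : ∀ a n → AllPairs _≢_ (range a n)
    range-unique a zero = []
    range-unique a (suc n) = all-range (suc a) n (λ i a<i _ a≡i → ℕP.<-irrefl a≡i a<i) ∷ range-unique (suc a) n

    allPairs-restrict : ∀ {A : Set} {P : A → Set} {R S : A → A → Set} {xs} → All P xs → AllPairs R xs →
      (∀ {a b} → P a → P b → R a b → S a b) → AllPairs S xs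
    allPairs-restrict [] [] _ = []
    allPairs-restrict (pa ∷ ps) (ra ∷ rs) f = All.zipWith (λ (pb , rab) → f pa pb rab) (ps , ra) ∷ allPairs-restrict ps rs f

  vertices-length : length vertices ≡ p ℕ.* q ℕ.* s
  vertices-length = begin
    length (map vertexᵗ triples)                     ≡⟨ ListP.length-map vertexᵗ triples ⟩
    length triples                                   ≡⟨ length-cartesianProduct U (cartesianProduct T W) ⟩
    length U ℕ.* length (cartesianProduct T W)       ≡⟨ cong (length U ℕ.*_) (length-cartesianProduct T W) ⟩
    length U ℕ.* (length T ℕ.* length W)             ≡⟨ cong₂ ℕ._*_ (length-range 0 p) (cong₂ ℕ._*_ (length-range p q) (length-range m s)) ⟩
    p ℕ.* (q ℕ.* s)                                  ≡⟨ ℕP.*-assoc p q s ⟨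
    p ℕ.* q ℕ.* s                                    ∎
    where open ≡-Reasoning

  triples-valid : All ValidTriple triples
  triples-valid = all-triples (λ _ _ _ v → v)

  vertices-distinct : AllPairs (λ x y → ¬ (x ≈ y)) vertices
  vertices-distinct = AllPairsP.map⁺ (allPairs-restrict triples-valid
    (UniqueP.cartesianProduct⁺ (range-unique 0 p) (UniqueP.cartesianProduct⁺ (range-unique p q) (range-unique m s)))
    (λ v v′ k≢k′ v≈v′ → k≢k′ (vertexᵗ-injective v v′ v≈v′)))

  vertices-are-vertices : All (IsVertex F) vertices
  vertices-are-vertices = AllP.map⁺ (All.map vertex-isVertex triples-valid)

  vertices-complete : ∀ x → IsVertex F x → Any (x ≈_) vertices
  vertices-complete x x-vertex = subst (Any (x ≈_)) (sym (ListP.map-∘ triples))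
    (vertex-∈-combo F-convex x-vertex weights-valid weights-sum x≈combo-weights)
    where open Decomposition (proj₁ x-vertex)

  face-vertices : HasExactlyVertices F (p ℕ.* q ℕ.* s)
  face-vertices = vertices , vertices-length , vertices-distinct , vertices-are-vertices , vertices-complete

  -- The supporting hyperplane

  Ψ : Pt r → ℚ
  Ψ x = lsum (range 1 p′) (α x) + lsum (range (p ℕ.+ q) λ-tail) (α x) + lsum (range p μ-middle) (γ x)

  Ψ-telescopes : ∀ x → Ψ x ≡ lamE x 1 - lamE x p + lamE x (p ℕ.+ q) + (muE x p - muE x m)
  Ψ-telescopes x = cong₂ _+_ (cong₂ _+_ (lsum-telescope 1 p′ (lamE x)) λ-tail-telescopes) μ-middle-telescopes
    where
    λ-tail-telescopes : lsum (range (p ℕ.+ q) λ-tail) (α x) ≡ lamE x (p ℕ.+ q)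
    λ-tail-telescopes = begin
      lsum (range (p ℕ.+ q) λ-tail) (α x)                   ≡⟨ lsum-telescope (p ℕ.+ q) λ-tail (lamE x) ⟩
      lamE x (p ℕ.+ q) - lamE x (p ℕ.+ q ℕ.+ λ-tail)        ≡⟨ cong (λ i → lamE x (p ℕ.+ q) - lamE x i) p+q+λ-tail≡1+r ⟩
      lamE x (p ℕ.+ q) - lamE x (suc r)                     ≡⟨ cong (λ a → lamE x (p ℕ.+ q) - a) (lamE-outside x r ℕP.≤-refl) ⟩
      lamE x (p ℕ.+ q) - 0ℚ                                 ≡⟨ ℚP.+-identityʳ _ ⟩
      lamE x (p ℕ.+ q)                                      ∎
      where open ≡-Reasoning
    μ-middle-telescopes : lsum (range p μ-middle) (γ x) ≡ muE x p - muE x m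
    μ-middle-telescopes = trans (lsum-telescope p μ-middle (muE x)) (cong (λ i → muE x p - muE x i) p+μ-middle≡m)

  module _ {x : Pt r} (x∈cone : KostkaCone r x) where

    private
      head-nonNeg : All (λ i → 0ℚ ≤ α x i) (range 1 p′)
      head-nonNeg = all-range 1 p′ (λ i 1≤i _ → α-nonNeg x∈cone i 1≤i)
      tail-nonNeg : All (λ i → 0ℚ ≤ α x i) (range (p ℕ.+ q) λ-tail)
      tail-nonNeg = all-range (p ℕ.+ q) λ-tail (λ i p+q≤i _ → α-nonNeg x∈cone i (ℕP.≤-trans (s≤s z≤n) p+q≤i))
      middle-nonNeg : All (λ i → 0ℚ ≤ γ x i) (range p μ-middle)
      middle-nonNeg = all-range p μ-middle (λ i p≤i _ → γ-nonNeg x∈cone i (ℕP.≤-trans (s≤s z≤n) p≤i))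

    Ψ-nonNeg : 0ℚ ≤ Ψ x
    Ψ-nonNeg = +-nonNeg (+-nonNeg (lsum-nonNegᴬ head-nonNeg) (lsum-nonNegᴬ tail-nonNeg)) (lsum-nonNegᴬ middle-nonNeg)

    Ψ≡0⇒F : coordSum x ≡ 1ℚ → Ψ x ≡ 0ℚ → F x
    Ψ≡0⇒F sum≡1 Ψ≡0 = (x∈cone , sum≡1) , head , tail , middle
      where
      split₁ : lsum (range 1 p′) (α x) + lsum (range (p ℕ.+ q) λ-tail) (α x) ≡ 0ℚ × lsum (range p μ-middle) (γ x) ≡ 0ℚ
      split₁ = nonNeg+nonNeg≡0 (+-nonNeg (lsum-nonNegᴬ head-nonNeg) (lsum-nonNegᴬ tail-nonNeg)) (lsum-nonNegᴬ middle-nonNeg) Ψ≡0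
      split₂ : lsum (range 1 p′) (α x) ≡ 0ℚ × lsum (range (p ℕ.+ q) λ-tail) (α x) ≡ 0ℚ
      split₂ = nonNeg+nonNeg≡0 (lsum-nonNegᴬ head-nonNeg) (lsum-nonNegᴬ tail-nonNeg) (proj₁ split₁)
      head : ∀ i → 1 ℕ.≤ i → i ℕ.≤ p′ → H i x
      head i 1≤i i≤p′ = p-q≡0⇒p≡q _ _ (all-range⁻ 1 p′ (lsum-nonNeg-≡0 head-nonNeg (proj₁ split₂)) i 1≤i (s≤s i≤p′))
      tail : ∀ i → p ℕ.+ q ℕ.≤ i → i ℕ.≤ r → H i x
      tail i p+q≤i i≤r = p-q≡0⇒p≡q _ _ (all-range⁻ (p ℕ.+ q) λ-tail (lsum-nonNeg-≡0 tail-nonNeg (proj₂ split₂)) i p+q≤i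
                                                   (subst (i ℕ.<_) (sym p+q+λ-tail≡1+r) (s≤s i≤r)))
      middle : ∀ k → p ℕ.≤ k → k ℕ.≤ K → Ĥ k x
      middle k p≤k k≤K = p-q≡0⇒p≡q _ _ (all-range⁻ p μ-middle (lsum-nonNeg-≡0 middle-nonNeg (proj₂ split₁)) k p≤k
                                                   (subst (k ℕ.<_) (sym p+μ-middle≡m) (s≤s k≤K)))

  F⇒Ψ≡0 : ∀ {x} → F x → Ψ x ≡ 0ℚ
  F⇒Ψ≡0 x∈F = trans (cong₂ _+_ (cong₂ _+_
      (lsum-range-zero 1 p′ (λ i 1≤i i<p → λ-head-flat i 1≤i (ℕP.≤-pred i<p)))
      (lsum-range-zero (p ℕ.+ q) λ-tail (λ i p+q≤i i< → λ-tail-flat i p+q≤i (ℕP.≤-pred (subst (i ℕ.<_) p+q+λ-tail≡1+r i<)))))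
      (lsum-range-zero p μ-middle (λ i p≤i i< → μ-middle-flat i p≤i (ℕP.≤-pred (subst (i ℕ.<_) p+μ-middle≡m i<)))))
    (trans (ℚP.+-identityʳ _) (ℚP.+-identityʳ 0ℚ))
    where open OnFace x∈F

  νλ νμ : ℕ → ℚ
  νλ i = - (𝟙[ 1 ≡ i ] - 𝟙[ p ≡ i ] + 𝟙[ p ℕ.+ q ≡ i ])
  νμ i = - (𝟙[ p ≡ i ] - 𝟙[ m ≡ i ])

  normal : Pt r
  normal = pt (λ j → νλ (suc (toℕ j))) (λ j → νμ (suc (toℕ j)))

  private
    pick : ∀ k f → 1 ℕ.≤ k → k ℕ.≤ r → lsum (range 1 r) (λ i → 𝟙[ k ≡ i ] * f i) ≡ f k
    pick k f 1≤k k≤r = lsum-range-𝟙≡ 1 r k f 1≤k (s≤s k≤r)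

  νλ-pairing : ∀ (x : Pt r) → lsum (range 1 r) (λ i → νλ i * lamE x i) ≡ - (lamE x 1 - lamE x p + lamE x (p ℕ.+ q))
  νλ-pairing x = begin
    lsum (range 1 r) (λ i → νλ i * lamE x i)
      ≡⟨ lsum-cong (range 1 r) (λ i → distribute 𝟙[ 1 ≡ i ] 𝟙[ p ≡ i ] 𝟙[ p ℕ.+ q ≡ i ] (lamE x i)) ⟩
    lsum (range 1 r) (λ i → - (𝟙[ 1 ≡ i ] * lamE x i - 𝟙[ p ≡ i ] * lamE x i + 𝟙[ p ℕ.+ q ≡ i ] * lamE x i))
      ≡⟨ lsum-neg (range 1 r) _ ⟩
    - lsum (range 1 r) (λ i → 𝟙[ 1 ≡ i ] * lamE x i - 𝟙[ p ≡ i ] * lamE x i + 𝟙[ p ℕ.+ q ≡ i ] * lamE x i)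
      ≡⟨ cong -_ (trans (lsum-distrib-+ (range 1 r) _ _) (cong₂ _+_ (lsum-distrib-- (range 1 r) _ _) refl)) ⟩
    - (lsum (range 1 r) (λ i → 𝟙[ 1 ≡ i ] * lamE x i) - lsum (range 1 r) (λ i → 𝟙[ p ≡ i ] * lamE x i)
       + lsum (range 1 r) (λ i → 𝟙[ p ℕ.+ q ≡ i ] * lamE x i))
      ≡⟨ cong -_ (cong₂ _+_ (cong₂ _-_ (pick 1 (lamE x) ℕP.≤-refl (ℕP.≤-trans (s≤s z≤n) p≤r)) (pick p (lamE x) (s≤s z≤n) p≤r))
                            (pick (p ℕ.+ q) (lamE x) (s≤s z≤n) p+q≤r)) ⟩
    - (lamE x 1 - lamE x p + lamE x (p ℕ.+ q)) ∎
    where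
    open ≡-Reasoning
    distribute : ∀ (a b c l : ℚ) → - (a - b + c) * l ≡ - (a * l - b * l + c * l)
    distribute = solve-∀ ℚ-ring

  νμ-pairing : ∀ (x : Pt r) → lsum (range 1 r) (λ i → νμ i * muE x i) ≡ - (muE x p - muE x m)
  νμ-pairing x = begin
    lsum (range 1 r) (λ i → νμ i * muE x i)
      ≡⟨ lsum-cong (range 1 r) (λ i → distribute 𝟙[ p ≡ i ] 𝟙[ m ≡ i ] (muE x i)) ⟩
    lsum (range 1 r) (λ i → - (𝟙[ p ≡ i ] * muE x i - 𝟙[ m ≡ i ] * muE x i))
      ≡⟨ lsum-neg (range 1 r) _ ⟩
    - lsum (range 1 r) (λ i → 𝟙[ p ≡ i ] * muE x i - 𝟙[ m ≡ i ] * muE x i)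
      ≡⟨ cong -_ (lsum-distrib-- (range 1 r) _ _) ⟩
    - (lsum (range 1 r) (λ i → 𝟙[ p ≡ i ] * muE x i) - lsum (range 1 r) (λ i → 𝟙[ m ≡ i ] * muE x i))
      ≡⟨ cong -_ (cong₂ _-_ (pick p (muE x) (s≤s z≤n) p≤r) (pick m (muE x) (s≤s z≤n) m≤r)) ⟩
    - (muE x p - muE x m) ∎
    where
    open ≡-Reasoning
    distribute : ∀ (a b l : ℚ) → - (a - b) * l ≡ - (a * l - b * l)
    distribute = solve-∀ ℚ-ring

  dot-normal : ∀ x → dot normal x ≡ - Ψ x
  dot-normal x = begin
    dot normal x
      ≡⟨ cong₂ _+_ (sumℚ-cong (λ j → cong (νλ (suc (toℕ j)) *_) (sym (ext-toℕ 0ℚ (lam x) j))))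
                   (sumℚ-cong (λ j → cong (νμ (suc (toℕ j)) *_) (sym (ext-toℕ 0ℚ (mu x) j)))) ⟩
    sumℚ {r} (λ j → νλ (suc (toℕ j)) * lamE x (suc (toℕ j))) + sumℚ {r} (λ j → νμ (suc (toℕ j)) * muE x (suc (toℕ j)))
      ≡⟨ cong₂ _+_ (sumℚ-tabulate r (λ i → νλ i * lamE x i)) (sumℚ-tabulate r (λ i → νμ i * muE x i)) ⟩
    lsum (range 1 r) (λ i → νλ i * lamE x i) + lsum (range 1 r) (λ i → νμ i * muE x i)
      ≡⟨ cong₂ _+_ (νλ-pairing x) (νμ-pairing x) ⟩
    - (lamE x 1 - lamE x p + lamE x (p ℕ.+ q)) + - (muE x p - muE x m)
      ≡⟨ neg-collect (lamE x 1) (lamE x p) (lamE x (p ℕ.+ q)) (muE x p) (muE x m) ⟩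
    - (lamE x 1 - lamE x p + lamE x (p ℕ.+ q) + (muE x p - muE x m))
      ≡⟨ cong -_ (Ψ-telescopes x) ⟨
    - Ψ x ∎
    where
    open ≡-Reasoning
    neg-collect : ∀ (a b c d e : ℚ) → - (a - b + c) + - (d - e) ≡ - (a - b + c + (d - e))
    neg-collect = solve-∀ ℚ-ring

  face-is-face : IsFace (KostkaPolytope r) F
  face-is-face = normal , 0ℚ , valid , on-face , back
    where
    valid : ∀ x → KostkaPolytope r x → dot normal x ≤ 0ℚ
    valid x (x∈cone , _) = subst (_≤ 0ℚ) (sym (dot-normal x)) (ℚP.neg-antimono-≤ (Ψ-nonNeg x∈cone))
    on-face : ∀ x → F x → KostkaPolytope r x × dot normal x ≡ 0ℚ
    on-face x x∈F = proj₁ x∈F , trans (dot-normal x) (cong -_ (F⇒Ψ≡0 x∈F))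
    back : ∀ x → KostkaPolytope r x → dot normal x ≡ 0ℚ → F x
    back x (x∈cone , sum≡1) dot≡0 = Ψ≡0⇒F x∈cone sum≡1 (ℚP.neg-injective (trans (sym (dot-normal x)) dot≡0))

  -- Dimension

  λ-free μ-free-head μ-free-tail : List ℕ
  λ-free = range (suc p) q′
  μ-free-head = range 1 p′
  μ-free-tail = range (suc m) s′

  lamE-at muE-at : ℕ → Pt r → ℚ
  lamE-at i y = lamE y i
  muE-at i y = muE y i

  -- Together with the constant 1 these d + 1 functionals determine every point of F affinely.
  chart : List (Pt r → ℚ)
  chart = (λ _ → 1ℚ) ∷ (map lamE-at λ-free ++ (map muE-at μ-free-head ++ map muE-at μ-free-tail))

  chart-length : length chart ≡ suc (p′ ℕ.+ q′ ℕ.+ s′)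
  chart-length = cong suc (begin
    length (map lamE-at λ-free ++ (map muE-at μ-free-head ++ map muE-at μ-free-tail))
      ≡⟨ ListP.length-++ (map lamE-at λ-free) ⟩
    length (map lamE-at λ-free) ℕ.+ length (map muE-at μ-free-head ++ map muE-at μ-free-tail)
      ≡⟨ cong (length (map lamE-at λ-free) ℕ.+_) (ListP.length-++ (map muE-at μ-free-head)) ⟩
    length (map lamE-at λ-free) ℕ.+ (length (map muE-at μ-free-head) ℕ.+ length (map muE-at μ-free-tail))
      ≡⟨ cong₂ ℕ._+_ (length-map-range lamE-at (suc p) q′) (cong₂ ℕ._+_ (length-map-range muE-at 1 p′) (length-map-range muE-at (suc m) s′)) ⟩
    q′ ℕ.+ (p′ ℕ.+ s′)
      ≡⟨ ℕP.+-assoc q′ p′ s′ ⟨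
    q′ ℕ.+ p′ ℕ.+ s′
      ≡⟨ cong (ℕ._+ s′) (ℕP.+-comm q′ p′) ⟩
    p′ ℕ.+ q′ ℕ.+ s′ ∎)
    where
    open ≡-Reasoning
    length-map-range : ∀ (f : ℕ → Pt r → ℚ) a n → length (map f (range a n)) ≡ n
    length-map-range f a zero = refl
    length-map-range f a (suc n) = cong suc (length-map-range f (suc a) n)

  module Shape {y : Pt r} (y∈F : F y) where
    open OnFace y∈F

    lamE-head : ∀ c → 1 ℕ.≤ c → c ℕ.≤ p → lamE y c ≡ lamE y 1
    lamE-head (suc c) _ c<p = trans (lamE-from-α c (ℕP.<-≤-trans c<p p≤r))
      (trans (lsum-range-cong p q (λ t p≤t _ → trans (cong (_* α y t) (𝟙-≤ (ℕP.≤-trans c<p p≤t))) (ℚP.*-identityˡ (α y t))))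
             (sym lamE-1≡A))

    lamE-tail : ∀ c → p ℕ.+ q ℕ.≤ c → c ℕ.≤ r → lamE y c ≡ 0ℚ
    lamE-tail (suc c) p+q≤c c<r = trans (lamE-from-α c c<r)
      (lsum-range-zero p q (λ t _ t<p+q → trans (cong (_* α y t) (𝟙-> (ℕP.<-≤-trans t<p+q p+q≤c))) (ℚP.*-zeroˡ (α y t))))

    muE-middle : ∀ c → p ℕ.≤ c → c ℕ.≤ m → muE y c ≡ muE y p
    muE-middle c p≤c c≤m = trans (muE≡G c p≤c c≤m) (sym (muE≡G p ℕP.≤-refl (ℕP.≤-trans (ℕP.m≤m+n p q) p+q≤m)))
      where
      muE≡G : ∀ c → p ℕ.≤ c → c ℕ.≤ m → muE y c ≡ G
      muE≡G (suc c) c<p c≤m = trans (muE-from-δγ c (ℕP.<-≤-trans c≤m m≤r)) (trans (cong₂ _+_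
        (lsum-range-zero 0 p (λ u _ u<p → trans (cong (_* δ y u) (𝟙-> (ℕP.<-≤-trans u<p c<p))) (ℚP.*-zeroˡ (δ y u))))
        (lsum-range-cong m s (λ w m≤w _ → trans (cong (_* γ y w) (𝟙-≤ (ℕP.≤-trans c≤m m≤w))) (ℚP.*-identityˡ (γ y w)))))
        (ℚP.+-identityˡ G))

    lsum-lamE-split : lsum (range 1 r) (lamE y) ≡ ℕtoℚ p * lamE y 1 + lsum λ-free (lamE y)
    lsum-lamE-split = begin
      lsum (range 1 r) (lamE y)
        ≡⟨ λ-blocks (lamE y) ⟩
      lsum (range 1 p′) (lamE y) + ((lamE y p + lsum λ-free (lamE y)) + lsum (range (p ℕ.+ q) λ-tail) (lamE y))
        ≡⟨ cong₂ (λ a b → a + ((b + lsum λ-free (lamE y)) + lsum (range (p ℕ.+ q) λ-tail) (lamE y)))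
                 (trans (lsum-range-cong 1 p′ (λ c 1≤c c<p → lamE-head c 1≤c (ℕP.<⇒≤ c<p))) (lsum-range-const 1 p′ (lamE y 1)))
                 (lamE-head p (s≤s z≤n) ℕP.≤-refl) ⟩
      ℕtoℚ p′ * lamE y 1 + ((lamE y 1 + lsum λ-free (lamE y)) + lsum (range (p ℕ.+ q) λ-tail) (lamE y))
        ≡⟨ cong (λ b → ℕtoℚ p′ * lamE y 1 + ((lamE y 1 + lsum λ-free (lamE y)) + b))
                (lsum-range-zero (p ℕ.+ q) λ-tail (λ c p+q≤c c< → lamE-tail c p+q≤c (ℕP.≤-pred (subst (c ℕ.<_) p+q+λ-tail≡1+r c<)))) ⟩
      ℕtoℚ p′ * lamE y 1 + ((lamE y 1 + lsum λ-free (lamE y)) + 0ℚ)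
        ≡⟨ collect (ℕtoℚ p′) (lamE y 1) (lsum λ-free (lamE y)) ⟩
      (1ℚ + ℕtoℚ p′) * lamE y 1 + lsum λ-free (lamE y)
        ≡⟨ cong (λ a → a * lamE y 1 + lsum λ-free (lamE y)) (ℕtoℚ-homo-+ 1 p′) ⟨
      ℕtoℚ p * lamE y 1 + lsum λ-free (lamE y) ∎
      where
      open ≡-Reasoning
      collect : ∀ (n a b : ℚ) → n * a + ((a + b) + 0ℚ) ≡ (1ℚ + n) * a + b
      collect = solve-∀ ℚ-ring

    lsum-muE-split : lsum (range 1 r) (muE y) ≡ lsum μ-free-head (muE y) + (ℕtoℚ (suc μ-middle) * muE y p + lsum μ-free-tail (muE y))
    lsum-muE-split = begin
      lsum (range 1 r) (muE y)
        ≡⟨ μ-blocks (muE y) ⟩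
      lsum μ-free-head (muE y) + (lsum (range p μ-middle) (muE y) + (muE y m + lsum μ-free-tail (muE y)))
        ≡⟨ cong₂ (λ a b → lsum μ-free-head (muE y) + (a + (b + lsum μ-free-tail (muE y))))
                 (trans (lsum-range-cong p μ-middle (λ c p≤c c< → muE-middle c p≤c (ℕP.<⇒≤ (subst (c ℕ.<_) p+μ-middle≡m c<))))
                        (lsum-range-const p μ-middle (muE y p)))
                 (muE-middle m (ℕP.≤-trans (ℕP.m≤m+n p q) p+q≤m) ℕP.≤-refl) ⟩
      lsum μ-free-head (muE y) + (ℕtoℚ μ-middle * muE y p + (muE y p + lsum μ-free-tail (muE y)))
        ≡⟨ cong (lsum μ-free-head (muE y) +_) (collect (ℕtoℚ μ-middle) (muE y p) (lsum μ-free-tail (muE y))) ⟩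
      lsum μ-free-head (muE y) + ((1ℚ + ℕtoℚ μ-middle) * muE y p + lsum μ-free-tail (muE y))
        ≡⟨ cong (λ a → lsum μ-free-head (muE y) + (a * muE y p + lsum μ-free-tail (muE y))) (ℕtoℚ-homo-+ 1 μ-middle) ⟨
      lsum μ-free-head (muE y) + (ℕtoℚ (suc μ-middle) * muE y p + lsum μ-free-tail (muE y)) ∎
      where
      open ≡-Reasoning
      collect : ∀ (n a b : ℚ) → n * a + (a + b) ≡ (1ℚ + n) * a + b
      collect = solve-∀ ℚ-ring

    lsum-lamE-twice : lsum (range 1 r) (lamE y) + lsum (range 1 r) (lamE y) ≡ 1ℚ
    lsum-lamE-twice = trans (cong₂ _+_ lsum-lamE≡A₁ lsum-lamE≡A₁) A₁+A₁≡1

    lsum-muE-twice : lsum (range 1 r) (muE y) + lsum (range 1 r) (muE y) ≡ 1ℚ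
    lsum-muE-twice = trans (cong₂ _+_ (sym lsum-lamE≡lsum-muE) (sym lsum-lamE≡lsum-muE)) lsum-lamE-twice

  module Dimension (pts : Fin (suc (suc (p′ ℕ.+ q′ ℕ.+ s′))) → Pt r) (pts∈F : ∀ j → F (pts j)) where

    private
      d : ℕ
      d = p′ ℕ.+ q′ ℕ.+ s′

      matrix : Fin (suc (suc d)) → Fin (suc d) → ℚ
      matrix j k = lookup chart (Fin.cast (sym chart-length) k) (pts j)

      dependence : Dependence matrix
      dependence = linear-dependence (suc d) matrix

    a : Fin (suc (suc d)) → ℚ
    a = proj₁ dependence

    open Evaluation a pts

    chart-annihilated : All (λ g → S g ≡ 0ℚ) chart
    chart-annihilated = subst (All (λ g → S g ≡ 0ℚ)) (ListP.tabulate-lookup chart) (AllP.tabulate⁺ {f = lookup chart} (λ i →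
      subst (λ k → S (lookup chart k) ≡ 0ℚ) (FinP.cast-involutive (sym chart-length) chart-length i)
            (proj₂ (proj₂ dependence) (Fin.cast chart-length i))))

    S-congᶠ : ∀ {g h : Pt r → ℚ} → (∀ y → F y → g y ≡ h y) → S g ≡ S h
    S-congᶠ g≡h = sumℚ-cong (λ j → cong (a j *_) (g≡h (pts j) (pts∈F j)))

    S-lsum : ∀ xs (g : ℕ → Pt r → ℚ) → S (λ y → lsum xs (λ i → g i y)) ≡ lsum xs (λ i → S (g i))
    S-lsum [] g = S-zero
    S-lsum (x ∷ xs) g = trans (S-+ (g x) (λ y → lsum xs (λ i → g i y))) (cong (S (g x) +_) (S-lsum xs g))

    S-one : S (λ _ → 1ℚ) ≡ 0ℚ
    S-one = All.head chart-annihilated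

    free-annihilated : All (λ g → S g ≡ 0ℚ) (map lamE-at λ-free ++ (map muE-at μ-free-head ++ map muE-at μ-free-tail))
    free-annihilated = All.tail chart-annihilated

    S-λ-free : ∀ c → suc p ℕ.≤ c → c ℕ.< suc p ℕ.+ q′ → S (lamE-at c) ≡ 0ℚ
    S-λ-free = all-range⁻ (suc p) q′ (AllP.map⁻ (AllP.++⁻ˡ (map lamE-at λ-free) free-annihilated))

    S-μ-free-head : ∀ c → 1 ℕ.≤ c → c ℕ.< 1 ℕ.+ p′ → S (muE-at c) ≡ 0ℚ
    S-μ-free-head = all-range⁻ 1 p′ (AllP.map⁻ (AllP.++⁻ˡ (map muE-at μ-free-head) (AllP.++⁻ʳ (map lamE-at λ-free) free-annihilated)))

    S-μ-free-tail : ∀ c → suc m ℕ.≤ c → c ℕ.< suc m ℕ.+ s′ → S (muE-at c) ≡ 0ℚ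
    S-μ-free-tail = all-range⁻ (suc m) s′ (AllP.map⁻ (AllP.++⁻ʳ (map muE-at μ-free-head) (AllP.++⁻ʳ (map lamE-at λ-free) free-annihilated)))

    S-twice-one : ∀ g → (∀ y → F y → g y + g y ≡ 1ℚ) → S g ≡ 0ℚ
    S-twice-one g twice = ℕtoℚ-suc-cancel 1 (S g) (begin
      ℕtoℚ 2 * S g      ≡⟨ two (S g) ⟩
      S g + S g         ≡⟨ S-+ g g ⟨
      S (λ y → g y + g y) ≡⟨ S-congᶠ twice ⟩
      S (λ _ → 1ℚ)      ≡⟨ S-one ⟩
      0ℚ                ∎)
      where
      open ≡-Reasoning
      two : ∀ x → ℕtoℚ 2 * x ≡ x + x
      two = solve-∀ ℚ-ring

    S-lamE-1 : S (lamE-at 1) ≡ 0ℚ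
    S-lamE-1 = ℕtoℚ-suc-cancel p′ (S (lamE-at 1)) (begin
      ℕtoℚ p * S (lamE-at 1)                                        ≡⟨ ℚP.+-identityʳ (ℕtoℚ p * S (lamE-at 1)) ⟨
      ℕtoℚ p * S (lamE-at 1) + 0ℚ                                   ≡⟨ cong (ℕtoℚ p * S (lamE-at 1) +_) (lsum-range-zero (suc p) q′ S-λ-free) ⟨
      ℕtoℚ p * S (lamE-at 1) + lsum λ-free (λ c → S (lamE-at c))    ≡⟨ cong₂ _+_ (S-*ˡ (ℕtoℚ p) (lamE-at 1)) (S-lsum λ-free lamE-at) ⟨
      S (λ y → ℕtoℚ p * lamE y 1) + S (λ y → lsum λ-free (lamE y))  ≡⟨ S-+ (λ y → ℕtoℚ p * lamE y 1) (λ y → lsum λ-free (lamE y)) ⟨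
      S (λ y → ℕtoℚ p * lamE y 1 + lsum λ-free (lamE y))            ≡⟨ S-congᶠ (λ y y∈F → Shape.lsum-lamE-split y∈F) ⟨
      S (λ y → lsum (range 1 r) (lamE y))                           ≡⟨ S-twice-one (λ y → lsum (range 1 r) (lamE y)) (λ y y∈F → Shape.lsum-lamE-twice y∈F) ⟩
      0ℚ                                                            ∎)
      where open ≡-Reasoning

    S-muE-p : S (muE-at p) ≡ 0ℚ
    S-muE-p = ℕtoℚ-suc-cancel μ-middle (S (muE-at p)) (begin
      ℕtoℚ (suc μ-middle) * S (muE-at p)
        ≡⟨ surround (lsum-range-zero 1 p′ S-μ-free-head) (lsum-range-zero (suc m) s′ S-μ-free-tail) ⟨
      lsum μ-free-head (λ c → S (muE-at c)) + (ℕtoℚ (suc μ-middle) * S (muE-at p) + lsum μ-free-tail (λ c → S (muE-at c)))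
        ≡⟨ cong₂ _+_ (S-lsum μ-free-head muE-at) (cong₂ _+_ (S-*ˡ (ℕtoℚ (suc μ-middle)) (muE-at p)) (S-lsum μ-free-tail muE-at)) ⟨
      S (λ y → lsum μ-free-head (muE y)) + (S (λ y → ℕtoℚ (suc μ-middle) * muE y p) + S (λ y → lsum μ-free-tail (muE y)))
        ≡⟨ trans (cong (S (λ y → lsum μ-free-head (muE y)) +_) (sym (S-+ (λ y → ℕtoℚ (suc μ-middle) * muE y p) (λ y → lsum μ-free-tail (muE y)))))
                 (sym (S-+ (λ y → lsum μ-free-head (muE y)) (λ y → ℕtoℚ (suc μ-middle) * muE y p + lsum μ-free-tail (muE y)))) ⟩
      S (λ y → lsum μ-free-head (muE y) + (ℕtoℚ (suc μ-middle) * muE y p + lsum μ-free-tail (muE y)))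
        ≡⟨ S-congᶠ (λ y y∈F → Shape.lsum-muE-split y∈F) ⟨
      S (λ y → lsum (range 1 r) (muE y))
        ≡⟨ S-twice-one (λ y → lsum (range 1 r) (muE y)) (λ y y∈F → Shape.lsum-muE-twice y∈F) ⟩
      0ℚ ∎)
      where
      open ≡-Reasoning
      surround : ∀ {a b c} → a ≡ 0ℚ → c ≡ 0ℚ → a + (b + c) ≡ b
      surround {b = b} refl refl = trans (ℚP.+-identityˡ _) (ℚP.+-identityʳ b)

    S-lamE : ∀ c → 1 ℕ.≤ c → c ℕ.≤ r → S (lamE-at c) ≡ 0ℚ
    S-lamE c 1≤c c≤r with c ℕ.≤? p
    ... | yes c≤p = trans (S-congᶠ (λ y y∈F → Shape.lamE-head y∈F c 1≤c c≤p)) S-lamE-1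
    ... | no c≰p with p ℕ.+ q ℕ.≤? c
    ...   | yes p+q≤c = trans (S-congᶠ (λ y y∈F → Shape.lamE-tail y∈F c p+q≤c c≤r)) S-zero
    ...   | no p+q≰c = S-λ-free c (ℕP.≰⇒> c≰p) (subst (c ℕ.<_) (cong suc (ℕP.+-suc p′ q′)) (ℕP.≰⇒> p+q≰c))

    S-muE : ∀ c → 1 ℕ.≤ c → c ℕ.≤ r → S (muE-at c) ≡ 0ℚ
    S-muE c 1≤c c≤r with c ℕ.≤? p′
    ... | yes c≤p′ = S-μ-free-head c 1≤c (s≤s c≤p′)
    ... | no c≰p′ with c ℕ.≤? m
    ...   | yes c≤m = trans (S-congᶠ (λ y y∈F → Shape.muE-middle y∈F c (ℕP.≰⇒> c≰p′) c≤m)) S-muE-p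
    ...   | no c≰m = S-μ-free-tail c (ℕP.≰⇒> c≰m) (subst (c ℕ.<_) (sym (cong suc m+s′≡r)) (s≤s c≤r))
      where
      m+s′≡r : m ℕ.+ s′ ≡ r
      m+s′≡r = trans (sym (ℕP.+-suc K s′)) K+s≡r

    dependence-nontrivial : ¬ (∀ j → a j ≡ 0ℚ)
    dependence-nontrivial = proj₁ (proj₂ dependence)

    weights-sum-zero : sumℚ a ≡ 0ℚ
    weights-sum-zero = trans (sumℚ-cong (λ j → sym (ℚP.*-identityʳ (a j)))) S-one

  face-dimension : DimAtMost (p′ ℕ.+ q′ ℕ.+ s′) F
  face-dimension pts pts∈F = a , dependence-nontrivial , weights-sum-zero , λ i →
    trans (sumℚ-cong (λ j → cong (a j *_) (sym (ext-toℕ 0ℚ (lam (pts j)) i)))) (S-lamE (suc (toℕ i)) (s≤s z≤n) (FinP.toℕ<n i)) ,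
    trans (sumℚ-cong (λ j → cong (a j *_) (sym (ext-toℕ 0ℚ (mu (pts j)) i)))) (S-muE (suc (toℕ i)) (s≤s z≤n) (FinP.toℕ<n i))
    where open Dimension pts pts∈F

open import Data.Nat using (ℕ; _+_; _*_; _<_; _≤_)

private
  face-parameters : ∀ {d r p′ q′ s′} → d + 1 < r → suc p′ + suc q′ + suc s′ ≡ d + 3 →
    p′ + suc q′ + suc s′ ≤ r × p′ + q′ + s′ ≡ d
  face-parameters {d} {r} {p′} {q′} {s′} d+1<r sum≡ =
    subst (_≤ r) (sym size≡) (subst (λ k → suc k ≤ r) (ℕP.+-comm d 1) d+1<r) ,
    ℕP.suc-injective (ℕP.suc-injective (trans (sym size-suc) size≡))
    where
    size≡ : p′ + suc q′ + suc s′ ≡ suc (suc d)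
    size≡ = ℕP.suc-injective (trans sum≡ (ℕP.+-comm d 3))
    size-suc : p′ + suc q′ + suc s′ ≡ suc (suc (p′ + q′ + s′))
    size-suc = trans (ℕP.+-suc (p′ + suc q′) s′) (cong (λ k → suc (k + s′)) (ℕP.+-suc p′ q′))

theorem3p7 : (d r z₁ z₂ z₃ : ℕ) → d + 1 < r
    → 1 ≤ z₁ → 1 ≤ z₂ → 1 ≤ z₃ → z₁ + z₂ + z₃ ≡ d + 3
    → IsFace (KostkaPolytope r) (FaceF r z₁ z₂ z₃)
      × DimAtMost d (FaceF r z₁ z₂ z₃)
      × HasExactlyVertices (FaceF r z₁ z₂ z₃) (z₁ * z₂ * z₃)
theorem3p7 d r (suc p′) (suc q′) (suc s′) d+1<r (s≤s z≤n) (s≤s z≤n) (s≤s z≤n) sum≡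
  with face-parameters d+1<r sum≡
... | fits , p′+q′+s′≡d = face-is-face , subst (λ k → DimAtMost k F) p′+q′+s′≡d face-dimension , face-vertices
  where open Face r p′ q′ s′ fits
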